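{- Let $m\ge1$ and $n\ge1$. Let $S_{m,n}\subset\mathbb{C}$ consist of real points $-1=x_0<x_1<\dots<x_m<x_{m+1}=1$ and points $y_j=e^{i\theta_j}$ with $\pi>\theta_1>\theta_2>\dots>\theta_n>0$. Let $A$ be the subposet of $\textsc{NC}(S_{m,n})$ consisting of all partitions in which $x_{m+1}$ is either a singleton block or lies in the same block as $x_m$. For each $k\in\{1,\dots,n\}$ let $B_k$ be the subposet of $\textsc{NC}(S_{m,n})$ consisting of all partitions in which $x_{m+1}$ lies in the same block as $y_k$ but not in the same block as any of $x_m,y_1,\dots,y_{k-1}$. Then (1) $A$ is isomorphic to $\textsc{NC}(S_{m-1,n})\times\textsc{Bool}(1)$; (2) $B_k$ is isomorphic to $\textsc{NC}(S_{m-1,k-1})\times\textsc{NC}(n-k+1)$; and $\textsc{NC}(S_{m,n})$ is the disjoint union of $A,B_1,\dots,B_n$.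
   Context: For a finite set $P\subset\mathbb{C}$, a partition of $P$ is noncrossing if the convex hulls of its blocks are pairwise disjoint; $\textsc{NC}(P)$ is the set of noncrossing partitions of $P$ ordered by refinement ($\pi\le\mu$ iff every block of $\mu$ is a union of blocks of $\pi$). For nonnegative $a,b$, $S_{a,b}$ denotes a semicircular configuration: $a+2$ points on the segment $[-1,1]$ including both endpoints, and $b$ points on the open upper unit semicircle; the isomorphism type of $\textsc{NC}(S_{a,b})$ depends only on $a,b$. $\textsc{NC}(r)$ denotes the classical noncrossing partition lattice, i.e. $\textsc{NC}$ of the vertex set of a convex $r$-gon. $\textsc{Bool}(1)$ is the two-element chain (subsets of $\{1\}$). Subposets carry the induced order; products carry the componentwise order. The ordering of the $y_j$ by decreasing argument is the one for which the stated isomorphisms hold (the paper just says the points lie on the upper semicircle). -}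

module Defs where

open import Level using (0ℓ)
open import Data.Nat using (ℕ; zero; suc) renaming (_+_ to _+ℕ_)
open import Data.Fin using (Fin; zero; suc; fromℕ; inject₁; _↑ˡ_; _↑ʳ_; splitAt)
  renaming (_<_ to _<ᶠ_)
open import Data.Fin.Properties using () renaming (_≟_ to _≟ᶠ_)
open import Data.Bool using (Bool; true; false; T; not)
open import Data.Product using (Σ; _×_; _,_; proj₁; proj₂)
open import Data.Sum using (_⊎_; [_,_])
open import Data.Empty using (⊥)
open import Relation.Nullary using (¬_)
open import Relation.Nullary.Decidable using (⌊_⌋)
open import Relation.Binary.PropositionalEquality using (_≡_; _≢_)
open import Relation.Binary.Structures using (IsStrictTotalOrder)
open import Algebra.Structures using (IsCommutativeRing)

-- An ordered field (stand-in for ℝ, which agda-stdlib lacks).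
-- ℝ is an instance.

record OrderedField : Set₁ where
  infixl 6 _+_
  infixl 7 _*_
  infix 4 _<_
  field
    Carrier : Set
    _+_ _*_ : Carrier → Carrier → Carrier
    -_      : Carrier → Carrier
    0# 1#   : Carrier
    _<_     : Carrier → Carrier → Set
    isCommutativeRing  : IsCommutativeRing _≡_ _+_ _*_ -_ 0# 1#
    inverse            : ∀ x → x ≢ 0# → Σ Carrier (λ y → x * y ≡ 1#)
    isStrictTotalOrder : IsStrictTotalOrder _≡_ _<_
    +-mono-<           : ∀ a b c → a < b → a + c < b + c
    *-pos              : ∀ a b → 0# < a → 0# < b → 0# < a * b
    0<1                : 0# < 1#

  _≤_ : Carrier → Carrier → Set
  a ≤ b = (a < b) ⊎ (a ≡ b)

-- Preorders ("posets" whose equality is mutual ≤) and isomorphisms.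

record Pre : Set₁ where
  field
    Elt : Set
    _⊑_     : Elt → Elt → Set

open Pre

Equiv : (P : Pre) → Elt P → Elt P → Set
Equiv P a b = _⊑_ P a b × _⊑_ P b a

record _≅_ (P Q : Pre) : Set where
  field
    to      : Elt P → Elt Q
    from    : Elt Q → Elt P
    to-mono   : ∀ a b → _⊑_ P a b → _⊑_ Q (to a) (to b)
    from-mono : ∀ a b → _⊑_ Q a b → _⊑_ P (from a) (from b)
    from-to : ∀ a → Equiv P (from (to a)) a
    to-from : ∀ b → Equiv Q (to (from b)) b

Sub : (P : Pre) → (Elt P → Set) → Pre
Sub P S = record { Elt = Σ (Elt P) S ; _⊑_ = λ a b → _⊑_ P (proj₁ a) (proj₁ b) }

_⊗_ : Pre → Pre → Pre
P ⊗ Q = record { Elt = Elt P × Elt Q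
               ; _⊑_ = λ a b → _⊑_ P (proj₁ a) (proj₁ b) × _⊑_ Q (proj₂ a) (proj₂ b) }

-- Bool(1): subsets of {1} ordered by inclusion
Bool1 : Pre
Bool1 = record { Elt = Bool ; _⊑_ = λ b c → T b → T c }

record Partition (N : ℕ) : Set where
  field
    rel   : Fin N → Fin N → Bool
    reflR  : ∀ i → T (rel i i)
    symR   : ∀ i j → T (rel i j) → T (rel j i)
    transR : ∀ i j k → T (rel i j) → T (rel j k) → T (rel i k)

open Partition public

module Geometry (F : OrderedField) where
  open OrderedField F

  Pt : Set
  Pt = Carrier × Carrier     -- (real part , imaginary part)

  sumF : ∀ {N} → (Fin N → Carrier) → Carrier
  sumF {zero}  f = 0#
  sumF {suc N} f = f zero + sumF (λ i → f (suc i))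

  InHull : ∀ {N} → (Fin N → Pt) → (Fin N → Bool) → Pt → Set
  InHull {N} pos S z = Σ (Fin N → Carrier) λ w →
      (∀ i → 0# ≤ w i)
    × (∀ i → S i ≡ false → w i ≡ 0#)
    × (sumF w ≡ 1#)
    × (sumF (λ i → w i * proj₁ (pos i)) ≡ proj₁ z)
    × (sumF (λ i → w i * proj₂ (pos i)) ≡ proj₂ z)

  NonCrossing : ∀ {N} → (Fin N → Pt) → Partition N → Set
  NonCrossing pos π = ∀ i j → T (not (rel π i j)) → ∀ z →
    InHull pos (rel π i) z → InHull pos (rel π j) z → ⊥

  NC : ∀ {N} → (Fin N → Pt) → Pre
  NC {N} pos = record
    { Elt = Σ (Partition N) (NonCrossing pos)
    ; _⊑_ = λ π μ → ∀ i j → T (rel (proj₁ π) i j) → T (rel (proj₁ μ) i j) }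

  -- vertex set of a convex r-gon: no point lies in the hull of the others
  ConvexPosition : ∀ {r} → (Fin r → Pt) → Set
  ConvexPosition {r} q = ∀ i → ¬ InHull q (λ j → not ⌊ j ≟ᶠ i ⌋) (q i)

  -- semicircular configuration S_{a,b}:
  -- x 0 = -1 < x 1 < ... < x (a+1) = 1 on the real segment,
  -- y j = (u j , v j) on the open upper unit semicircle, with arguments
  -- strictly decreasing in j (equivalently real parts strictly increasing).
  record SemiConf (a b : ℕ) : Set where
    field
      xs    : Fin (suc (suc a)) → Carrier
      ys    : Fin b → Pt
      x-first : xs zero ≡ - 1#
      x-last  : xs (fromℕ (suc a)) ≡ 1#
      x-inc   : ∀ i j → i <ᶠ j → xs i < xs j
      y-unit  : ∀ j → proj₁ (ys j) * proj₁ (ys j) + proj₂ (ys j) * proj₂ (ys j) ≡ 1#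
      y-upper : ∀ j → 0# < proj₂ (ys j)
      y-arg-dec : ∀ i j → i <ᶠ j → proj₁ (ys i) < proj₁ (ys j)

    pos : Fin (suc (suc a) +ℕ b) → Pt
    pos p = [ (λ i → xs i , 0#) , ys ] (splitAt (suc (suc a)) p)

  open SemiConf public

  NCS : ∀ {a b} → SemiConf a b → Pre
  NCS C = NC (pos C)

  X : ∀ {a b} → Fin (suc (suc a)) → Fin (suc (suc a) +ℕ b)
  X {b = b} i = i ↑ˡ b

  Y : ∀ {a b} → Fin b → Fin (suc (suc a) +ℕ b)
  Y {a} j = suc (suc a) ↑ʳ j

  xLast : ∀ {m b} → Fin (suc (suc m) +ℕ b)
  xLast {m} = X (fromℕ (suc m))

  xPen : ∀ {m b} → Fin (suc (suc m) +ℕ b)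
  xPen {m} = X (inject₁ (fromℕ m))

  InA : ∀ {m n} (C : SemiConf m n) → Elt (NCS C) → Set
  InA {m} {n} C (π , _) =
      (∀ j → T (rel π (xLast {m} {n}) j) → j ≡ xLast {m} {n})
    ⊎ T (rel π (xLast {m} {n}) (xPen {m} {n}))

  -- the subposet B_k (k : Fin n is 0-based, so y_k of the paper is Y k,
  -- and y_1..y_{k-1} are Y j with j < k)
  InB : ∀ {m n} (C : SemiConf m n) → Fin n → Elt (NCS C) → Set
  InB {m} {n} C k (π , _) =
      T (rel π (xLast {m} {n}) (Y {m} k))
    × ¬ T (rel π (xLast {m} {n}) (xPen {m} {n}))
    × (∀ j → j <ᶠ k → ¬ T (rel π (xLast {m} {n}) (Y {m} j)))

{-# OPTIONS --safe #-}
-- Noncrossing is defined by disjoint convex hulls. For points listed counterclockwise around their hull, an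
-- initial run of them collinear, it is equivalent to a condition on ranks alone: no two blocks cross, and blocks
-- meet the collinear run in intervals. Crossing diagonals meet in a common point, and otherwise a line through
-- two points of one block separates the two blocks. S_{a,b} (with the xᵢ as collinear run) and convex polygons
-- are such configurations, and in terms of ranks the lemma is bookkeeping: a partition in A is one of
-- NC(S_{m−1,n}) with x_{m+1} merged into the block of x_m or isolated, and a partition in B_k is cut by the chord
-- x_{m+1} y_k into a partition of x₀ … x_m, y₁ … y_{k−1} and one of the polygon x_{m+1}, y_{k+1}, …, y_n.
module Submission where

open import Defs
open import Algebra.Bundles using (CommutativeRing)
open import Data.Bool using (Bool; true; false; T; not)
open import Data.Empty using (⊥; ⊥-elim)
open import Data.Fin using (Fin; zero; suc; toℕ; fromℕ; fromℕ<; inject₁; inject≤; lower₁; punchOut; splitAt; join) renaming (_<_ to _<ᶠ_)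
import Data.Fin.Properties as FP
open import Data.Integer as ℤ using (ℤ; -[1+_]; sign; ∣_∣; _◃_; 0ℤ; 1ℤ)
import Data.Integer.Properties as ℤP
open import Data.Maybe using (Maybe; just; nothing)
open import Data.Nat as ℕ using (ℕ; zero; suc; _∸_; _⊓_; s≤s; z≤n) renaming (_<_ to _<ℕ_; _≤_ to _≤ℕ_; _+_ to _+ℕ_)
import Data.Nat.Properties as ℕP
open import Data.Product using (Σ; _×_; _,_; proj₁; proj₂)
open import Data.Sign as Sign using (Sign)
open import Data.Sum using (_⊎_; inj₁; inj₂; [_,_])
open import Data.Unit using (tt)
open import Relation.Binary.Definitions using (Tri; Trichotomous; tri<; tri≈; tri>)
open import Relation.Binary.Structures using (IsStrictTotalOrder)
open import Relation.Binary.PropositionalEquality hiding ([_])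
open import Relation.Nullary using (¬_; Dec; yes; no)
open import Relation.Nullary.Decidable using (⌊_⌋; T?; _×-dec_)

module RingSolver (F : OrderedField) where
  open import Algebra.Solver.Ring.AlmostCommutativeRing
  open OrderedField F public

  commutativeRing : CommutativeRing _ _
  commutativeRing = record { isCommutativeRing = isCommutativeRing }

  open CommutativeRing commutativeRing public
    using (+-assoc; +-comm; *-comm; *-commutativeSemigroup; distribˡ; distribʳ; +-identityˡ; +-identityʳ; *-identityˡ; *-identityʳ;
           -‿inverseˡ; -‿inverseʳ; zeroˡ; zeroʳ; ring; semiring)
  open import Algebra.Properties.Ring ring public using (-‿involutive; -0#≈0#; -‿+-comm; -‿distribˡ-*; -1*x≈-x)
  open import Algebra.Properties.CommutativeSemigroup *-commutativeSemigroup using (interchange)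
  open import Algebra.Properties.Semiring.Mult.TCOptimised semiring using (×-homo-+; ×1-homo-*; 1+×) renaming (_×_ to _×ₙ_)

  -- The ring solver normalises coefficients, so it needs them from a ring with decidable equality: ℤ, via fromℤ.
  fromℤ : ℤ → Carrier
  fromℤ (ℤ.+ n) = n ×ₙ 1#
  fromℤ -[1+ n ] = - (suc n ×ₙ 1#)

  fromSign : Sign → Carrier
  fromSign Sign.+ = 1#
  fromSign Sign.- = - 1#

  fromℤ-◃ : ∀ s n → fromℤ (s ◃ n) ≡ fromSign s * (n ×ₙ 1#)
  fromℤ-◃ Sign.+ n rewrite ℤP.+◃n≡+n n = sym (*-identityˡ _)
  fromℤ-◃ Sign.- zero = sym (trans (sym (-‿distribˡ-* 1# 0#)) (trans (cong -_ (zeroʳ 1#)) -0#≈0#))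
  fromℤ-◃ Sign.- (suc n) = sym (-1*x≈-x _)

  fromℤ-sign-abs : ∀ i → fromℤ i ≡ fromSign (sign i) * (∣ i ∣ ×ₙ 1#)
  fromℤ-sign-abs i = trans (cong fromℤ (sym (ℤP.◃-inverse i))) (fromℤ-◃ (sign i) ∣ i ∣)

  fromSign-* : ∀ s t → fromSign (s Sign.* t) ≡ fromSign s * fromSign t
  fromSign-* Sign.+ Sign.+ = sym (*-identityˡ _)
  fromSign-* Sign.+ Sign.- = sym (*-identityˡ _)
  fromSign-* Sign.- Sign.+ = sym (*-identityʳ _)
  fromSign-* Sign.- Sign.- = sym (trans (-1*x≈-x (- 1#)) (-‿involutive 1#))

  *-homo : ∀ i j → fromℤ (i ℤ.* j) ≡ fromℤ i * fromℤ j
  *-homo i j = begin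
    fromℤ (sign i Sign.* sign j ◃ ∣ i ∣ ℕ.* ∣ j ∣) ≡⟨ fromℤ-◃ (sign i Sign.* sign j) (∣ i ∣ ℕ.* ∣ j ∣) ⟩
    fromSign (sign i Sign.* sign j) * ((∣ i ∣ ℕ.* ∣ j ∣) ×ₙ 1#) ≡⟨ cong₂ _*_ (fromSign-* (sign i) (sign j)) (×1-homo-* ∣ i ∣ ∣ j ∣) ⟩
    (fromSign (sign i) * fromSign (sign j)) * ((∣ i ∣ ×ₙ 1#) * (∣ j ∣ ×ₙ 1#)) ≡⟨ interchange _ _ _ _ ⟩
    (fromSign (sign i) * (∣ i ∣ ×ₙ 1#)) * (fromSign (sign j) * (∣ j ∣ ×ₙ 1#)) ≡⟨ sym (cong₂ _*_ (fromℤ-sign-abs i) (fromℤ-sign-abs j)) ⟩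
    fromℤ i * fromℤ j ∎
    where open ≡-Reasoning

  fromℤ-⊖ : ∀ a b → fromℤ (a ℤ.⊖ b) ≡ (a ×ₙ 1#) + - (b ×ₙ 1#)
  fromℤ-⊖ zero zero = sym (trans (+-identityˡ _) -0#≈0#)
  fromℤ-⊖ (suc a) zero = sym (trans (cong (λ z → (suc a ×ₙ 1#) + z) -0#≈0#) (+-identityʳ _))
  fromℤ-⊖ zero (suc b) = sym (+-identityˡ _)
  fromℤ-⊖ (suc a) (suc b) = begin
    fromℤ (suc a ℤ.⊖ suc b) ≡⟨ cong fromℤ (ℤP.[1+m]⊖[1+n]≡m⊖n a b) ⟩
    fromℤ (a ℤ.⊖ b) ≡⟨ fromℤ-⊖ a b ⟩
    A + - B ≡⟨ sym (cong (_+ - B) (+-identityˡ A)) ⟩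
    (0# + A) + - B ≡⟨ cong (λ z → (z + A) + - B) (sym (-‿inverseʳ 1#)) ⟩
    ((1# + - 1#) + A) + - B ≡⟨ cong (_+ - B) (+-assoc 1# (- 1#) A) ⟩
    (1# + (- 1# + A)) + - B ≡⟨ cong (λ z → (1# + z) + - B) (+-comm (- 1#) A) ⟩
    (1# + (A + - 1#)) + - B ≡⟨ cong (_+ - B) (sym (+-assoc 1# A (- 1#))) ⟩
    ((1# + A) + - 1#) + - B ≡⟨ +-assoc (1# + A) (- 1#) (- B) ⟩
    (1# + A) + (- 1# + - B) ≡⟨ cong ((1# + A) +_) (-‿+-comm 1# B) ⟩
    (1# + A) + - (1# + B) ≡⟨ sym (cong₂ (λ u v → u + - v) (1+× a 1#) (1+× b 1#)) ⟩
    (suc a ×ₙ 1#) + - (suc b ×ₙ 1#) ∎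
    where
    open ≡-Reasoning
    A = a ×ₙ 1#
    B = b ×ₙ 1#

  +-homo : ∀ i j → fromℤ (i ℤ.+ j) ≡ fromℤ i + fromℤ j
  +-homo -[1+ m ] -[1+ n ] = begin
    - (suc (suc (m ℕ.+ n)) ×ₙ 1#) ≡⟨ cong (λ z → - (z ×ₙ 1#)) (cong suc (sym (ℕP.+-suc m n))) ⟩
    - ((suc m ℕ.+ suc n) ×ₙ 1#) ≡⟨ cong -_ (×-homo-+ 1# (suc m) (suc n)) ⟩
    - ((suc m ×ₙ 1#) + (suc n ×ₙ 1#)) ≡⟨ sym (-‿+-comm _ _) ⟩
    - (suc m ×ₙ 1#) + - (suc n ×ₙ 1#) ∎
    where open ≡-Reasoning
  +-homo -[1+ m ] (ℤ.+ n) = trans (fromℤ-⊖ n (suc m)) (+-comm _ _)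
  +-homo (ℤ.+ m) -[1+ n ] = fromℤ-⊖ m (suc n)
  +-homo (ℤ.+ m) (ℤ.+ n) = ×-homo-+ 1# m n

  -homo : ∀ i → fromℤ (ℤ.- i) ≡ - fromℤ i
  -homo -[1+ n ] = sym (-‿involutive _)
  -homo (ℤ.+ zero) = sym -0#≈0#
  -homo (ℤ.+ suc n) = refl

  almostCommutativeRing : AlmostCommutativeRing _ _
  almostCommutativeRing = fromCommutativeRing commutativeRing

  fromℤ-morphism : ℤ.+-*-rawRing -Raw-AlmostCommutative⟶ almostCommutativeRing
  fromℤ-morphism = record
    { ⟦_⟧ = fromℤ ; +-homo = +-homo ; *-homo = *-homo ; -‿homo = -homo
    ; 0-homo = refl ; 1-homo = refl }

  fromℤ-≟ : (i j : ℤ) → Maybe (fromℤ i ≡ fromℤ j)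
  fromℤ-≟ i j with i ℤ.≟ j
  ... | yes p = just (cong fromℤ p)
  ... | no _ = nothing

  open import Algebra.Solver.Ring ℤ.+-*-rawRing almostCommutativeRing fromℤ-morphism fromℤ-≟ public using (solve; _:=_; _:+_; _:*_; _:-_; :-_; con)

module OrderedFieldProperties (F : OrderedField) where
  open RingSolver F public

  module STO = IsStrictTotalOrder isStrictTotalOrder

  infixl 6 _-_
  _-_ : Carrier → Carrier → Carrier
  a - b = a + - b

  compare : Trichotomous _≡_ _<_
  compare = STO.compare

  <-irrefl : ∀ {a} → a < a → ⊥
  <-irrefl p = STO.irrefl refl p

  <-trans : ∀ {a b c} → a < b → b < c → a < c
  <-trans = STO.trans

  <⇒≢ : ∀ {a b} → a < b → a ≢ b
  <⇒≢ p refl = <-irrefl p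

  <-asym : ∀ {a b} → a < b → b < a → ⊥
  <-asym p q = <-irrefl (<-trans p q)

  ≤-refl : ∀ {a} → a ≤ a
  ≤-refl = inj₂ refl

  <-≤-trans : ∀ {a b c} → a < b → b ≤ c → a < c
  <-≤-trans p (inj₁ q) = <-trans p q
  <-≤-trans p (inj₂ refl) = p

  ≮⇒≥ : ∀ {a b} → ¬ (a < b) → b ≤ a
  ≮⇒≥ {a} {b} a≮b with compare a b
  ... | tri< a<b _ _ = ⊥-elim (a≮b a<b)
  ... | tri≈ _ a≡b _ = inj₂ (sym a≡b)
  ... | tri> _ _ b<a = inj₁ b<a

  ≤⇒≯ : ∀ {a b} → a ≤ b → b < a → ⊥
  ≤⇒≯ (inj₁ p) q = <-asym p q
  ≤⇒≯ (inj₂ refl) q = <-irrefl q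

  x-y+y≡x : ∀ x y → (x - y) + y ≡ x
  x-y+y≡x = solve 2 (λ x y → ((x :- y) :+ y) := x) refl

  x<y⇒0<y-x : ∀ {x y} → x < y → 0# < y - x
  x<y⇒0<y-x {x} {y} p = subst₂ _<_ (-‿inverseʳ x) refl (+-mono-< x y (- x) p)

  0<y-x⇒x<y : ∀ {x y} → 0# < y - x → x < y
  0<y-x⇒x<y {x} {y} p = subst₂ _<_ (+-identityˡ x) (x-y+y≡x y x) (+-mono-< 0# (y - x) x p)

  x≤y⇒0≤y-x : ∀ {x y} → x ≤ y → 0# ≤ (y - x)
  x≤y⇒0≤y-x (inj₁ p) = inj₁ (x<y⇒0<y-x p)
  x≤y⇒0≤y-x {x} (inj₂ refl) = inj₂ (sym (-‿inverseʳ x))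

  x<0⇒0<-x : ∀ {x} → x < 0# → 0# < - x
  x<0⇒0<-x {x} p = subst (0# <_) (solve 1 (λ x → (con 0ℤ :- x) := :- x) refl x) (x<y⇒0<y-x p)

  0<-x⇒x<0 : ∀ {x} → 0# < - x → x < 0#
  0<-x⇒x<0 {x} p = 0<y-x⇒x<y (subst (0# <_) (solve 1 (λ x → (:- x) := (con 0ℤ :- x)) refl x) p)

  0<x⇒-x<0 : ∀ {x} → 0# < x → - x < 0#
  0<x⇒-x<0 {x} p = 0<-x⇒x<0 (subst (0# <_) (sym (-‿involutive x)) p)

  x≤0⇒0≤-x : ∀ {x} → x ≤ 0# → 0# ≤ (- x)
  x≤0⇒0≤-x (inj₁ p) = inj₁ (x<0⇒0<-x p)
  x≤0⇒0≤-x (inj₂ refl) = inj₂ (sym -0#≈0#)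

  +-pos : ∀ {a b} → 0# < a → 0# < b → 0# < a + b
  +-pos {a} {b} p q = <-trans q (subst₂ _<_ (+-identityˡ b) refl (+-mono-< 0# a b p))

  +-nonneg-pos : ∀ {a b} → 0# ≤ a → 0# < b → 0# < a + b
  +-nonneg-pos (inj₁ p) q = +-pos p q
  +-nonneg-pos {b = b} (inj₂ refl) q = subst (0# <_) (sym (+-identityˡ b)) q

  +-pos-nonneg : ∀ {a b} → 0# < a → 0# ≤ b → 0# < a + b
  +-pos-nonneg {a} {b} p q = subst (0# <_) (+-comm b a) (+-nonneg-pos q p)

  +-nonneg : ∀ {a b} → 0# ≤ a → 0# ≤ b → 0# ≤ (a + b)
  +-nonneg p (inj₁ q) = inj₁ (+-nonneg-pos p q)
  +-nonneg {a} p (inj₂ refl) = subst (0# ≤_) (sym (+-identityʳ a)) p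

  *-nonneg : ∀ {a b} → 0# ≤ a → 0# ≤ b → 0# ≤ (a * b)
  *-nonneg (inj₁ p) (inj₁ q) = inj₁ (*-pos _ _ p q)
  *-nonneg {a} (inj₁ p) (inj₂ refl) = inj₂ (sym (zeroʳ a))
  *-nonneg {b = b} (inj₂ refl) q = inj₂ (sym (zeroˡ b))

  *-pos-neg : ∀ {a b} → 0# < a → b < 0# → a * b < 0#
  *-pos-neg {a} {b} p q =
    0<-x⇒x<0 (subst (0# <_) (solve 2 (λ a b → (a :* (:- b)) := (:- (a :* b))) refl a b) (*-pos _ _ p (x<0⇒0<-x q)))

  *-neg-neg : ∀ {a b} → a < 0# → b < 0# → 0# < a * b
  *-neg-neg {a} {b} p q =
    subst (0# <_) (solve 2 (λ a b → ((:- a) :* (:- b)) := (a :* b)) refl a b) (*-pos _ _ (x<0⇒0<-x p) (x<0⇒0<-x q))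

  square-pos : ∀ {a} → a ≢ 0# → 0# < a * a
  square-pos {a} a≢0 with compare a 0#
  ... | tri< a<0 _ _ = *-neg-neg a<0 a<0
  ... | tri≈ _ a≡0 _ = ⊥-elim (a≢0 a≡0)
  ... | tri> _ _ 0<a = *-pos _ _ 0<a 0<a

  square-nonneg : ∀ a → 0# ≤ (a * a)
  square-nonneg a with compare a 0#
  ... | tri≈ _ refl _ = inj₂ (sym (zeroˡ 0#))
  ... | tri< _ a≢0 _ = inj₁ (square-pos a≢0)
  ... | tri> _ a≢0 _ = inj₁ (square-pos a≢0)

  pos⇒≢0 : ∀ {a} → 0# < a → a ≢ 0#
  pos⇒≢0 p e = <-irrefl (subst (0# <_) e p)

  1≢0 : 1# ≢ 0#
  1≢0 = pos⇒≢0 0<1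

  *-cancelˡ-pos : ∀ {c a} → 0# < c → 0# < c * a → 0# < a
  *-cancelˡ-pos {c} {a} p q with compare a 0#
  ... | tri< a<0 _ _ = ⊥-elim (<-asym q (*-pos-neg p a<0))
  ... | tri≈ _ refl _ = ⊥-elim (<-irrefl (subst (0# <_) (zeroʳ c) q))
  ... | tri> _ _ 0<a = 0<a

  inv : (a : Carrier) → 0# < a → Carrier
  inv a p = proj₁ (inverse a (pos⇒≢0 p))

  inv-inverseʳ : ∀ a (p : 0# < a) → a * inv a p ≡ 1#
  inv-inverseʳ a p = proj₂ (inverse a (pos⇒≢0 p))

  inv-pos : ∀ a (p : 0# < a) → 0# < inv a p
  inv-pos a p = *-cancelˡ-pos p (subst (0# <_) (sym (inv-inverseʳ a p)) 0<1)

module ConvexHull (F : OrderedField) where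
  open OrderedFieldProperties F public
  open Geometry F public

  sumF-cong : ∀ {N} {f g : Fin N → Carrier} → (∀ i → f i ≡ g i) → sumF f ≡ sumF g
  sumF-cong {zero} e = refl
  sumF-cong {suc N} e = cong₂ _+_ (e zero) (sumF-cong (λ i → e (suc i)))

  sumF-+ : ∀ {N} (f g : Fin N → Carrier) → sumF (λ i → f i + g i) ≡ sumF f + sumF g
  sumF-+ {zero} f g = sym (+-identityˡ 0#)
  sumF-+ {suc N} f g = trans (cong ((f zero + g zero) +_) (sumF-+ (λ i → f (suc i)) (λ i → g (suc i))))
     (solve 4 (λ a b c d → ((a :+ b) :+ (c :+ d)) := ((a :+ c) :+ (b :+ d))) refl (f zero) (g zero) (sumF (λ i → f (suc i))) (sumF (λ i → g (suc i))))

  sumF-* : ∀ {N} (c : Carrier) (f : Fin N → Carrier) → sumF (λ i → c * f i) ≡ c * sumF f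
  sumF-* {zero} c f = sym (zeroʳ c)
  sumF-* {suc N} c f = trans (cong ((c * f zero) +_) (sumF-* c (λ i → f (suc i)))) (sym (distribˡ c _ _))

  sumF-neg : ∀ {N} (f : Fin N → Carrier) → sumF (λ i → - f i) ≡ - sumF f
  sumF-neg {zero} f = sym -0#≈0#
  sumF-neg {suc N} f = trans (cong (- f zero +_) (sumF-neg (λ i → f (suc i)))) (-‿+-comm (f zero) _)

  sumF-zero : ∀ {N} (f : Fin N → Carrier) → (∀ i → f i ≡ 0#) → sumF f ≡ 0#
  sumF-zero {zero} f e = refl
  sumF-zero {suc N} f e = trans (cong₂ _+_ (e zero) (sumF-zero (λ i → f (suc i)) (λ i → e (suc i)))) (+-identityˡ 0#)

  sumF-nonneg : ∀ {N} (f : Fin N → Carrier) → (∀ i → 0# ≤ f i) → 0# ≤ sumF f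
  sumF-nonneg {zero} f h = ≤-refl
  sumF-nonneg {suc N} f h = +-nonneg (h zero) (sumF-nonneg (λ i → f (suc i)) (λ i → h (suc i)))

  +-nonneg-≡0⇒≡0 : ∀ {a b} → 0# ≤ a → 0# ≤ b → a + b ≡ 0# → a ≡ 0#
  +-nonneg-≡0⇒≡0 (inj₁ p) q e = ⊥-elim (pos⇒≢0 (+-pos-nonneg p q) e)
  +-nonneg-≡0⇒≡0 (inj₂ e′) q e = sym e′

  sumF-nonneg-≡0⇒≡0 : ∀ {N} (f : Fin N → Carrier) → (∀ i → 0# ≤ f i) → sumF f ≡ 0# → ∀ i → f i ≡ 0#
  sumF-nonneg-≡0⇒≡0 {suc N} f h e zero = +-nonneg-≡0⇒≡0 (h zero) (sumF-nonneg _ (λ i → h (suc i))) e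
  sumF-nonneg-≡0⇒≡0 {suc N} f h e (suc i) = sumF-nonneg-≡0⇒≡0 (λ i → f (suc i)) (λ i → h (suc i))
    (+-nonneg-≡0⇒≡0 (sumF-nonneg _ (λ i → h (suc i))) (h zero) (trans (+-comm _ _) e)) i

  sumF-concentrated : ∀ {N} (f : Fin N → Carrier) (a : Fin N) → (∀ t → t ≢ a → f t ≡ 0#) → sumF f ≡ f a
  sumF-concentrated {suc N} f zero off =
    trans (cong (f zero +_) (sumF-zero (λ t → f (suc t)) (λ t → off (suc t) (λ ())))) (+-identityʳ _)
  sumF-concentrated {suc N} f (suc a) off =
    trans (cong (_+ sumF (λ t → f (suc t))) (off zero (λ ())))
      (trans (+-identityˡ _) (sumF-concentrated (λ t → f (suc t)) a (λ t t≢a → off (suc t) (λ e → t≢a (FP.suc-injective e)))))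

  pointMass : ∀ {N} → Fin N → Carrier → Fin N → Carrier
  pointMass a c t with t FP.≟ a
  ... | yes _ = c
  ... | no _ = 0#

  pointMass-at : ∀ {N} (a : Fin N) c → pointMass a c a ≡ c
  pointMass-at a c with a FP.≟ a
  ... | yes _ = refl
  ... | no a≢a = ⊥-elim (a≢a refl)

  pointMass-nonneg : ∀ {N} (a : Fin N) {c} → 0# ≤ c → ∀ t → 0# ≤ pointMass a c t
  pointMass-nonneg a p t with t FP.≟ a
  ... | yes _ = p
  ... | no _ = ≤-refl

  pointMass-off : ∀ {N} (a : Fin N) c t → t ≢ a → pointMass a c t ≡ 0#
  pointMass-off a c t n with t FP.≟ a
  ... | yes e = ⊥-elim (n e)
  ... | no _ = refl

  sumF-pointMass : ∀ {N} (a : Fin N) (c : Carrier) (g : Fin N → Carrier) → sumF (λ t → pointMass a c t * g t) ≡ c * g a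
  sumF-pointMass a c g =
    trans (sumF-concentrated _ a (λ t t≢a → trans (cong (_* g t) (pointMass-off a c t t≢a)) (zeroˡ _))) (cong (_* g a) (pointMass-at a c))

  weights₃ : ∀ {N} → Fin N → Fin N → Fin N → Carrier → Carrier → Carrier → Fin N → Carrier
  weights₃ a b c α β γ t = pointMass a α t + pointMass b β t + pointMass c γ t

  sumF-weights₃ : ∀ {N} (a b c : Fin N) α β γ (g : Fin N → Carrier) →
    sumF (λ t → weights₃ a b c α β γ t * g t) ≡ α * g a + β * g b + γ * g c
  sumF-weights₃ a b c α β γ g =
    trans (sumF-cong (λ t → trans (distribʳ (g t) (pointMass a α t + pointMass b β t) (pointMass c γ t)) (cong (_+ (pointMass c γ t * g t)) (distribʳ (g t) (pointMass a α t) (pointMass b β t)))))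
    (trans (sumF-+ (λ t → pointMass a α t * g t + pointMass b β t * g t) (λ t → pointMass c γ t * g t))
    (cong₂ _+_ (trans (sumF-+ (λ t → pointMass a α t * g t) (λ t → pointMass b β t * g t)) (cong₂ _+_ (sumF-pointMass a α g) (sumF-pointMass b β g))) (sumF-pointMass c γ g)))

  combination₃ : ∀ {N} (pos : Fin N → Pt) → Fin N → Fin N → Fin N → Carrier → Carrier → Carrier → Pt
  combination₃ pos a b c α β γ = (α * proj₁ (pos a) + β * proj₁ (pos b) + γ * proj₁ (pos c))
                      , (α * proj₂ (pos a) + β * proj₂ (pos b) + γ * proj₂ (pos c))

  InHull-combination₃ : ∀ {N} (pos : Fin N → Pt) (S : Fin N → Bool) (a b c : Fin N) {α β γ : Carrier} →
    T (S a) → T (S b) → T (S c) → 0# ≤ α → 0# ≤ β → 0# ≤ γ → α + β + γ ≡ 1# →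
    InHull pos S (combination₃ pos a b c α β γ)
  InHull-combination₃ pos S a b c {α} {β} {γ} a∈ b∈ c∈ 0≤α 0≤β 0≤γ α+β+γ≡1 =
    w , w≥0 , w-off , Σw≡1 , sumF-weights₃ a b c α β γ (λ t → proj₁ (pos t)) , sumF-weights₃ a b c α β γ (λ t → proj₂ (pos t))
    where
    w = weights₃ a b c α β γ
    w≥0 : ∀ t → 0# ≤ w t
    w≥0 t = +-nonneg (+-nonneg (pointMass-nonneg a 0≤α t) (pointMass-nonneg b 0≤β t)) (pointMass-nonneg c 0≤γ t)
    outside : ∀ {t x} → S t ≡ false → T (S x) → t ≢ x
    outside St≡false x∈ refl = subst T St≡false x∈
    w-off : ∀ t → S t ≡ false → w t ≡ 0#
    w-off t St≡false =
      trans (cong₂ _+_ (cong₂ _+_ (pointMass-off a α t (outside St≡false a∈)) (pointMass-off b β t (outside St≡false b∈)))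
                       (pointMass-off c γ t (outside St≡false c∈)))
            (trans (cong (_+ 0#) (+-identityʳ 0#)) (+-identityʳ 0#))
    Σw≡1 : sumF w ≡ 1#
    Σw≡1 = trans (sym (sumF-cong (λ t → *-identityʳ (w t))))
             (trans (sumF-weights₃ a b c α β γ (λ _ → 1#))
               (trans (solve 3 (λ a b c → (a :* con 1ℤ :+ b :* con 1ℤ :+ c :* con 1ℤ) := (a :+ b :+ c)) refl α β γ) α+β+γ≡1))

  InHull-point : ∀ {N} {pos : Fin N → Pt} {S : Fin N → Bool} {a} → T (S a) → InHull pos S (pos a)
  InHull-point {pos = pos} {S} {a} sa =
    subst (InHull pos S) (cong₂ _,_ (one-zero-zero (proj₁ (pos a))) (one-zero-zero (proj₂ (pos a))))
      (InHull-combination₃ pos S a a a sa sa sa (inj₁ 0<1) ≤-refl ≤-refl (solve 0 (con 1ℤ :+ con 0ℤ :+ con 0ℤ := con 1ℤ) refl))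
    where
    one-zero-zero : ∀ x → 1# * x + 0# * x + 0# * x ≡ x
    one-zero-zero = solve 1 (λ x → (con 1ℤ :* x :+ con 0ℤ :* x :+ con 0ℤ :* x) := x) refl

  InHull-singleton : ∀ {N} {pos : Fin N → Pt} {S : Fin N → Bool} {a z} → (∀ t → T (S t) → t ≡ a) → InHull pos S z → z ≡ pos a
  InHull-singleton {pos = pos} {S} {a} {z} only-a (w , _ , w-off , Σw≡1 , Σwx≡zx , Σwy≡zy) =
    cong₂ _,_ (coordinate proj₁ Σwx≡zx) (coordinate proj₂ Σwy≡zy)
    where
    w-off-a : ∀ t → t ≢ a → w t ≡ 0#
    w-off-a t t≢a with S t in e
    ... | true = ⊥-elim (t≢a (only-a t (subst T (sym e) tt)))
    ... | false = w-off t e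
    wa≡1 : w a ≡ 1#
    wa≡1 = trans (sym (sumF-concentrated w a w-off-a)) Σw≡1
    coordinate : (c : Pt → Carrier) → sumF (λ t → w t * c (pos t)) ≡ c z → c z ≡ c (pos a)
    coordinate c Σ≡cz = begin
      c z                          ≡⟨ sym Σ≡cz ⟩
      sumF (λ t → w t * c (pos t)) ≡⟨ sumF-concentrated _ a (λ t t≢a → trans (cong (_* c (pos t)) (w-off-a t t≢a)) (zeroˡ _)) ⟩
      w a * c (pos a)              ≡⟨ cong (_* c (pos a)) wa≡1 ⟩
      1# * c (pos a)               ≡⟨ *-identityˡ _ ⟩
      c (pos a)                    ∎
      where open ≡-Reasoning

module Separation (F : OrderedField) where
  open ConvexHull F public

  affine : Carrier → Carrier → Carrier → Pt → Carrier
  affine α β γ p = α * proj₁ p + β * proj₂ p + γ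

  affine-average : ∀ {N} {pos : Fin N → Pt} {S : Fin N → Bool} {z} α β γ → (h : InHull pos S z) →
    affine α β γ z ≡ sumF (λ i → proj₁ h i * affine α β γ (pos i))
  affine-average {pos = pos} {z = z} α β γ (w , _ , _ , Σw≡1 , Σwx≡zx , Σwy≡zy) = sym (begin
    sumF (λ i → w i * affine α β γ (pos i))
      ≡⟨ sumF-cong (λ i → solve 6 (λ w a b c x y → (w :* (a :* x :+ b :* y :+ c)) := (a :* (w :* x) :+ b :* (w :* y) :+ c :* w))
                                  refl (w i) α β γ (proj₁ (pos i)) (proj₂ (pos i))) ⟩
    sumF (λ i → α * (w i * proj₁ (pos i)) + β * (w i * proj₂ (pos i)) + γ * w i)
      ≡⟨ sumF-+ (λ i → α * (w i * proj₁ (pos i)) + β * (w i * proj₂ (pos i))) (λ i → γ * w i) ⟩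
    sumF (λ i → α * (w i * proj₁ (pos i)) + β * (w i * proj₂ (pos i))) + sumF (λ i → γ * w i)
      ≡⟨ cong₂ _+_ (sumF-+ (λ i → α * (w i * proj₁ (pos i))) (λ i → β * (w i * proj₂ (pos i)))) (sumF-* γ w) ⟩
    sumF (λ i → α * (w i * proj₁ (pos i))) + sumF (λ i → β * (w i * proj₂ (pos i))) + γ * sumF w
      ≡⟨ cong₂ _+_ (cong₂ _+_ (sumF-* α (λ i → w i * proj₁ (pos i))) (sumF-* β (λ i → w i * proj₂ (pos i)))) refl ⟩
    α * sumF (λ i → w i * proj₁ (pos i)) + β * sumF (λ i → w i * proj₂ (pos i)) + γ * sumF w
      ≡⟨ cong₂ _+_ (cong₂ _+_ (cong (α *_) Σwx≡zx) (cong (β *_) Σwy≡zy)) (trans (cong (γ *_) Σw≡1) (*-identityʳ γ)) ⟩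
    α * proj₁ z + β * proj₂ z + γ ∎)
    where open ≡-Reasoning

  hull-affine-nonneg : ∀ {N} {pos : Fin N → Pt} {S : Fin N → Bool} {z} α β γ → InHull pos S z →
    (∀ i → T (S i) → 0# ≤ affine α β γ (pos i)) → 0# ≤ affine α β γ z
  hull-affine-nonneg {pos = pos} {S} α β γ h@(w , w≥0 , w-off , _) H =
    subst (0# ≤_) (sym (affine-average α β γ h)) (sumF-nonneg _ term≥0)
    where
    term≥0 : ∀ i → 0# ≤ (w i * affine α β γ (pos i))
    term≥0 i with S i in e
    ... | true = *-nonneg (w≥0 i) (H i (subst T (sym e) tt))
    ... | false = inj₂ (sym (trans (cong (_* affine α β γ (pos i)) (w-off i e)) (zeroˡ _)))

  nonneg*neg≡0⇒≡0 : ∀ {w l} → 0# ≤ w → l < 0# → w * l ≡ 0# → w ≡ 0#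
  nonneg*neg≡0⇒≡0 (inj₁ p) q e = ⊥-elim (<⇒≢ (*-pos-neg p q) e)
  nonneg*neg≡0⇒≡0 (inj₂ e) _ _ = sym e

  hull-affine-neg : ∀ {N} {pos : Fin N → Pt} {S : Fin N → Bool} {z} α β γ → InHull pos S z →
    (∀ i → T (S i) → affine α β γ (pos i) < 0#) → affine α β γ z < 0#
  hull-affine-neg {N} {pos} {S} {z} α β γ h@(w , w≥0 , w-off , Σw≡1 , _) H = strict (compare ℓz 0#)
    where
    ℓz = affine α β γ z
    t : Fin N → Carrier
    t i = - (w i * affine α β γ (pos i))
    t≥0 : ∀ i → 0# ≤ t i
    t≥0 i with S i in e
    ... | true = x≤0⇒0≤-x (nonneg*neg≤0 (w≥0 i) (H i (subst T (sym e) tt)))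
      where
      nonneg*neg≤0 : ∀ {a b} → 0# ≤ a → b < 0# → (a * b) ≤ 0#
      nonneg*neg≤0 (inj₁ 0<a) b<0 = inj₁ (*-pos-neg 0<a b<0)
      nonneg*neg≤0 {b = b} (inj₂ refl) _ = inj₂ (zeroˡ b)
    ... | false = inj₂ (sym (trans (cong -_ (trans (cong (_* affine α β γ (pos i)) (w-off i e)) (zeroˡ _))) -0#≈0#))
    Σt≡-ℓz : sumF t ≡ - ℓz
    Σt≡-ℓz = trans (sumF-neg (λ i → w i * affine α β γ (pos i))) (cong -_ (sym (affine-average α β γ h)))
    -- a weighted average of negative values vanishes only if every weight does
    strict : Tri (ℓz < 0#) (ℓz ≡ 0#) (0# < ℓz) → ℓz < 0#
    strict (tri< ℓz<0 _ _) = ℓz<0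
    strict (tri> _ _ 0<ℓz) = ⊥-elim (≤⇒≯ (subst (0# ≤_) Σt≡-ℓz (sumF-nonneg t t≥0)) (0<x⇒-x<0 0<ℓz))
    strict (tri≈ _ ℓz≡0 _) = ⊥-elim (1≢0 (trans (sym Σw≡1) (sumF-zero w w≡0)))
      where
      t≡0 : ∀ i → t i ≡ 0#
      t≡0 = sumF-nonneg-≡0⇒≡0 t t≥0 (trans Σt≡-ℓz (trans (cong -_ ℓz≡0) -0#≈0#))
      w≡0 : ∀ i → w i ≡ 0#
      w≡0 i with S i in e
      ... | false = w-off i e
      ... | true = nonneg*neg≡0⇒≡0 (w≥0 i) (H i (subst T (sym e) tt)) (trans (sym (-‿involutive _)) (trans (cong -_ (t≡0 i)) -0#≈0#))

  hulls-disjoint-by-affine : ∀ {N} (pos : Fin N → Pt) (S1 S2 : Fin N → Bool) z α β γ → InHull pos S1 z → InHull pos S2 z →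
    (∀ i → T (S1 i) → 0# ≤ affine α β γ (pos i)) → (∀ i → T (S2 i) → affine α β γ (pos i) < 0#) → ⊥
  hulls-disjoint-by-affine pos S1 S2 z α β γ h1 h2 H1 H2 = ≤⇒≯ (hull-affine-nonneg α β γ h1 H1) (hull-affine-neg α β γ h2 H2)

  orient : Pt → Pt → Pt → Carrier
  orient (px , py) (qx , qy) (rx , ry) = (qx - px) * (ry - py) - (qy - py) * (rx - px)

  orient-affine : ∀ u v z → orient u v z ≡ affine (- (proj₂ v - proj₂ u)) (proj₁ v - proj₁ u) (- ((proj₁ v - proj₁ u) * proj₂ u) + (proj₂ v - proj₂ u) * proj₁ u) z
  orient-affine (ux , uy) (vx , vy) (zx , zy) = solve 6 (λ ux uy vx vy zx zy →
    ((vx :- ux) :* (zy :- uy) :- (vy :- uy) :* (zx :- ux)) :=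
    ((:- (vy :- uy)) :* zx :+ (vx :- ux) :* zy :+ (:- ((vx :- ux) :* uy) :+ (vy :- uy) :* ux))) refl ux uy vx vy zx zy

  hulls-disjoint-by-orient : ∀ {N} (pos : Fin N → Pt) (S1 S2 : Fin N → Bool) z u v → InHull pos S1 z → InHull pos S2 z →
    (∀ i → T (S1 i) → 0# ≤ orient u v (pos i)) → (∀ i → T (S2 i) → orient u v (pos i) < 0#) → ⊥
  hulls-disjoint-by-orient pos S1 S2 z u v h1 h2 H1 H2 = hulls-disjoint-by-affine pos S1 S2 z _ _ _ h1 h2
    (λ i e → subst (0# ≤_) (orient-affine u v (pos i)) (H1 i e))
    (λ i e → subst (_< 0#) (orient-affine u v (pos i)) (H2 i e))

  hulls-disjoint-by-abscissa : ∀ {N} (pos : Fin N → Pt) (S1 S2 : Fin N → Bool) z c → InHull pos S1 z → InHull pos S2 z →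
    (∀ i → T (S1 i) → proj₁ (pos i) ≤ c) → (∀ i → T (S2 i) → c < proj₁ (pos i)) → ⊥
  hulls-disjoint-by-abscissa pos S1 S2 z c h1 h2 H1 H2 = hulls-disjoint-by-affine pos S1 S2 z (- 1#) 0# c h1 h2
    (λ i e → subst (0# ≤_) (eqn (pos i)) (x≤y⇒0≤y-x (H1 i e)))
    (λ i e → subst (_< 0#) (eqn (pos i)) (0<-x⇒x<0 (subst (0# <_) (solve 2 (λ x c → (x :- c) := (:- (c :- x))) refl (proj₁ (pos i)) c) (x<y⇒0<y-x (H2 i e)))))
    where
    eqn : ∀ p → c - proj₁ p ≡ affine (- 1#) 0# c p
    eqn (x , y) = solve 3 (λ x y c → (c :- x) := ((:- con 1ℤ) :* x :+ con 0ℤ :* y :+ c)) refl x y c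

module Orientation (F : OrderedField) where
  open Separation F public

  orient-rotate : ∀ p q r → orient p q r ≡ orient q r p
  orient-rotate (a , b) (c , d) (e , f) = solve 6 (λ a b c d e f →
    ((c :- a) :* (f :- b) :- (d :- b) :* (e :- a)) := ((e :- c) :* (b :- d) :- (f :- d) :* (a :- c))) refl a b c d e f

  orient-swap : ∀ p q r → orient p r q ≡ - orient p q r
  orient-swap (a , b) (c , d) (e , f) = solve 6 (λ a b c d e f →
    ((e :- a) :* (d :- b) :- (f :- b) :* (c :- a)) := (:- ((c :- a) :* (f :- b) :- (d :- b) :* (e :- a)))) refl a b c d e f

  orient-pqp : ∀ p q → orient p q p ≡ 0#
  orient-pqp (a , b) (c , d) = solve 4 (λ a b c d → ((c :- a) :* (b :- b) :- (d :- b) :* (a :- a)) := con 0ℤ) refl a b c d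

  orient-pqq : ∀ p q → orient p q q ≡ 0#
  orient-pqq (a , b) (c , d) = solve 4 (λ a b c d → ((c :- a) :* (d :- b) :- (d :- b) :* (c :- a)) := con 0ℤ) refl a b c d

  orient-swap-neg : ∀ {p q r} → 0# < orient p q r → orient p r q < 0#
  orient-swap-neg {p} {q} {r} h = subst (_< 0#) (sym (orient-swap p q r)) (0<x⇒-x<0 h)

  diagonal-identityˣ : ∀ (pi pj pk pl : Pt) →
    orient pj pk pl * proj₁ pi + orient pi pj pl * proj₁ pk ≡ orient pi pk pl * proj₁ pj + orient pi pj pk * proj₁ pl
  diagonal-identityˣ (a , b) (c , d) (e , f) (g , h) = solve 8 (λ a b c d e f g h →
     (((e :- c) :* (h :- d) :- (f :- d) :* (g :- c)) :* a :+ ((c :- a) :* (h :- b) :- (d :- b) :* (g :- a)) :* e) :=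
     (((e :- a) :* (h :- b) :- (f :- b) :* (g :- a)) :* c :+ ((c :- a) :* (f :- b) :- (d :- b) :* (e :- a)) :* g)) refl a b c d e f g h

  diagonal-identityʸ : ∀ (pi pj pk pl : Pt) →
    orient pj pk pl * proj₂ pi + orient pi pj pl * proj₂ pk ≡ orient pi pk pl * proj₂ pj + orient pi pj pk * proj₂ pl
  diagonal-identityʸ (a , b) (c , d) (e , f) (g , h) = solve 8 (λ a b c d e f g h →
     (((e :- c) :* (h :- d) :- (f :- d) :* (g :- c)) :* b :+ ((c :- a) :* (h :- b) :- (d :- b) :* (g :- a)) :* f) :=
     (((e :- a) :* (h :- b) :- (f :- b) :* (g :- a)) :* d :+ ((c :- a) :* (f :- b) :- (d :- b) :* (e :- a)) :* h)) refl a b c d e f g h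

  orient-diagonal-sum : ∀ (pi pj pk pl : Pt) → orient pj pk pl + orient pi pj pl ≡ orient pi pk pl + orient pi pj pk
  orient-diagonal-sum (a , b) (c , d) (e , f) (g , h) = solve 8 (λ a b c d e f g h →
     (((e :- c) :* (h :- d) :- (f :- d) :* (g :- c)) :+ ((c :- a) :* (h :- b) :- (d :- b) :* (g :- a))) :=
     (((e :- a) :* (h :- b) :- (f :- b) :* (g :- a)) :+ ((c :- a) :* (f :- b) :- (d :- b) :* (e :- a)))) refl a b c d e f g h

  Between : Pt → Pt → Pt → Set
  Between p q r = Σ Carrier λ α → Σ Carrier λ β → (0# ≤ α) × (0# ≤ β) × (α + β ≡ 1#)
    × (α * proj₁ p + β * proj₁ r ≡ proj₁ q) × (α * proj₂ p + β * proj₂ r ≡ proj₂ q)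

  InHull-between : ∀ {N} {pos : Fin N → Pt} {S : Fin N → Bool} {a b z} →
    T (S a) → T (S b) → Between (pos a) z (pos b) → InHull pos S z
  InHull-between {pos = pos} {S} {a} {b} {z} sa sb (α , β , 0≤α , 0≤β , α+β≡1 , ex , ey) =
    subst (InHull pos S) (cong₂ _,_ (trans (drop-zero _ _ _ _) ex) (trans (drop-zero _ _ _ _) ey))
      (InHull-combination₃ pos S a b b sa sb sb 0≤α 0≤β ≤-refl (trans (+-identityʳ _) α+β≡1))
    where
    drop-zero : ∀ a b x y → a * x + b * y + 0# * y ≡ a * x + b * y
    drop-zero a b x y = solve 4 (λ a b x y → (a :* x :+ b :* y :+ con 0ℤ :* y) := (a :* x :+ b :* y)) refl a b x y

  -- With A = orient j k l, B = orient i j l, C = orient i k l, D = orient i j k, the diagonal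
  -- identities say (A pᵢ + B pₖ) / (A + B) = (C pⱼ + D pₗ) / (C + D).
  diagonals-meet : ∀ {N} (pos : Fin N → Pt) (S1 S2 : Fin N → Bool) (i j k l : Fin N) →
    T (S1 i) → T (S1 k) → T (S2 j) → T (S2 l) →
    0# < orient (pos i) (pos j) (pos k) → 0# < orient (pos i) (pos j) (pos l) →
    0# < orient (pos i) (pos k) (pos l) → 0# < orient (pos j) (pos k) (pos l) →
    Σ Pt (λ z → InHull pos S1 z × InHull pos S2 z)
  diagonals-meet pos S1 S2 i j k l si sk sj sl 0<D 0<B 0<C 0<A =
      z
    , InHull-between si sk (A * I , B * I , weight 0<A , weight 0<B , AB-sum , scale A B _ _ , scale A B _ _)
    , InHull-between sj sl (C * I , D * I , weight 0<C , weight 0<D , CD-sum , CD-x , CD-y)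
    where
    A = orient (pos j) (pos k) (pos l)
    B = orient (pos i) (pos j) (pos l)
    C = orient (pos i) (pos k) (pos l)
    D = orient (pos i) (pos j) (pos k)
    0<A+B = +-pos 0<A 0<B
    I = inv (A + B) 0<A+B
    weight : ∀ {a} → 0# < a → 0# ≤ (a * I)
    weight 0<a = inj₁ (*-pos _ _ 0<a (inv-pos _ 0<A+B))
    scale : ∀ a b x y → a * I * x + b * I * y ≡ (a * x + b * y) * I
    scale a b x y = solve 5 (λ a b x y i → (a :* i :* x :+ b :* i :* y) := ((a :* x :+ b :* y) :* i)) refl a b x y I
    z : Pt
    z = (A * proj₁ (pos i) + B * proj₁ (pos k)) * I , (A * proj₂ (pos i) + B * proj₂ (pos k)) * I
    AB-sum : A * I + B * I ≡ 1#
    AB-sum = trans (sym (distribʳ I A B)) (inv-inverseʳ _ 0<A+B)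
    CD-sum : C * I + D * I ≡ 1#
    CD-sum = trans (sym (distribʳ I C D)) (trans (cong (_* I) (sym (orient-diagonal-sum (pos i) (pos j) (pos k) (pos l)))) (inv-inverseʳ _ 0<A+B))
    CD-x : C * I * proj₁ (pos j) + D * I * proj₁ (pos l) ≡ proj₁ z
    CD-x = trans (scale C D _ _) (cong (_* I) (sym (diagonal-identityˣ (pos i) (pos j) (pos k) (pos l))))
    CD-y : C * I * proj₂ (pos j) + D * I * proj₂ (pos l) ≡ proj₂ z
    CD-y = trans (scale C D _ _) (cong (_* I) (sym (diagonal-identityʸ (pos i) (pos j) (pos k) (pos l))))

module RankedConfigurations (F : OrderedField) where
  open Orientation F public

  T-dichotomy : ∀ b → T b ⊎ T (not b)
  T-dichotomy true = inj₁ tt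
  T-dichotomy false = inj₂ tt

  T-not⇒¬T : ∀ {b} → T (not b) → ¬ T b
  T-not⇒¬T {false} _ ()

  ¬T⇒T-not : ∀ {b} → ¬ T b → T (not b)
  ¬T⇒T-not {true} ¬t = ¬t tt
  ¬T⇒T-not {false} _ = tt

  data Extremum {N} (P : Fin N → Set) (R : ℕ → ℕ → Set) (f : Fin N → ℕ) : Set where
    none : (∀ t → ¬ P t) → Extremum P R f
    some : (e : Fin N) → P e → (∀ t → P t → R (f e) (f t)) → Extremum P R f

  extremum : {R : ℕ → ℕ → Set} → (∀ a b → R a b ⊎ R b a) → (∀ {a b c} → R a b → R b c → R a c) → (∀ {a} → R a a) →
    ∀ {N} {P : Fin N → Set} → (∀ t → Dec (P t)) → (f : Fin N → ℕ) → Extremum P R f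
  extremum total trans′ refl′ {zero} P? f = none (λ ())
  extremum total trans′ refl′ {suc N} P? f
    with extremum total trans′ refl′ (λ t → P? (suc t)) (λ t → f (suc t)) | P? zero
  ... | none ∉P | yes p₀ = some zero p₀ (λ { zero _ → refl′ ; (suc t) p → ⊥-elim (∉P t p) })
  ... | none ∉P | no ¬p₀ = none (λ { zero → ¬p₀ ; (suc t) → ∉P t })
  ... | some e pₑ best | no ¬p₀ = some (suc e) pₑ (λ { zero p → ⊥-elim (¬p₀ p) ; (suc t) p → best t p })
  ... | some e pₑ best | yes p₀ with total (f zero) (f (suc e))
  ...   | inj₁ r = some zero p₀ (λ { zero _ → refl′ ; (suc t) p → trans′ r (best t p) })
  ...   | inj₂ r = some (suc e) pₑ (λ { zero _ → r ; (suc t) p → best t p })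

  minimum : ∀ {N} {P : Fin N → Set} → (∀ t → Dec (P t)) → (f : Fin N → ℕ) → Extremum P _≤ℕ_ f
  minimum = extremum ℕP.≤-total ℕP.≤-trans ℕP.≤-refl

  maximum : ∀ {N} {P : Fin N → Set} → (∀ t → Dec (P t)) → (f : Fin N → ℕ) → Extremum P (λ a b → b ≤ℕ a) f
  maximum = extremum (λ a b → ℕP.≤-total b a) (λ p q → ℕP.≤-trans q p) ℕP.≤-refl

  -- The combinatorial form of noncrossing for points listed by a rank in counterclockwise order,
  -- the first of which (those onBase) are collinear.
  record RankNoncrossing {N} (rank : Fin N → ℕ) (onBase : Fin N → Bool) (π : Partition N) : Set where
    field
      no-crossing : ∀ i j k l → rank i <ℕ rank j → rank j <ℕ rank k → rank k <ℕ rank l →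
                    T (rel π i k) → T (rel π j l) → T (rel π i j)
      base-interval : ∀ i j k → rank i <ℕ rank j → rank j <ℕ rank k → T (onBase k) → T (rel π i k) → T (rel π i j)

  open RankNoncrossing public

  record RankedConfiguration (N : ℕ) : Set where
    field
      point : Fin N → Pt
      point-injective : ∀ i j → point i ≡ point j → i ≡ j
      rank : Fin N → ℕ
      rank-injective : ∀ i j → rank i ≡ rank j → i ≡ j
      onBase : Fin N → Bool
      onBase-downward : ∀ i j → rank i <ℕ rank j → T (onBase j) → T (onBase i)
      onBase-abscissa : ∀ i j → T (onBase i) → T (onBase j) → rank i <ℕ rank j → proj₁ (point i) < proj₁ (point j)
      onBase-between : ∀ i j k → rank i <ℕ rank j → rank j <ℕ rank k → T (onBase k) → Between (point i) (point j) (point k)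
      orient-nonneg : ∀ i j k → rank i <ℕ rank j → rank j <ℕ rank k → 0# ≤ orient (point i) (point j) (point k)
      orient-pos : ∀ i j k → rank i <ℕ rank j → rank j <ℕ rank k → ¬ T (onBase k) → 0# < orient (point i) (point j) (point k)

  module RankOrder {N} (K : RankedConfiguration N) where
    open RankedConfiguration K public

    infix 4 _≺_ _≼_
    _≺_ _≼_ : Fin N → Fin N → Set
    a ≺ b = rank a <ℕ rank b
    a ≼ b = rank a ≤ℕ rank b

    ≺-trichotomy : ∀ a b → Tri (a ≺ b) (a ≡ b) (b ≺ a)
    ≺-trichotomy a b with ℕP.<-cmp (rank a) (rank b)
    ... | tri< a≺b ¬eq ¬b≺a = tri< a≺b (λ a≡b → ¬eq (cong rank a≡b)) ¬b≺a
    ... | tri≈ ¬a≺b eq ¬b≺a = tri≈ ¬a≺b (rank-injective a b eq) ¬b≺a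
    ... | tri> ¬a≺b ¬eq b≺a = tri> ¬a≺b (λ a≡b → ¬eq (cong rank a≡b)) b≺a

    ≼⇒≺⊎≡ : ∀ {a b} → a ≼ b → a ≺ b ⊎ a ≡ b
    ≼⇒≺⊎≡ {a} {b} a≼b with ℕP.m≤n⇒m<n∨m≡n a≼b
    ... | inj₁ a≺b = inj₁ a≺b
    ... | inj₂ eq = inj₂ (rank-injective a b eq)

    onBase-≼ : ∀ {a b} → a ≼ b → T (onBase b) → T (onBase a)
    onBase-≼ {a} {b} a≼b b∈ with ≼⇒≺⊎≡ a≼b
    ... | inj₁ a≺b = onBase-downward a b a≺b b∈
    ... | inj₂ refl = b∈

    orient-outside : ∀ {u v t} → u ≺ v → t ≼ u ⊎ v ≼ t → 0# ≤ orient (point u) (point v) (point t)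
    orient-outside {u} {v} {t} u≺v (inj₁ t≼u) with ≼⇒≺⊎≡ t≼u
    ... | inj₁ t≺u = subst (0# ≤_) (orient-rotate (point t) (point u) (point v)) (orient-nonneg t u v t≺u u≺v)
    ... | inj₂ refl = inj₂ (sym (orient-pqp (point u) (point v)))
    orient-outside {u} {v} {t} u≺v (inj₂ v≼t) with ≼⇒≺⊎≡ v≼t
    ... | inj₁ v≺t = orient-nonneg u v t u≺v v≺t
    ... | inj₂ refl = inj₂ (sym (orient-pqq (point u) (point v)))

    orient-inside : ∀ {u v t} → u ≼ t → t ≼ v → u ≺ v → 0# ≤ orient (point v) (point u) (point t)
    orient-inside {u} {v} {t} u≼t t≼v u≺v with ≼⇒≺⊎≡ u≼t | ≼⇒≺⊎≡ t≼v
    ... | inj₂ refl | _ = inj₂ (sym (orient-pqq (point v) (point u)))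
    ... | inj₁ _ | inj₂ refl = inj₂ (sym (orient-pqp (point v) (point u)))
    ... | inj₁ u≺t | inj₁ t≺v =
      subst (0# ≤_) (sym (orient-rotate (point v) (point u) (point t))) (orient-nonneg u t v u≺t t≺v)

    orient-inside-neg : ∀ {u v t} → u ≺ t → t ≺ v → ¬ T (onBase v) → orient (point u) (point v) (point t) < 0#
    orient-inside-neg {u} {v} {t} u≺t t≺v v∉ = orient-swap-neg (orient-pos u t v u≺t t≺v v∉)

    orient-below-neg : ∀ {u v t} → t ≺ u → u ≺ v → ¬ T (onBase v) → orient (point v) (point u) (point t) < 0#
    orient-below-neg {u} {v} {t} t≺u u≺v v∉ =
      subst (_< 0#) (orient-rotate (point t) (point v) (point u)) (orient-swap-neg (orient-pos t u v t≺u u≺v v∉))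

    orient-above-neg : ∀ {u v t} → u ≺ v → v ≺ t → ¬ T (onBase t) → orient (point v) (point u) (point t) < 0#
    orient-above-neg {u} {v} {t} u≺v v≺t t∉ =
      subst (_< 0#) (sym (orient-rotate (point v) (point u) (point t))) (orient-swap-neg (orient-pos u v t u≺v v≺t t∉))

  module _ {N} (K : RankedConfiguration N) where
    open RankOrder K

    noncrossing⇒rankNoncrossing : (π : Partition N) → NonCrossing point π → RankNoncrossing rank onBase π
    noncrossing⇒rankNoncrossing π nc = record { no-crossing = crossing-free ; base-interval = interval }
      where
      interval : ∀ i j k → i ≺ j → j ≺ k → T (onBase k) → T (rel π i k) → T (rel π i j)
      interval i j k i≺j j≺k k∈ i~k with T-dichotomy (rel π i j)
      ... | inj₁ i~j = i~j
      ... | inj₂ i≁j = ⊥-elim (nc i j i≁j (point j)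
                         (InHull-between (reflR π i) i~k (onBase-between i j k i≺j j≺k k∈)) (InHull-point (reflR π j)))
      crossing-free : ∀ i j k l → i ≺ j → j ≺ k → k ≺ l → T (rel π i k) → T (rel π j l) → T (rel π i j)
      crossing-free i j k l i≺j j≺k k≺l i~k j~l with T-dichotomy (rel π i j)
      ... | inj₁ i~j = i~j
      ... | inj₂ i≁j with T-dichotomy (onBase k)
      ...   | inj₁ k∈ = interval i j k i≺j j≺k k∈ i~k
      ...   | inj₂ k∉ = ⊥-elim (nc i j i≁j z z∈i z∈j)
        where
        l∉ : ¬ T (onBase l)
        l∉ l∈ = T-not⇒¬T k∉ (onBase-downward k l k≺l l∈)
        meet = diagonals-meet point (rel π i) (rel π j) i j k l (reflR π i) i~k (reflR π j) j~l
                 (orient-pos i j k i≺j j≺k (T-not⇒¬T k∉)) (orient-pos i j l i≺j (ℕP.<-trans j≺k k≺l) l∉)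
                 (orient-pos i k l (ℕP.<-trans i≺j j≺k) k≺l l∉) (orient-pos j k l j≺k k≺l l∉)
        z = proj₁ meet
        z∈i = proj₁ (proj₂ meet)
        z∈j = proj₂ (proj₂ meet)

  -- Two blocks Bᵢ, Bⱼ whose least elements satisfy c₁ ≺ c₂ have disjoint hulls: in each case
  -- below, a line through two points of one block separates the blocks.
  module BlockSeparation {N} (K : RankedConfiguration N) where
    open RankOrder K

    module _ (π : Partition N) (cnc : RankNoncrossing rank onBase π) (i j : Fin N) (i≁j : ¬ T (rel π i j))
             (c₁ c₂ : Fin N) (c₁∈ : T (rel π i c₁)) (c₂∈ : T (rel π j c₂))
             (c₁-least : ∀ t → T (rel π i t) → c₁ ≼ t) (c₂-least : ∀ t → T (rel π j t) → c₂ ≼ t) (c₁≺c₂ : c₁ ≺ c₂) where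

      Bᵢ Bⱼ : Fin N → Bool
      Bᵢ = rel π i
      Bⱼ = rel π j

      Separated : Set
      Separated = ∀ z → InHull point Bᵢ z → InHull point Bⱼ z → ⊥

      unrelated : ∀ {a b} → T (Bᵢ a) → T (Bⱼ b) → ¬ T (rel π a b)
      unrelated {a} {b} a∈ b∈ a~b = i≁j (transR π i b j (transR π i a b a∈ a~b) (symR π j b b∈))

      disjoint : ∀ {a} → T (Bᵢ a) → ¬ T (Bⱼ a)
      disjoint {a} a∈ a∈′ = unrelated a∈ a∈′ (reflR π a)

      linked : ∀ {c a b} → T (rel π c a) → T (rel π c b) → T (rel π a b)
      linked {c} {a} {b} c~a c~b = transR π a c b (symR π c a c~a) c~b

      nested-separated : ∀ u v → T (Bᵢ u) → T (Bᵢ v) → u ≺ c₂ → c₂ ≺ v →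
        (∀ t → T (Bᵢ t) → t ≺ c₂ → t ≼ u) → (∀ t → T (Bᵢ t) → c₂ ≺ t → v ≼ t) → Separated
      nested-separated u v u∈ v∈ u≺c₂ c₂≺v u-max v-min z z∈Bᵢ z∈Bⱼ =
        hulls-disjoint-by-orient point Bᵢ Bⱼ z (point u) (point v) z∈Bᵢ z∈Bⱼ Bᵢ-side Bⱼ-side
        where
        u≺v = ℕP.<-trans u≺c₂ c₂≺v
        Bⱼ-below-v : ∀ p → T (Bⱼ p) → p ≺ v
        Bⱼ-below-v p p∈ with ≺-trichotomy p v
        ... | tri< p≺v _ _ = p≺v
        ... | tri≈ _ refl _ = ⊥-elim (disjoint v∈ p∈)
        ... | tri> _ _ v≺p =
          ⊥-elim (unrelated u∈ c₂∈ (no-crossing cnc u c₂ v p u≺c₂ c₂≺v v≺p (linked u∈ v∈) (linked c₂∈ p∈)))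
        v∉ : ¬ T (onBase v)
        v∉ v∈base = unrelated u∈ c₂∈ (base-interval cnc u c₂ v u≺c₂ c₂≺v v∈base (linked u∈ v∈))
        Bᵢ-side : ∀ t → T (Bᵢ t) → 0# ≤ orient (point u) (point v) (point t)
        Bᵢ-side t t∈ with ≺-trichotomy t c₂
        ... | tri< t≺c₂ _ _ = orient-outside u≺v (inj₁ (u-max t t∈ t≺c₂))
        ... | tri≈ _ refl _ = ⊥-elim (disjoint t∈ c₂∈)
        ... | tri> _ _ c₂≺t = orient-outside u≺v (inj₂ (v-min t t∈ c₂≺t))
        Bⱼ-side : ∀ p → T (Bⱼ p) → orient (point u) (point v) (point p) < 0#
        Bⱼ-side p p∈ = orient-inside-neg (ℕP.<-≤-trans u≺c₂ (c₂-least p p∈)) (Bⱼ-below-v p p∈) v∉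

      module Preceding (Bᵢ≺c₂ : ∀ t → T (Bᵢ t) → t ≺ c₂) (b d : Fin N) (b∈ : T (Bᵢ b)) (d∈ : T (Bⱼ d))
                       (b-max : ∀ t → T (Bᵢ t) → t ≼ b) (d-max : ∀ t → T (Bⱼ t) → t ≼ d) where

        base-separated : T (onBase d) → Separated
        base-separated d∈base z z∈Bᵢ z∈Bⱼ =
          hulls-disjoint-by-abscissa point Bᵢ Bⱼ z (proj₁ (point b)) z∈Bᵢ z∈Bⱼ Bᵢ-side Bⱼ-side
          where
          Bᵢ-base : ∀ t → T (Bᵢ t) → T (onBase t)
          Bᵢ-base t t∈ = onBase-≼ (ℕP.<⇒≤ (ℕP.<-≤-trans (Bᵢ≺c₂ t t∈) (d-max c₂ c₂∈))) d∈base
          Bᵢ-side : ∀ t → T (Bᵢ t) → proj₁ (point t) ≤ proj₁ (point b)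
          Bᵢ-side t t∈ with ≼⇒≺⊎≡ (b-max t t∈)
          ... | inj₁ t≺b = inj₁ (onBase-abscissa t b (Bᵢ-base t t∈) (Bᵢ-base b b∈) t≺b)
          ... | inj₂ refl = ≤-refl
          Bⱼ-side : ∀ p → T (Bⱼ p) → proj₁ (point b) < proj₁ (point p)
          Bⱼ-side p p∈ = onBase-abscissa b p (Bᵢ-base b b∈) (onBase-≼ (d-max p p∈) d∈base)
                           (ℕP.<-≤-trans (Bᵢ≺c₂ b b∈) (c₂-least p p∈))

        chord-separated : ¬ T (onBase d) → c₂ ≺ d → Separated
        chord-separated d∉ c₂≺d z z∈Bᵢ z∈Bⱼ =
          hulls-disjoint-by-orient point Bⱼ Bᵢ z (point d) (point c₂) z∈Bⱼ z∈Bᵢ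
            (λ p p∈ → orient-inside (c₂-least p p∈) (d-max p p∈) c₂≺d)
            (λ t t∈ → orient-below-neg (Bᵢ≺c₂ t t∈) c₂≺d d∉)

        singleton-separated : ¬ T (onBase c₂) → (∀ p → T (Bⱼ p) → p ≡ c₂) → Separated
        singleton-separated c₂∉ only-c₂ z z∈Bᵢ z∈Bⱼ with ≺-trichotomy c₁ b
        ... | tri> _ _ b≺c₁ = ℕP.<-irrefl refl (ℕP.<-≤-trans b≺c₁ (b-max c₁ c₁∈))
        ... | tri< c₁≺b _ _ =
          hulls-disjoint-by-orient point Bᵢ Bⱼ z (point b) (point c₁) z∈Bᵢ z∈Bⱼ
            (λ t t∈ → orient-inside (c₁-least t t∈) (b-max t t∈) c₁≺b)
            (λ p p∈ → subst (λ q → orient (point b) (point c₁) (point q) < 0#) (sym (only-c₂ p p∈))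
                        (orient-above-neg c₁≺b (Bᵢ≺c₂ b b∈) c₂∉))
        ... | tri≈ _ refl _ = ℕP.<-irrefl (cong rank c₁≡c₂) c₁≺c₂
          where
          only-c₁ : ∀ t → T (Bᵢ t) → t ≡ c₁
          only-c₁ t t∈ = rank-injective t c₁ (ℕP.≤-antisym (b-max t t∈) (c₁-least t t∈))
          c₁≡c₂ : c₁ ≡ c₂
          c₁≡c₂ = point-injective c₁ c₂ (trans (sym (InHull-singleton only-c₁ z∈Bᵢ)) (InHull-singleton only-c₂ z∈Bⱼ))

        separated : Separated
        separated with T-dichotomy (onBase d) | ≼⇒≺⊎≡ (d-max c₂ c₂∈)
        ... | inj₁ d∈base | _ = base-separated d∈base
        ... | inj₂ d∉ | inj₁ c₂≺d = chord-separated (T-not⇒¬T d∉) c₂≺d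
        ... | inj₂ d∉ | inj₂ refl =
          singleton-separated (T-not⇒¬T d∉) (λ p p∈ → rank-injective p c₂ (ℕP.≤-antisym (d-max p p∈) (c₂-least p p∈)))

      preceding-separated : (∀ t → T (Bᵢ t) → t ≺ c₂) → Separated
      preceding-separated Bᵢ≺c₂ with maximum (λ t → T? (Bᵢ t)) rank | maximum (λ t → T? (Bⱼ t)) rank
      ... | none ∉Bᵢ | _ = ⊥-elim (∉Bᵢ c₁ c₁∈)
      ... | some _ _ _ | none ∉Bⱼ = ⊥-elim (∉Bⱼ c₂ c₂∈)
      ... | some b b∈ b-max | some d d∈ d-max = Preceding.separated Bᵢ≺c₂ b d b∈ d∈ b-max d-max

      separated : Separated
      separated with minimum (λ t → T? (Bᵢ t) ×-dec (rank c₂ ℕP.<? rank t)) rank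
      ... | none none-after = preceding-separated Bᵢ≺c₂
        where
        Bᵢ≺c₂ : ∀ t → T (Bᵢ t) → t ≺ c₂
        Bᵢ≺c₂ t t∈ with ≺-trichotomy t c₂
        ... | tri< t≺c₂ _ _ = t≺c₂
        ... | tri≈ _ refl _ = ⊥-elim (disjoint t∈ c₂∈)
        ... | tri> _ _ c₂≺t = ⊥-elim (none-after t (t∈ , c₂≺t))
      ... | some v (v∈ , c₂≺v) v-min with maximum (λ t → T? (Bᵢ t) ×-dec (rank t ℕP.<? rank c₂)) rank
      ...   | none none-before = ⊥-elim (none-before c₁ (c₁∈ , c₁≺c₂))
      ...   | some u (u∈ , u≺c₂) u-max =
        nested-separated u v u∈ v∈ u≺c₂ c₂≺v (λ t t∈ t≺c₂ → u-max t (t∈ , t≺c₂)) (λ t t∈ c₂≺t → v-min t (t∈ , c₂≺t))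

  module _ {N} (K : RankedConfiguration N) where
    open RankOrder K

    rankNoncrossing⇒noncrossing : (π : Partition N) → RankNoncrossing rank onBase π → NonCrossing point π
    rankNoncrossing⇒noncrossing π cnc i j i≁j z z∈Bᵢ z∈Bⱼ
      with minimum (λ t → T? (rel π i t)) rank | minimum (λ t → T? (rel π j t)) rank
    ... | none ∉Bᵢ | _ = ∉Bᵢ i (reflR π i)
    ... | some _ _ _ | none ∉Bⱼ = ∉Bⱼ j (reflR π j)
    ... | some c₁ c₁∈ c₁-least | some c₂ c₂∈ c₂-least with ≺-trichotomy c₁ c₂
    ...   | tri< c₁≺c₂ _ _ =
      BlockSeparation.separated K π cnc i j (T-not⇒¬T i≁j) c₁ c₂ c₁∈ c₂∈ c₁-least c₂-least c₁≺c₂ z z∈Bᵢ z∈Bⱼ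
    ...   | tri> _ _ c₂≺c₁ =
      BlockSeparation.separated K π cnc j i (λ j~i → T-not⇒¬T i≁j (symR π j i j~i)) c₂ c₁ c₂∈ c₁∈ c₂-least c₁-least c₂≺c₁ z z∈Bⱼ z∈Bᵢ
    ...   | tri≈ _ refl _ = T-not⇒¬T i≁j (transR π i c₁ j c₁∈ (symR π j c₁ c₂∈))

module Semicircle (F : OrderedField) where
  open RankedConfigurations F public

  x-y≡0⇒x≡y : ∀ {x y} → x - y ≡ 0# → x ≡ y
  x-y≡0⇒x≡y {x} {y} e = trans (sym (x-y+y≡x x y)) (trans (cong (_+ y) e) (+-identityˡ y))

  +-neg : ∀ {x y} → x < 0# → y < 0# → x + y < 0#
  +-neg {x} {y} x<0 y<0 = 0<-x⇒x<0 (subst (0# <_) (-‿+-comm x y) (+-pos (x<0⇒0<-x x<0) (x<0⇒0<-x y<0)))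

  half-pos : ∀ {x} → 0# < x + x → 0# < x
  half-pos {x} 0<2x with compare 0# x
  ... | tri< 0<x _ _ = 0<x
  ... | tri≈ _ refl _ = ⊥-elim (<-irrefl (subst (0# <_) (+-identityˡ 0#) 0<2x))
  ... | tri> _ _ x<0 = ⊥-elim (<-asym 0<2x (+-neg x<0 x<0))

  pos-product-neg⇒neg : ∀ {x y} → 0# < x * y → x < 0# → y < 0#
  pos-product-neg⇒neg {x} {y} 0<xy x<0 with compare y 0#
  ... | tri< y<0 _ _ = y<0
  ... | tri≈ _ refl _ = ⊥-elim (<-irrefl (subst (0# <_) (zeroʳ x) 0<xy))
  ... | tri> _ _ 0<y = ⊥-elim (<-asym 0<xy (subst (_< 0#) (*-comm y x) (*-pos-neg 0<y x<0)))

  pos-product-sum⇒pos : ∀ {x y} → 0# < x * y → 0# < x + y → (0# < x) × (0# < y)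
  pos-product-sum⇒pos {x} {y} 0<xy 0<x+y with compare x 0#
  ... | tri> _ _ 0<x = 0<x , *-cancelˡ-pos 0<x 0<xy
  ... | tri≈ _ refl _ = ⊥-elim (<-irrefl (subst (0# <_) (zeroˡ y) 0<xy))
  ... | tri< x<0 _ _ = ⊥-elim (<-asym 0<x+y (+-neg x<0 (pos-product-neg⇒neg 0<xy x<0)))

  difference-of-squares⇒< : ∀ {x y} → 0# < x → 0# < y → 0# < (x - y) * (x + y) → y < x
  difference-of-squares⇒< {x} {y} 0<x 0<y 0<[x-y][x+y] =
    0<y-x⇒x<y (*-cancelˡ-pos (+-pos 0<x 0<y) (subst (0# <_) (*-comm (x - y) (x + y)) 0<[x-y][x+y]))

  dist² : Pt → Pt → Carrier
  dist² (ax , ay) (cx , cy) = (ax - cx) * (ax - cx) + (ay - cy) * (ay - cy)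

  dist²-pos : ∀ A C → A ≢ C → 0# < dist² A C
  dist²-pos (ax , ay) (cx , cy) A≢C with compare (ax - cx) 0# | compare (ay - cy) 0#
  ... | tri< _ dx≢0 _ | _ = +-pos-nonneg (square-pos dx≢0) (square-nonneg _)
  ... | tri> _ dx≢0 _ | _ = +-pos-nonneg (square-pos dx≢0) (square-nonneg _)
  ... | tri≈ _ _ _ | tri< _ dy≢0 _ = +-nonneg-pos (square-nonneg _) (square-pos dy≢0)
  ... | tri≈ _ _ _ | tri> _ dy≢0 _ = +-nonneg-pos (square-nonneg _) (square-pos dy≢0)
  ... | tri≈ _ dx≡0 _ | tri≈ _ dy≡0 _ = ⊥-elim (A≢C (cong₂ _,_ (x-y≡0⇒x≡y dx≡0) (x-y≡0⇒x≡y dy≡0)))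

  OnUpperSemicircle : Pt → Set
  OnUpperSemicircle p = (proj₁ p * proj₁ p + proj₂ p * proj₂ p ≡ 1#) × (0# < proj₂ p)

  unit-bounds : ∀ {a b} → OnUpperSemicircle (a , b) → (0# < 1# - a) × (0# < 1# + a)
  unit-bounds {a} {b} (unit , 0<b) = pos-product-sum⇒pos (subst (0# <_) b²≡[1-a][1+a] (*-pos _ _ 0<b 0<b)) 0<sum
    where
    b²≡[1-a][1+a] : b * b ≡ (1# - a) * (1# + a)
    b²≡[1-a][1+a] = begin
      b * b                   ≡⟨ solve 2 (λ a b → b :* b := (a :* a :+ b :* b) :- a :* a) refl a b ⟩
      (a * a + b * b) - a * a ≡⟨ cong (_- a * a) unit ⟩
      1# - a * a              ≡⟨ solve 1 (λ a → con 1ℤ :- a :* a := (con 1ℤ :- a) :* (con 1ℤ :+ a)) refl a ⟩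
      (1# - a) * (1# + a)     ∎
      where open ≡-Reasoning
    0<sum : 0# < (1# - a) + (1# + a)
    0<sum = subst (0# <_) (solve 1 (λ a → con 1ℤ :+ con 1ℤ := (con 1ℤ :- a) :+ (con 1ℤ :+ a)) refl a) (+-pos 0<1 0<1)

  -- U and V below are positive, and a² + b² = c² + d² = 1 turns U² − V² into a positive multiple of a − c.
  orient-east-pos : ∀ {a b c d} → OnUpperSemicircle (a , b) → OnUpperSemicircle (c , d) → c < a →
    0# < orient (1# , 0#) (a , b) (c , d)
  orient-east-pos {a} {b} {c} {d} A@(unitA , 0<b) C@(unitC , 0<d) c<a =
    subst (0# <_) as-orient (x<y⇒0<y-x (difference-of-squares⇒< 0<U 0<V 0<[U-V][U+V]))
    where
    U = b * (1# - c)
    V = d * (1# - a)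
    0<U = *-pos _ _ 0<b (proj₁ (unit-bounds C))
    0<V = *-pos _ _ 0<d (proj₁ (unit-bounds A))
    0<[U-V][U+V] : 0# < (U - V) * (U + V)
    0<[U-V][U+V] = subst (0# <_) (sym (begin
      (U - V) * (U + V)
        ≡⟨ solve 4 (λ a b c d → ((b :* (con 1ℤ :- c)) :- (d :* (con 1ℤ :- a))) :* ((b :* (con 1ℤ :- c)) :+ (d :* (con 1ℤ :- a))) :=
                      ((a :* a :+ b :* b) :- a :* a) :* ((con 1ℤ :- c) :* (con 1ℤ :- c)) :- ((c :* c :+ d :* d) :- c :* c) :* ((con 1ℤ :- a) :* (con 1ℤ :- a)))
                   refl a b c d ⟩
      ((a * a + b * b) - a * a) * ((1# - c) * (1# - c)) - ((c * c + d * d) - c * c) * ((1# - a) * (1# - a))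
        ≡⟨ cong₂ (λ u v → (u - a * a) * ((1# - c) * (1# - c)) - (v - c * c) * ((1# - a) * (1# - a))) unitA unitC ⟩
      (1# - a * a) * ((1# - c) * (1# - c)) - (1# - c * c) * ((1# - a) * (1# - a))
        ≡⟨ solve 2 (λ a c → (con 1ℤ :- a :* a) :* ((con 1ℤ :- c) :* (con 1ℤ :- c)) :- (con 1ℤ :- c :* c) :* ((con 1ℤ :- a) :* (con 1ℤ :- a)) :=
                      ((con 1ℤ :- a) :* (con 1ℤ :- c)) :* ((a :- c) :+ (a :- c))) refl a c ⟩
      ((1# - a) * (1# - c)) * ((a - c) + (a - c)) ∎))
      (*-pos _ _ (*-pos _ _ (proj₁ (unit-bounds A)) (proj₁ (unit-bounds C))) (+-pos (x<y⇒0<y-x c<a) (x<y⇒0<y-x c<a)))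
      where open ≡-Reasoning
    as-orient : U - V ≡ orient (1# , 0#) (a , b) (c , d)
    as-orient = solve 4 (λ a b c d → (b :* (con 1ℤ :- c)) :- (d :* (con 1ℤ :- a)) :=
                                      (a :- con 1ℤ) :* (d :- con 0ℤ) :- (b :- con 0ℤ) :* (c :- con 1ℤ)) refl a b c d

  orient-west-pos : ∀ {a b c d} → OnUpperSemicircle (a , b) → OnUpperSemicircle (c , d) → c < a →
    0# < orient (- 1# , 0#) (a , b) (c , d)
  orient-west-pos {a} {b} {c} {d} A@(unitA , 0<b) C@(unitC , 0<d) c<a =
    subst (0# <_) as-orient (x<y⇒0<y-x (difference-of-squares⇒< 0<U 0<V 0<[U-V][U+V]))
    where
    U = d * (1# + a)
    V = b * (1# + c)
    0<U = *-pos _ _ 0<d (proj₂ (unit-bounds A))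
    0<V = *-pos _ _ 0<b (proj₂ (unit-bounds C))
    0<[U-V][U+V] : 0# < (U - V) * (U + V)
    0<[U-V][U+V] = subst (0# <_) (sym (begin
      (U - V) * (U + V)
        ≡⟨ solve 4 (λ a b c d → ((d :* (con 1ℤ :+ a)) :- (b :* (con 1ℤ :+ c))) :* ((d :* (con 1ℤ :+ a)) :+ (b :* (con 1ℤ :+ c))) :=
                      ((c :* c :+ d :* d) :- c :* c) :* ((con 1ℤ :+ a) :* (con 1ℤ :+ a)) :- ((a :* a :+ b :* b) :- a :* a) :* ((con 1ℤ :+ c) :* (con 1ℤ :+ c)))
                   refl a b c d ⟩
      ((c * c + d * d) - c * c) * ((1# + a) * (1# + a)) - ((a * a + b * b) - a * a) * ((1# + c) * (1# + c))
        ≡⟨ cong₂ (λ v u → (v - c * c) * ((1# + a) * (1# + a)) - (u - a * a) * ((1# + c) * (1# + c))) unitC unitA ⟩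
      (1# - c * c) * ((1# + a) * (1# + a)) - (1# - a * a) * ((1# + c) * (1# + c))
        ≡⟨ solve 2 (λ a c → (con 1ℤ :- c :* c) :* ((con 1ℤ :+ a) :* (con 1ℤ :+ a)) :- (con 1ℤ :- a :* a) :* ((con 1ℤ :+ c) :* (con 1ℤ :+ c)) :=
                      ((con 1ℤ :+ a) :* (con 1ℤ :+ c)) :* ((a :- c) :+ (a :- c))) refl a c ⟩
      ((1# + a) * (1# + c)) * ((a - c) + (a - c)) ∎))
      (*-pos _ _ (*-pos _ _ (proj₂ (unit-bounds A)) (proj₂ (unit-bounds C))) (+-pos (x<y⇒0<y-x c<a) (x<y⇒0<y-x c<a)))
      where open ≡-Reasoning
    as-orient : U - V ≡ orient (- 1# , 0#) (a , b) (c , d)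
    as-orient = solve 4 (λ a b c d → (d :* (con 1ℤ :+ a)) :- (b :* (con 1ℤ :+ c)) :=
                                      (a :- (:- con 1ℤ)) :* (d :- con 0ℤ) :- (b :- con 0ℤ) :* (c :- (:- con 1ℤ))) refl a b c d

  orient-diameter-east : ∀ {s a b c d} → s ≤ 1# → OnUpperSemicircle (a , b) → OnUpperSemicircle (c , d) → c < a →
    0# ≤ (d - b) → 0# < orient (s , 0#) (a , b) (c , d)
  orient-diameter-east {s} {a} {b} {c} {d} s≤1 A C c<a 0≤d-b =
    subst (0# <_) (sym east-form) (+-pos-nonneg (orient-east-pos A C c<a) (*-nonneg (x≤y⇒0≤y-x s≤1) 0≤d-b))
    where
    east-form : orient (s , 0#) (a , b) (c , d) ≡ orient (1# , 0#) (a , b) (c , d) + (1# - s) * (d - b)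
    east-form = solve 5 (λ s a b c d → (a :- s) :* (d :- con 0ℤ) :- (b :- con 0ℤ) :* (c :- s) :=
                  (a :- con 1ℤ) :* (d :- con 0ℤ) :- (b :- con 0ℤ) :* (c :- con 1ℤ) :+ (con 1ℤ :- s) :* (d :- b)) refl s a b c d

  -- orient (s , 0#) A C is affine in s; interpolate between the two ends of the diameter.
  orient-diameter-pos : ∀ {s a b c d} → (- 1#) ≤ s → s ≤ 1# → OnUpperSemicircle (a , b) → OnUpperSemicircle (c , d) → c < a →
    0# < orient (s , 0#) (a , b) (c , d)
  orient-diameter-pos {s} {a} {b} {c} {d} -1≤s s≤1 A C c<a with compare d b
  ... | tri< d<b _ _ = subst (0# <_) (sym west-form) (+-pos-nonneg (orient-west-pos A C c<a) (*-nonneg 0≤s+1 (inj₁ (x<y⇒0<y-x d<b))))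
    where
    0≤s+1 : 0# ≤ (s + 1#)
    0≤s+1 = subst (0# ≤_) (solve 1 (λ s → s :- (:- con 1ℤ) := s :+ con 1ℤ) refl s) (x≤y⇒0≤y-x -1≤s)
    west-form : orient (s , 0#) (a , b) (c , d) ≡ orient (- 1# , 0#) (a , b) (c , d) + (s + 1#) * (b - d)
    west-form = solve 5 (λ s a b c d → (a :- s) :* (d :- con 0ℤ) :- (b :- con 0ℤ) :* (c :- s) :=
                  (a :- (:- con 1ℤ)) :* (d :- con 0ℤ) :- (b :- con 0ℤ) :* (c :- (:- con 1ℤ)) :+ (s :+ con 1ℤ) :* (b :- d)) refl s a b c d
  ... | tri≈ _ d≡b _ = orient-diameter-east s≤1 A C c<a (inj₂ (sym (trans (cong (_- b) d≡b) (-‿inverseʳ b))))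
  ... | tri> _ _ b<d = orient-diameter-east s≤1 A C c<a (inj₁ (x<y⇒0<y-x b<d))

  dot : Pt → Pt → Carrier
  dot (b₁ , b₂) (c₁ , c₂) = b₁ * c₁ + b₂ * c₂

  distinct-unit⇒dot<1 : ∀ B C → dot B B ≡ 1# → dot C C ≡ 1# → B ≢ C → 0# < 1# - dot B C
  distinct-unit⇒dot<1 B@(b₁ , b₂) C@(c₁ , c₂) |B|≡1 |C|≡1 B≢C = half-pos (subst (0# <_) dist²≡2[1-B·C] (dist²-pos B C B≢C))
    where
    dist²≡2[1-B·C] : dist² B C ≡ (1# - dot B C) + (1# - dot B C)
    dist²≡2[1-B·C] = trans
      (solve 4 (λ b₁ b₂ c₁ c₂ → (b₁ :- c₁) :* (b₁ :- c₁) :+ (b₂ :- c₂) :* (b₂ :- c₂) :=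
                 ((b₁ :* b₁ :+ b₂ :* b₂) :- (b₁ :* c₁ :+ b₂ :* c₂)) :+ ((c₁ :* c₁ :+ c₂ :* c₂) :- (b₁ :* c₁ :+ b₂ :* c₂))) refl b₁ b₂ c₁ c₂)
      (cong₂ (λ u v → (u - dot B C) + (v - dot B C)) |B|≡1 |C|≡1)

  -- orient A B C · |B|² = orient O A B · (|B|² − B·C) + orient O B C · (|B|² − A·B), with O the origin.
  orient-semicircle-pos : ∀ {a₁ a₂ b₁ b₂ c₁ c₂} → OnUpperSemicircle (a₁ , a₂) → OnUpperSemicircle (b₁ , b₂) → OnUpperSemicircle (c₁ , c₂) →
    b₁ < a₁ → c₁ < b₁ → 0# < orient (a₁ , a₂) (b₁ , b₂) (c₁ , c₂)
  orient-semicircle-pos {a₁} {a₂} {b₁} {b₂} {c₁} {c₂} A@(|A|≡1 , _) B@(|B|≡1 , _) C@(|C|≡1 , _) b₁<a₁ c₁<b₁ =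
    subst (0# <_) (sym (begin
      ABC                                               ≡⟨ sym (*-identityʳ ABC) ⟩
      ABC * 1#                                          ≡⟨ cong (ABC *_) (sym |B|≡1) ⟩
      ABC * |B|²                                        ≡⟨ identity ⟩
      OAB * (|B|² - dot B′ C′) + OBC * (|B|² - dot A′ B′) ≡⟨ cong (λ u → OAB * (u - dot B′ C′) + OBC * (u - dot A′ B′)) |B|≡1 ⟩
      OAB * (1# - dot B′ C′) + OBC * (1# - dot A′ B′)     ∎))
      (+-pos (*-pos _ _ (orient-diameter-pos -1≤0 0≤1 A B b₁<a₁) (distinct-unit⇒dot<1 B′ C′ |B|≡1 |C|≡1 (λ e → <⇒≢ c₁<b₁ (sym (cong proj₁ e)))))
             (*-pos _ _ (orient-diameter-pos -1≤0 0≤1 B C c₁<b₁) (distinct-unit⇒dot<1 A′ B′ |A|≡1 |B|≡1 (λ e → <⇒≢ b₁<a₁ (sym (cong proj₁ e))))))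
    where
    open ≡-Reasoning
    A′ = (a₁ , a₂)
    B′ = (b₁ , b₂)
    C′ = (c₁ , c₂)
    O = (0# , 0#)
    ABC = orient A′ B′ C′
    OAB = orient O A′ B′
    OBC = orient O B′ C′
    |B|² = dot B′ B′
    -1≤0 : (- 1#) ≤ 0#
    -1≤0 = inj₁ (0<x⇒-x<0 0<1)
    0≤1 : 0# ≤ 1#
    0≤1 = inj₁ 0<1
    identity : ABC * |B|² ≡ OAB * (|B|² - dot B′ C′) + OBC * (|B|² - dot A′ B′)
    identity = solve 6 (λ a₁ a₂ b₁ b₂ c₁ c₂ →
      ((b₁ :- a₁) :* (c₂ :- a₂) :- (b₂ :- a₂) :* (c₁ :- a₁)) :* (b₁ :* b₁ :+ b₂ :* b₂) :=
      ((a₁ :- con 0ℤ) :* (b₂ :- con 0ℤ) :- (a₂ :- con 0ℤ) :* (b₁ :- con 0ℤ)) :* ((b₁ :* b₁ :+ b₂ :* b₂) :- (b₁ :* c₁ :+ b₂ :* c₂))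
      :+ ((b₁ :- con 0ℤ) :* (c₂ :- con 0ℤ) :- (b₂ :- con 0ℤ) :* (c₁ :- con 0ℤ)) :* ((b₁ :* b₁ :+ b₂ :* b₂) :- (a₁ :* b₁ :+ a₂ :* b₂)))
      refl a₁ a₂ b₁ b₂ c₁ c₂

module SemicircularRanking (F : OrderedField) where
  open Semicircle F public

  between-on-axis : ∀ {p q r} → p < q → q < r → Between (p , 0#) (q , 0#) (r , 0#)
  between-on-axis {p} {q} {r} p<q q<r =
    (r - q) * I , (q - p) * I , inj₁ (*-pos _ _ (x<y⇒0<y-x q<r) 0<I) , inj₁ (*-pos _ _ (x<y⇒0<y-x p<q) 0<I) , sum≡1 , abscissa , ordinate
    where
    0<r-p = x<y⇒0<y-x (<-trans p<q q<r)
    I = inv (r - p) 0<r-p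
    0<I = inv-pos (r - p) 0<r-p
    sum≡1 : (r - q) * I + (q - p) * I ≡ 1#
    sum≡1 = trans (solve 4 (λ p q r i → (r :- q) :* i :+ (q :- p) :* i := (r :- p) :* i) refl p q r I) (inv-inverseʳ _ 0<r-p)
    abscissa : (r - q) * I * p + (q - p) * I * r ≡ q
    abscissa = begin
      (r - q) * I * p + (q - p) * I * r ≡⟨ solve 4 (λ p q r i → (r :- q) :* i :* p :+ (q :- p) :* i :* r := q :* ((r :- p) :* i)) refl p q r I ⟩
      q * ((r - p) * I)                 ≡⟨ cong (q *_) (inv-inverseʳ _ 0<r-p) ⟩
      q * 1#                            ≡⟨ *-identityʳ q ⟩
      q                                 ∎
      where open ≡-Reasoning
    ordinate : (r - q) * I * 0# + (q - p) * I * 0# ≡ 0#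
    ordinate = solve 2 (λ a b → a :* con 0ℤ :+ b :* con 0ℤ := con 0ℤ) refl ((r - q) * I) ((q - p) * I)

  strictMono⇒injective : ∀ {n} (f : Fin n → Carrier) → (∀ i j → i <ᶠ j → f i < f j) → ∀ i j → f i ≡ f j → i ≡ j
  strictMono⇒injective f mono i j fi≡fj with FP.<-cmp i j
  ... | tri< i<j _ _ = ⊥-elim (<⇒≢ (mono i j i<j) fi≡fj)
  ... | tri≈ _ i≡j _ = i≡j
  ... | tri> _ _ j<i = ⊥-elim (<⇒≢ (mono j i j<i) (sym fi≡fj))

  -- Counterclockwise from x₀ = −1 the points of S_{a,b} are x₀, …, x_{a+1}, y_{b−1}, …, y₀;
  -- the rank is the position in this list, and the xᵢ form the base.
  module SemiConfRanking {a b : ℕ} (C : SemiConf a b) where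
    A2 : ℕ
    A2 = suc (suc a)
    N : ℕ
    N = A2 +ℕ b

    data View (p : Fin N) : Set where
      isX : ∀ i → p ≡ X {a} {b} i → View p
      isY : ∀ j → p ≡ Y {a} {b} j → View p

    view : ∀ p → View p
    view p with splitAt A2 {b} p in eq
    ... | inj₁ i = isX i (trans (sym (FP.join-splitAt A2 b p)) (cong (join A2 b) eq))
    ... | inj₂ j = isY j (trans (sym (FP.join-splitAt A2 b p)) (cong (join A2 b) eq))

    rankSum : Fin A2 ⊎ Fin b → ℕ
    rankSum (inj₁ i) = toℕ i
    rankSum (inj₂ j) = A2 +ℕ (b ∸ suc (toℕ j))

    onBaseSum : Fin A2 ⊎ Fin b → Bool
    onBaseSum (inj₁ i) = true
    onBaseSum (inj₂ j) = false

    pointSum : Fin A2 ⊎ Fin b → Pt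
    pointSum = [ (λ i → xs C i , 0#) , ys C ]

    rank : Fin N → ℕ
    rank p = rankSum (splitAt A2 {b} p)

    onBase : Fin N → Bool
    onBase p = onBaseSum (splitAt A2 {b} p)

    infix 4 _≺_
    _≺_ : Fin N → Fin N → Set
    p ≺ q = rank p <ℕ rank q

    rank-X : ∀ i → rank (X {a} {b} i) ≡ toℕ i
    rank-X i = cong rankSum (FP.splitAt-↑ˡ A2 i b)

    rank-Y : ∀ j → rank (Y {a} {b} j) ≡ A2 +ℕ (b ∸ suc (toℕ j))
    rank-Y j = cong rankSum (FP.splitAt-↑ʳ A2 b j)

    X∈base : ∀ i → T (onBase (X {a} {b} i))
    X∈base i = subst T (sym (cong onBaseSum (FP.splitAt-↑ˡ A2 i b))) tt

    Y∉base : ∀ {j} → ¬ T (onBase (Y {a} {b} j))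
    Y∉base {j} = subst T (cong onBaseSum (FP.splitAt-↑ʳ A2 b j))

    pos-X : ∀ i → pos C (X {a} {b} i) ≡ (xs C i , 0#)
    pos-X i = cong pointSum (FP.splitAt-↑ˡ A2 i b)

    pos-Y : ∀ j → pos C (Y {a} {b} j) ≡ ys C j
    pos-Y j = cong pointSum (FP.splitAt-↑ʳ A2 b j)

    rank-X< : ∀ i → rank (X {a} {b} i) <ℕ A2
    rank-X< i = subst (_<ℕ A2) (sym (rank-X i)) (FP.toℕ<n i)

    rank-Y≥ : ∀ j → A2 ≤ℕ rank (Y {a} {b} j)
    rank-Y≥ j = subst (A2 ≤ℕ_) (sym (rank-Y j)) (ℕP.m≤m+n A2 _)

    X≺Y : ∀ i j → X {a} {b} i ≺ Y {a} {b} j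
    X≺Y i j = ℕP.<-≤-trans (rank-X< i) (rank-Y≥ j)

    Y⊀X : ∀ i j → ¬ (Y {a} {b} j ≺ X {a} {b} i)
    Y⊀X i j Y≺X = ℕP.<-asym Y≺X (X≺Y i j)

    <⇒X≺X : ∀ i i′ → toℕ i <ℕ toℕ i′ → X {a} {b} i ≺ X {a} {b} i′
    <⇒X≺X i i′ = subst₂ _<ℕ_ (sym (rank-X i)) (sym (rank-X i′))

    X≺X⇒< : ∀ i i′ → X {a} {b} i ≺ X {a} {b} i′ → toℕ i <ℕ toℕ i′
    X≺X⇒< i i′ = subst₂ _<ℕ_ (rank-X i) (rank-X i′)

    >⇒Y≺Y : ∀ j j′ → toℕ j′ <ℕ toℕ j → Y {a} {b} j ≺ Y {a} {b} j′
    >⇒Y≺Y j j′ j′<j = subst₂ _<ℕ_ (sym (rank-Y j)) (sym (rank-Y j′)) (ℕP.+-monoʳ-< A2 (ℕP.∸-monoʳ-< (s≤s j′<j) (FP.toℕ<n j)))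

    Y≺Y⇒> : ∀ j j′ → Y {a} {b} j ≺ Y {a} {b} j′ → toℕ j′ <ℕ toℕ j
    Y≺Y⇒> j j′ Y≺Y with ℕP.<-cmp (toℕ j′) (toℕ j)
    ... | tri< j′<j _ _ = j′<j
    ... | tri≈ _ j′≡j _ = ⊥-elim (ℕP.<-irrefl (cong rank (cong (Y {a} {b}) (FP.toℕ-injective (sym j′≡j)))) Y≺Y)
    ... | tri> _ _ j<j′ = ⊥-elim (ℕP.<-asym Y≺Y (>⇒Y≺Y j′ j j<j′))

    -1≤x : ∀ i → (- 1#) ≤ xs C i
    -1≤x zero = inj₂ (sym (x-first C))
    -1≤x (suc i) = inj₁ (subst (_< xs C (suc i)) (x-first C) (x-inc C zero (suc i) (s≤s z≤n)))

    x≤1 : ∀ i → xs C i ≤ 1#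
    x≤1 i with FP.<-cmp i (fromℕ (suc a))
    ... | tri< i<last _ _ = inj₁ (subst (xs C i <_) (x-last C) (x-inc C i (fromℕ (suc a)) i<last))
    ... | tri≈ _ refl _ = inj₂ (x-last C)
    ... | tri> _ _ last<i = ⊥-elim (ℕP.<-irrefl refl (ℕP.<-≤-trans last<i (FP.≤fromℕ i)))

    y-on-semicircle : ∀ j → OnUpperSemicircle (ys C j)
    y-on-semicircle j = y-unit C j , y-upper C j

    data Ccw (p q r : Fin N) : Set where
      collinear : T (onBase r) → orient (pos C p) (pos C q) (pos C r) ≡ 0# → Ccw p q r
      strict : 0# < orient (pos C p) (pos C q) (pos C r) → Ccw p q r

    orient-via : ∀ p q r {P Q R} → pos C p ≡ P → pos C q ≡ Q → pos C r ≡ R → orient (pos C p) (pos C q) (pos C r) ≡ orient P Q R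
    orient-via p q r refl refl refl = refl

    ccw : ∀ p q r → p ≺ q → q ≺ r → Ccw p q r
    ccw p q r p≺q q≺r with view p | view q | view r
    ... | isY _ refl | isX i refl | _ = ⊥-elim (Y⊀X i _ p≺q)
    ... | _ | isY _ refl | isX k refl = ⊥-elim (Y⊀X k _ q≺r)
    ... | isX i refl | isX j refl | isX k refl =
      collinear (X∈base k) (trans (orient-via p q r (pos-X i) (pos-X j) (pos-X k))
        (solve 3 (λ p q r → (q :- p) :* (con 0ℤ :- con 0ℤ) :- (con 0ℤ :- con 0ℤ) :* (r :- p) := con 0ℤ) refl (xs C i) (xs C j) (xs C k)))
    ... | isX i refl | isX j refl | isY k refl =
      strict (subst (0# <_) (sym (orient-via p q r (pos-X i) (pos-X j) (pos-Y k)))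
        (subst (0# <_) (solve 4 (λ p q u v → (q :- p) :* v := (q :- p) :* (v :- con 0ℤ) :- (con 0ℤ :- con 0ℤ) :* (u :- p)) refl (xs C i) (xs C j) (proj₁ (ys C k)) (proj₂ (ys C k)))
          (*-pos _ _ (x<y⇒0<y-x (x-inc C i j (X≺X⇒< i j p≺q))) (y-upper C k))))
    ... | isX i refl | isY j refl | isY k refl =
      strict (subst (0# <_) (sym (orient-via p q r (pos-X i) (pos-Y j) (pos-Y k)))
        (orient-diameter-pos (-1≤x i) (x≤1 i) (y-on-semicircle j) (y-on-semicircle k) (y-arg-dec C k j (Y≺Y⇒> j k q≺r))))
    ... | isY i refl | isY j refl | isY k refl =
      strict (subst (0# <_) (sym (orient-via p q r (pos-Y i) (pos-Y j) (pos-Y k)))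
        (orient-semicircle-pos (y-on-semicircle i) (y-on-semicircle j) (y-on-semicircle k)
          (y-arg-dec C j i (Y≺Y⇒> i j p≺q)) (y-arg-dec C k j (Y≺Y⇒> j k q≺r))))

    rank-injective : ∀ p q → rank p ≡ rank q → p ≡ q
    rank-injective p q e with view p | view q
    ... | isX i refl | isX i′ refl = cong (X {a} {b}) (FP.toℕ-injective (trans (sym (rank-X i)) (trans e (rank-X i′))))
    ... | isX i refl | isY j refl = ⊥-elim (ℕP.<-irrefl e (X≺Y i j))
    ... | isY j refl | isX i refl = ⊥-elim (ℕP.<-irrefl (sym e) (X≺Y i j))
    ... | isY j refl | isY j′ refl = cong (Y {a} {b}) (FP.toℕ-injective (ℕP.suc-injective (ℕP.∸-cancelˡ-≡ (FP.toℕ<n j) (FP.toℕ<n j′)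
                                       (ℕP.+-cancelˡ-≡ A2 _ _ (trans (sym (rank-Y j)) (trans e (rank-Y j′)))))))

    onBase-downward : ∀ p q → p ≺ q → T (onBase q) → T (onBase p)
    onBase-downward p q p≺q q∈ with view p | view q
    ... | _ | isY j refl = ⊥-elim (Y∉base q∈)
    ... | isX i refl | isX _ refl = X∈base i
    ... | isY j refl | isX i refl = ⊥-elim (Y⊀X i j p≺q)

    onBase-abscissa : ∀ p q → T (onBase p) → T (onBase q) → p ≺ q → proj₁ (pos C p) < proj₁ (pos C q)
    onBase-abscissa p q p∈ q∈ p≺q with view p | view q
    ... | isY j refl | _ = ⊥-elim (Y∉base p∈)
    ... | isX _ refl | isY j refl = ⊥-elim (Y∉base q∈)
    ... | isX i refl | isX i′ refl = subst₂ _<_ (cong proj₁ (sym (pos-X i))) (cong proj₁ (sym (pos-X i′))) (x-inc C i i′ (X≺X⇒< i i′ p≺q))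

    onBase-between : ∀ p q r → p ≺ q → q ≺ r → T (onBase r) → Between (pos C p) (pos C q) (pos C r)
    onBase-between p q r p≺q q≺r r∈ with view p | view q | view r
    ... | _ | _ | isY k refl = ⊥-elim (Y∉base r∈)
    ... | _ | isY j refl | isX k refl = ⊥-elim (Y⊀X k j q≺r)
    ... | isY i refl | isX j refl | isX k refl = ⊥-elim (Y⊀X j i p≺q)
    ... | isX i refl | isX j refl | isX k refl rewrite pos-X i | pos-X j | pos-X k =
      between-on-axis (x-inc C i j (X≺X⇒< i j p≺q)) (x-inc C j k (X≺X⇒< j k q≺r))

    point-injective : ∀ p q → pos C p ≡ pos C q → p ≡ q
    point-injective p q e with view p | view q
    ... | isX i refl | isX i′ refl =
      cong (X {a} {b}) (strictMono⇒injective (xs C) (x-inc C) i i′ (trans (cong proj₁ (sym (pos-X i))) (trans (cong proj₁ e) (cong proj₁ (pos-X i′)))))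
    ... | isX i refl | isY j refl = ⊥-elim (<⇒≢ (y-upper C j) (trans (cong proj₂ (sym (pos-X i))) (trans (cong proj₂ e) (cong proj₂ (pos-Y j)))))
    ... | isY j refl | isX i refl = ⊥-elim (<⇒≢ (y-upper C j) (sym (trans (cong proj₂ (sym (pos-Y j))) (trans (cong proj₂ e) (cong proj₂ (pos-X i))))))
    ... | isY j refl | isY j′ refl =
      cong (Y {a} {b}) (strictMono⇒injective (λ j → proj₁ (ys C j)) (y-arg-dec C) j j′ (trans (cong proj₁ (sym (pos-Y j))) (trans (cong proj₁ e) (cong proj₁ (pos-Y j′)))))

    ranked : RankedConfiguration N
    ranked = record
      { point = pos C ; point-injective = point-injective ; rank = rank ; rank-injective = rank-injective
      ; onBase = onBase ; onBase-downward = onBase-downward ; onBase-abscissa = onBase-abscissa ; onBase-between = onBase-between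
      ; orient-nonneg = λ p q r p≺q q≺r → ccw⇒nonneg (ccw p q r p≺q q≺r)
      ; orient-pos = λ p q r p≺q q≺r r∉ → ccw⇒pos r∉ (ccw p q r p≺q q≺r) }
      where
      ccw⇒nonneg : ∀ {p q r} → Ccw p q r → 0# ≤ orient (pos C p) (pos C q) (pos C r)
      ccw⇒nonneg (collinear _ e) = inj₂ (sym e)
      ccw⇒nonneg (strict 0<o) = inj₁ 0<o
      ccw⇒pos : ∀ {p q r} → ¬ T (onBase r) → Ccw p q r → 0# < orient (pos C p) (pos C q) (pos C r)
      ccw⇒pos r∉ (collinear r∈ _) = ⊥-elim (r∉ r∈)
      ccw⇒pos _ (strict 0<o) = 0<o

  semiRanked : ∀ {a b} → SemiConf a b → RankedConfiguration (suc (suc a) +ℕ b)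
  semiRanked C = SemiConfRanking.ranked C

module Collinearity (F : OrderedField) where
  open SemicircularRanking F public

  module Reciprocal (d : Carrier) (0<d : 0# < d) where
    I : Carrier
    I = inv d 0<d
    0<I : 0# < I
    0<I = inv-pos d 0<d
    d*I≡1 : d * I ≡ 1#
    d*I≡1 = inv-inverseʳ d 0<d

  -- With u = Q − P, w = R − P, U = |u|² and s = u·w, collinearity gives U·w = s·u, so R sits at
  -- parameter s/U on the line through P (parameter 0) and Q (parameter 1).
  module CollinearTriple (px py qx qy rx ry : Carrier) (collinear : orient (px , py) (qx , qy) (rx , ry) ≡ 0#) (Q≢P : (qx , qy) ≢ (px , py)) where
    ux uy wx wy U s : Carrier
    ux = qx - px
    uy = qy - py
    wx = rx - px
    wy = ry - py
    U = ux * ux + uy * uy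
    s = ux * wx + uy * wy
    cross≡0 : ux * wy - uy * wx ≡ 0#
    cross≡0 = collinear
    0<U : 0# < U
    0<U = dist²-pos (qx , qy) (px , py) Q≢P
    U*wx≡s*ux : U * wx ≡ s * ux
    U*wx≡s*ux = trans (solve 4 (λ ux uy wx wy → ((ux :* ux :+ uy :* uy) :* wx) := ((ux :* wx :+ uy :* wy) :* ux :+ (:- uy) :* (ux :* wy :- uy :* wx))) refl ux uy wx wy)
            (trans (cong (λ c → s * ux + (- uy) * c) cross≡0) (trans (cong (s * ux +_) (zeroʳ _)) (+-identityʳ _)))
    U*wy≡s*uy : U * wy ≡ s * uy
    U*wy≡s*uy = trans (solve 4 (λ ux uy wx wy → ((ux :* ux :+ uy :* uy) :* wy) := ((ux :* wx :+ uy :* wy) :* uy :+ ux :* (ux :* wy :- uy :* wx))) refl ux uy wx wy)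
            (trans (cong (λ c → s * uy + ux * c) cross≡0) (trans (cong (s * uy +_) (zeroʳ _)) (+-identityʳ _)))
    x≡base+offset : ∀ b x → x ≡ b + (x - b)
    x≡base+offset b x = solve 2 (λ b x → x := (b :+ (x :- b))) refl b x

    P-between : s < 0# → Between (qx , qy) (px , py) (rx , ry)
    P-between s<0 = α , β , inj₁ (*-pos _ _ (x<0⇒0<-x s<0) D.0<I) , inj₁ (*-pos _ _ 0<U D.0<I) , α+β≡1 , ex , ey
      where
      module D = Reciprocal (U - s) (+-pos 0<U (x<0⇒0<-x s<0))
      α = (- s) * D.I
      β = U * D.I
      α+β≡1 : α + β ≡ 1#
      α+β≡1 = trans (solve 3 (λ s u i → ((:- s) :* i :+ u :* i) := ((u :- s) :* i)) refl s U D.I) D.d*I≡1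
      combine : ∀ p u w → U * w ≡ s * u → α * (p + u) + β * (p + w) ≡ p
      combine p u w e = trans (solve 6 (λ s uu i p u w → ((:- s) :* i :* (p :+ u) :+ uu :* i :* (p :+ w)) := (p :* ((uu :- s) :* i) :+ i :* (uu :* w :- s :* u))) refl s U D.I p u w)
                     (trans (cong₂ (λ x y → p * x + D.I * y) D.d*I≡1 (trans (cong (_- (s * u)) e) (-‿inverseʳ (s * u))))
                     (trans (cong₂ _+_ (*-identityʳ p) (zeroʳ D.I)) (+-identityʳ p)))
      ex = trans (cong₂ (λ a b → α * a + β * b) (x≡base+offset px qx) (x≡base+offset px rx)) (combine px ux wx U*wx≡s*ux)
      ey = trans (cong₂ (λ a b → α * a + β * b) (x≡base+offset py qy) (x≡base+offset py ry)) (combine py uy wy U*wy≡s*uy)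

    R-between : 0# < s → s ≤ U → Between (px , py) (rx , ry) (qx , qy)
    R-between 0<s s≤U = α , β , 0≤α , inj₁ (*-pos _ _ 0<s D.0<I) , α+β≡1 , ex , ey
      where
      module D = Reciprocal U 0<U
      α = (U - s) * D.I
      β = s * D.I
      0≤α : 0# ≤ α
      0≤α = *-nonneg (x≤y⇒0≤y-x s≤U) (inj₁ D.0<I)
      α+β≡1 : α + β ≡ 1#
      α+β≡1 = trans (solve 3 (λ s u i → ((u :- s) :* i :+ s :* i) := (u :* i)) refl s U D.I) D.d*I≡1
      combine : ∀ p u w → U * w ≡ s * u → α * p + β * (p + u) ≡ p + w
      combine p u w e = trans (solve 6 (λ s uu i p u w → ((uu :- s) :* i :* p :+ s :* i :* (p :+ u)) := (p :* (uu :* i) :+ i :* (s :* u))) refl s U D.I p u w)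
                     (trans (cong₂ (λ x y → p * x + D.I * y) D.d*I≡1 (sym e))
                     (trans (cong₂ _+_ (*-identityʳ p) (solve 3 (λ i s u → (i :* (s :* u)) := ((s :* i) :* u)) refl D.I U w)) (trans (cong (λ x → p + x * w) D.d*I≡1) (cong (p +_) (*-identityˡ w)))))
      ex = trans (cong (λ b → α * px + β * b) (x≡base+offset px qx)) (trans (combine px ux wx U*wx≡s*ux) (sym (x≡base+offset px rx)))
      ey = trans (cong (λ b → α * py + β * b) (x≡base+offset py qy)) (trans (combine py uy wy U*wy≡s*uy) (sym (x≡base+offset py ry)))

    Q-between : U < s → Between (px , py) (qx , qy) (rx , ry)
    Q-between U<s = α , β , inj₁ (*-pos _ _ (x<y⇒0<y-x U<s) D.0<I) , inj₁ (*-pos _ _ 0<U D.0<I) , α+β≡1 , ex , ey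
      where
      module D = Reciprocal s (<-trans 0<U U<s)
      α = (s - U) * D.I
      β = U * D.I
      α+β≡1 : α + β ≡ 1#
      α+β≡1 = trans (solve 3 (λ s u i → ((s :- u) :* i :+ u :* i) := (s :* i)) refl s U D.I) D.d*I≡1
      combine : ∀ p u w → U * w ≡ s * u → α * p + β * (p + w) ≡ p + u
      combine p u w e = trans (solve 6 (λ s uu i p u w → ((s :- uu) :* i :* p :+ uu :* i :* (p :+ w)) := (p :* (s :* i) :+ i :* (uu :* w))) refl s U D.I p u w)
                     (trans (cong₂ (λ x y → p * x + D.I * y) D.d*I≡1 e)
                     (trans (cong₂ _+_ (*-identityʳ p) (solve 3 (λ i s u → (i :* (s :* u)) := ((s :* i) :* u)) refl D.I s u)) (trans (cong (λ x → p + x * u) D.d*I≡1) (cong (p +_) (*-identityˡ u)))))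
      ex = trans (cong (λ b → α * px + β * b) (x≡base+offset px rx)) (trans (combine px ux wx U*wx≡s*ux) (sym (x≡base+offset px qx)))
      ey = trans (cong (λ b → α * py + β * b) (x≡base+offset py ry)) (trans (combine py uy wy U*wy≡s*uy) (sym (x≡base+offset py qy)))

    s≡0⇒R≡P : s ≡ 0# → (rx , ry) ≡ (px , py)
    s≡0⇒R≡P s≡0 = cong₂ _,_ (x-y≡0⇒x≡y (w≡0 wx U*wx≡s*ux)) (x-y≡0⇒x≡y (w≡0 wy U*wy≡s*uy))
      where
      w≡0 : ∀ w {u} → U * w ≡ s * u → w ≡ 0#
      w≡0 w {u} e with compare w 0#
      ... | tri≈ _ w≡0 _ = w≡0
      ... | tri< w<0 _ _ = ⊥-elim (<⇒≢ (*-pos-neg 0<U w<0) (trans e (trans (cong (_* u) s≡0) (zeroˡ u))))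
      ... | tri> _ _ 0<w = ⊥-elim (<⇒≢ (*-pos _ _ 0<U 0<w) (sym (trans e (trans (cong (_* u) s≡0) (zeroˡ u)))))

  collinear⇒between : ∀ (P Q R : Pt) → orient P Q R ≡ 0# → Q ≢ P → R ≢ P →
    Between Q P R ⊎ Between P R Q ⊎ Between P Q R
  collinear⇒between (px , py) (qx , qy) (rx , ry) collinear Q≢P R≢P = by-position (compare s 0#) (compare s U)
    where
    open CollinearTriple px py qx qy rx ry collinear Q≢P
    by-position : Tri (s < 0#) (s ≡ 0#) (0# < s) → Tri (s < U) (s ≡ U) (U < s) →
      Between (qx , qy) (px , py) (rx , ry) ⊎ Between (px , py) (rx , ry) (qx , qy) ⊎ Between (px , py) (qx , qy) (rx , ry)
    by-position (tri< s<0 _ _) _ = inj₁ (P-between s<0)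
    by-position (tri≈ _ s≡0 _) _ = ⊥-elim (R≢P (s≡0⇒R≡P s≡0))
    by-position (tri> _ _ 0<s) (tri< s<U _ _) = inj₂ (inj₁ (R-between 0<s (inj₁ s<U)))
    by-position (tri> _ _ 0<s) (tri≈ _ s≡U _) = inj₂ (inj₁ (R-between 0<s (inj₂ s≡U)))
    by-position (tri> _ _ _) (tri> _ _ U<s) = inj₂ (inj₂ (Q-between U<s))

  barycentric-identityˣ : ∀ (P A B C : Pt) →
    orient P B C * proj₁ A + orient P C A * proj₁ B + orient P A B * proj₁ C ≡ (orient P B C + orient P C A + orient P A B) * proj₁ P
  barycentric-identityˣ (p , p′) (a , a′) (b , b′) (c , c′) = solve 8 (λ p p′ a a′ b b′ c c′ →
    (((b :- p) :* (c′ :- p′) :- (b′ :- p′) :* (c :- p)) :* a :+ ((c :- p) :* (a′ :- p′) :- (c′ :- p′) :* (a :- p)) :* b :+ ((a :- p) :* (b′ :- p′) :- (a′ :- p′) :* (b :- p)) :* c) :=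
    ((((b :- p) :* (c′ :- p′) :- (b′ :- p′) :* (c :- p)) :+ ((c :- p) :* (a′ :- p′) :- (c′ :- p′) :* (a :- p)) :+ ((a :- p) :* (b′ :- p′) :- (a′ :- p′) :* (b :- p))) :* p)) refl p p′ a a′ b b′ c c′

  barycentric-identityʸ : ∀ (P A B C : Pt) →
    orient P B C * proj₂ A + orient P C A * proj₂ B + orient P A B * proj₂ C ≡ (orient P B C + orient P C A + orient P A B) * proj₂ P
  barycentric-identityʸ (p , p′) (a , a′) (b , b′) (c , c′) = solve 8 (λ p p′ a a′ b b′ c c′ →
    (((b :- p) :* (c′ :- p′) :- (b′ :- p′) :* (c :- p)) :* a′ :+ ((c :- p) :* (a′ :- p′) :- (c′ :- p′) :* (a :- p)) :* b′ :+ ((a :- p) :* (b′ :- p′) :- (a′ :- p′) :* (b :- p)) :* c′) :=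
    ((((b :- p) :* (c′ :- p′) :- (b′ :- p′) :* (c :- p)) :+ ((c :- p) :* (a′ :- p′) :- (c′ :- p′) :* (a :- p)) :+ ((a :- p) :* (b′ :- p′) :- (a′ :- p′) :* (b :- p))) :* p′)) refl p p′ a a′ b b′ c c′

  InHull-barycentric : ∀ {N} (pos : Fin N → Pt) (S : Fin N → Bool) (p a b c : Fin N) → T (S a) → T (S b) → T (S c) →
    0# ≤ orient (pos p) (pos b) (pos c) → 0# ≤ orient (pos p) (pos c) (pos a) → 0# ≤ orient (pos p) (pos a) (pos b) →
    0# < orient (pos p) (pos b) (pos c) + orient (pos p) (pos c) (pos a) + orient (pos p) (pos a) (pos b) →
    InHull pos S (pos p)
  InHull-barycentric pos S p a b c a∈ b∈ c∈ 0≤α 0≤β 0≤γ 0<Σ =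
    subst (InHull pos S) (cong₂ _,_ (normalise _ _ _ _ (barycentric-identityˣ P A B C)) (normalise _ _ _ _ (barycentric-identityʸ P A B C)))
      (InHull-combination₃ pos S a b c a∈ b∈ c∈ (*-nonneg 0≤α (inj₁ D.0<I)) (*-nonneg 0≤β (inj₁ D.0<I)) (*-nonneg 0≤γ (inj₁ D.0<I))
        (trans (solve 4 (λ x y z i → (x :* i :+ y :* i :+ z :* i) := ((x :+ y :+ z) :* i)) refl α β γ D.I) D.d*I≡1))
    where
    P = pos p
    A = pos a
    B = pos b
    C = pos c
    α = orient P B C
    β = orient P C A
    γ = orient P A B
    module D = Reciprocal (α + β + γ) 0<Σ
    normalise : ∀ x y z w → α * x + β * y + γ * z ≡ (α + β + γ) * w → α * D.I * x + β * D.I * y + γ * D.I * z ≡ w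
    normalise x y z w e = trans (solve 7 (λ a b g i x y z → (a :* i :* x :+ b :* i :* y :+ g :* i :* z) := (i :* (a :* x :+ b :* y :+ g :* z))) refl α β γ D.I x y z)
                    (trans (cong (D.I *_) e) (trans (solve 3 (λ i s w → (i :* (s :* w)) := ((s :* i) :* w)) refl D.I (α + β + γ) w) (trans (cong (_* w) D.d*I≡1) (*-identityˡ w))))

module ConvexPolygons (F : OrderedField) where
  open Collinearity F public

  count : ∀ {N} {P : Fin N → Set} → (∀ t → Dec (P t)) → ℕ
  count {zero} P? = 0
  count {suc N} P? with P? zero
  ... | yes _ = suc (count (λ t → P? (suc t)))
  ... | no _ = count (λ t → P? (suc t))

  count-≤ : ∀ {N} {P Q : Fin N → Set} (P? : ∀ t → Dec (P t)) (Q? : ∀ t → Dec (Q t)) → (∀ t → P t → Q t) → count P? ≤ℕ count Q?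
  count-≤ {zero} P? Q? P⊆Q = ℕP.≤-refl
  count-≤ {suc N} P? Q? P⊆Q with P? zero | Q? zero
  ... | yes _ | yes _ = s≤s (count-≤ _ _ (λ t → P⊆Q (suc t)))
  ... | yes p₀ | no ¬q₀ = ⊥-elim (¬q₀ (P⊆Q zero p₀))
  ... | no _ | yes _ = ℕP.m≤n⇒m≤1+n (count-≤ _ _ (λ t → P⊆Q (suc t)))
  ... | no _ | no _ = count-≤ _ _ (λ t → P⊆Q (suc t))

  count-< : ∀ {N} {P Q : Fin N → Set} (P? : ∀ t → Dec (P t)) (Q? : ∀ t → Dec (Q t)) → (∀ t → P t → Q t) →
    ∀ a → Q a → ¬ P a → count P? <ℕ count Q?
  count-< {suc N} P? Q? P⊆Q zero q₀ ¬p₀ with P? zero | Q? zero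
  ... | yes p₀ | _ = ⊥-elim (¬p₀ p₀)
  ... | no _ | no ¬q₀ = ⊥-elim (¬q₀ q₀)
  ... | no _ | yes _ = s≤s (count-≤ _ _ (λ t → P⊆Q (suc t)))
  count-< {suc N} P? Q? P⊆Q (suc a) qₐ ¬pₐ with P? zero | Q? zero
  ... | yes _ | yes _ = s≤s (count-< _ _ (λ t → P⊆Q (suc t)) a qₐ ¬pₐ)
  ... | yes p₀ | no ¬q₀ = ⊥-elim (¬q₀ (P⊆Q zero p₀))
  ... | no _ | yes _ = ℕP.m≤n⇒m≤1+n (count-< _ _ (λ t → P⊆Q (suc t)) a qₐ ¬pₐ)
  ... | no _ | no _ = count-< _ _ (λ t → P⊆Q (suc t)) a qₐ ¬pₐ

  count≤N : ∀ {N} {P : Fin N → Set} (P? : ∀ t → Dec (P t)) → count P? ≤ℕ N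
  count≤N {zero} P? = ℕP.≤-refl
  count≤N {suc N} P? with P? zero
  ... | yes _ = s≤s (count≤N _)
  ... | no _ = ℕP.m≤n⇒m≤1+n (count≤N _)

  count<N : ∀ {N} {P : Fin N → Set} (P? : ∀ t → Dec (P t)) a → ¬ P a → count P? <ℕ N
  count<N {suc N} P? zero ¬p₀ with P? zero
  ... | yes p₀ = ⊥-elim (¬p₀ p₀)
  ... | no _ = s≤s (count≤N _)
  count<N {suc N} P? (suc a) ¬pₐ with P? zero
  ... | yes _ = s≤s (count<N _ a ¬pₐ)
  ... | no _ = ℕP.m≤n⇒m≤1+n (count<N _ a ¬pₐ)

  Others : ∀ {N} → Fin N → Fin N → Bool
  Others i j = not ⌊ j FP.≟ i ⌋

  Others-≢ : ∀ {N} {i j : Fin N} → j ≢ i → T (Others i j)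
  Others-≢ {i = i} {j} j≢i with j FP.≟ i
  ... | yes j≡i = j≢i j≡i
  ... | no _ = tt

  module ConvexPolygonRanking {r′ : ℕ} (q : Fin (suc r′) → Pt) (convex : ConvexPosition q) where
    r : ℕ
    r = suc r′

    p₀ : Fin r
    p₀ = zero

    point-injective : ∀ i j → q i ≡ q j → i ≡ j
    point-injective i j qi≡qj with j FP.≟ i
    ... | yes j≡i = sym j≡i
    ... | no j≢i = ⊥-elim (convex i (subst (InHull q (Others i)) (sym qi≡qj) (InHull-point {pos = q} (Others-≢ j≢i))))

    not-between : ∀ x y z → y ≢ x → y ≢ z → ¬ Between (q x) (q y) (q z)
    not-between x y z y≢x y≢z between = convex y (InHull-between (Others-≢ (λ e → y≢x (sym e))) (Others-≢ (λ e → y≢z (sym e))) between)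

    not-collinear : ∀ i j k → j ≢ i → k ≢ i → j ≢ k → orient (q i) (q j) (q k) ≢ 0#
    not-collinear i j k j≢i k≢i j≢k e with collinear⇒between (q i) (q j) (q k) e (λ h → j≢i (point-injective j i h)) (λ h → k≢i (point-injective k i h))
    ... | inj₁ i-between = not-between j i k (λ h → j≢i (sym h)) (λ h → k≢i (sym h)) i-between
    ... | inj₂ (inj₁ k-between) = not-between i k j k≢i (λ h → j≢k (sym h)) k-between
    ... | inj₂ (inj₂ j-between) = not-between i j k j≢i j≢k j-between

    -- the counterclockwise order of the other points as seen from p₀, which comes first
    data Before (a b : Fin r) : Set where
      first : a ≡ p₀ → b ≢ p₀ → Before a b
      ccw : a ≢ p₀ → b ≢ p₀ → 0# < orient (q p₀) (q a) (q b) → Before a b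

    before? : ∀ a b → Dec (Before a b)
    before? a b with a FP.≟ p₀ | b FP.≟ p₀
    ... | _ | yes b≡p₀ = no λ { (first _ b≢p₀) → b≢p₀ b≡p₀ ; (ccw _ b≢p₀ _) → b≢p₀ b≡p₀ }
    ... | yes a≡p₀ | no b≢p₀ = yes (first a≡p₀ b≢p₀)
    ... | no a≢p₀ | no b≢p₀ with 0# STO.<? orient (q p₀) (q a) (q b)
    ...   | yes 0<o = yes (ccw a≢p₀ b≢p₀ 0<o)
    ...   | no ¬0<o = no λ { (first a≡p₀ _) → a≢p₀ a≡p₀ ; (ccw _ _ 0<o) → ¬0<o 0<o }

    Before-irrefl : ∀ a → ¬ Before a a
    Before-irrefl a (first a≡p₀ a≢p₀) = a≢p₀ a≡p₀
    Before-irrefl a (ccw _ _ 0<o) = <-irrefl (subst (0# <_) (orient-pqq (q p₀) (q a)) 0<o)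

    -- If p₀, a, b and p₀, b, c are counterclockwise but p₀, a, c is not, then p₀ lies in the triangle a b c.
    Before-trans : ∀ a b c → Before a b → Before b c → Before a c
    Before-trans a b c (first a≡p₀ b≢p₀) (first b≡p₀ _) = ⊥-elim (b≢p₀ b≡p₀)
    Before-trans a b c (first a≡p₀ _) (ccw _ c≢p₀ _) = first a≡p₀ c≢p₀
    Before-trans a b c (ccw _ b≢p₀ _) (first b≡p₀ _) = ⊥-elim (b≢p₀ b≡p₀)
    Before-trans a b c (ccw a≢p₀ b≢p₀ 0<p₀ab) (ccw _ c≢p₀ 0<p₀bc) with 0# STO.<? orient (q p₀) (q a) (q c)
    ... | yes 0<p₀ac = ccw a≢p₀ c≢p₀ 0<p₀ac
    ... | no ¬0<p₀ac = ⊥-elim (convex p₀ (InHull-barycentric q (Others p₀) p₀ a b c (Others-≢ a≢p₀) (Others-≢ b≢p₀) (Others-≢ c≢p₀)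
                                 (inj₁ 0<p₀bc) 0≤p₀ca (inj₁ 0<p₀ab) (+-pos (+-pos-nonneg 0<p₀bc 0≤p₀ca) 0<p₀ab)))
      where
      0≤p₀ca : 0# ≤ orient (q p₀) (q c) (q a)
      0≤p₀ca = subst (0# ≤_) (sym (orient-swap (q p₀) (q a) (q c))) (x≤0⇒0≤-x (≮⇒≥ ¬0<p₀ac))

    Before-total : ∀ a b → a ≢ b → Before a b ⊎ Before b a
    Before-total a b a≢b with a FP.≟ p₀ | b FP.≟ p₀
    ... | yes a≡p₀ | yes b≡p₀ = ⊥-elim (a≢b (trans a≡p₀ (sym b≡p₀)))
    ... | yes a≡p₀ | no b≢p₀ = inj₁ (first a≡p₀ b≢p₀)
    ... | no a≢p₀ | yes b≡p₀ = inj₂ (first b≡p₀ a≢p₀)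
    ... | no a≢p₀ | no b≢p₀ with compare 0# (orient (q p₀) (q a) (q b))
    ...   | tri< 0<o _ _ = inj₁ (ccw a≢p₀ b≢p₀ 0<o)
    ...   | tri≈ _ 0≡o _ = ⊥-elim (not-collinear p₀ a b a≢p₀ b≢p₀ a≢b (sym 0≡o))
    ...   | tri> _ _ o<0 = inj₂ (ccw b≢p₀ a≢p₀ (subst (0# <_) (sym (orient-swap (q p₀) (q a) (q b))) (x<0⇒0<-x o<0)))

    rank : Fin r → ℕ
    rank t = count (λ c → before? c t)

    Before⇒< : ∀ a b → Before a b → rank a <ℕ rank b
    Before⇒< a b a-b = count-< (λ c → before? c a) (λ c → before? c b) (λ c c-a → Before-trans c a b c-a a-b) a a-b (Before-irrefl a)

    <⇒Before : ∀ a b → rank a <ℕ rank b → Before a b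
    <⇒Before a b a<b with a FP.≟ b
    ... | yes refl = ⊥-elim (ℕP.<-irrefl refl a<b)
    ... | no a≢b with Before-total a b a≢b
    ...   | inj₁ a-b = a-b
    ...   | inj₂ b-a = ⊥-elim (ℕP.<-asym a<b (Before⇒< b a b-a))

    rank-injective : ∀ a b → rank a ≡ rank b → a ≡ b
    rank-injective a b ra≡rb with a FP.≟ b
    ... | yes a≡b = a≡b
    ... | no a≢b with Before-total a b a≢b
    ...   | inj₁ a-b = ⊥-elim (ℕP.<-irrefl ra≡rb (Before⇒< a b a-b))
    ...   | inj₂ b-a = ⊥-elim (ℕP.<-irrefl (sym ra≡rb) (Before⇒< b a b-a))

    rank<r : ∀ t → rank t <ℕ r
    rank<r t = count<N (λ c → before? c t) t (Before-irrefl t)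

    -- If p₀, i, j and p₀, j, k are counterclockwise but i, j, k is not, then j lies in the triangle p₀ i k.
    orient-pos : ∀ i j k → rank i <ℕ rank j → rank j <ℕ rank k → 0# < orient (q i) (q j) (q k)
    orient-pos i j k i<j j<k with <⇒Before i j i<j | <⇒Before j k j<k
    ... | first _ j≢p₀ | first j≡p₀ _ = ⊥-elim (j≢p₀ j≡p₀)
    ... | ccw _ j≢p₀ _ | first j≡p₀ _ = ⊥-elim (j≢p₀ j≡p₀)
    ... | first refl _ | ccw _ _ 0<p₀jk = 0<p₀jk
    ... | ccw i≢p₀ j≢p₀ 0<p₀ij | ccw _ k≢p₀ 0<p₀jk with 0# STO.<? orient (q i) (q j) (q k)
    ...   | yes 0<ijk = 0<ijk
    ...   | no ¬0<ijk = ⊥-elim (convex j (InHull-barycentric q (Others j) j p₀ i k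
                              (Others-≢ (λ e → j≢p₀ (sym e))) (Others-≢ (λ e → ℕP.<-irrefl (cong rank e) i<j)) (Others-≢ (λ e → ℕP.<-irrefl (cong rank (sym e)) j<k))
                              0≤jik (inj₁ 0<jkp₀) (inj₁ 0<jp₀i) (+-pos (+-nonneg-pos 0≤jik 0<jkp₀) 0<jp₀i)))
      where
      0≤jik : 0# ≤ orient (q j) (q i) (q k)
      0≤jik = subst (0# ≤_) (sym (trans (orient-rotate (q j) (q i) (q k)) (orient-swap (q i) (q j) (q k)))) (x≤0⇒0≤-x (≮⇒≥ ¬0<ijk))
      0<jkp₀ : 0# < orient (q j) (q k) (q p₀)
      0<jkp₀ = subst (0# <_) (orient-rotate (q p₀) (q j) (q k)) 0<p₀jk
      0<jp₀i : 0# < orient (q j) (q p₀) (q i)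
      0<jp₀i = subst (0# <_) (trans (orient-rotate (q p₀) (q i) (q j)) (orient-rotate (q i) (q j) (q p₀))) 0<p₀ij

    rankFin : Fin r → Fin r
    rankFin t = fromℕ< (rank<r t)

    toℕ-rankFin : ∀ t → toℕ (rankFin t) ≡ rank t
    toℕ-rankFin t = FP.toℕ-fromℕ< (rank<r t)

    -- an injection Fin r → Fin r missing s would factor through Fin (r − 1), contradicting the pigeonhole principle
    rank-surjective : ∀ (s : Fin r) → Σ (Fin r) (λ t → rank t ≡ toℕ s)
    rank-surjective s with FP.any? (λ t → rank t ℕP.≟ toℕ s)
    ... | yes hit = hit
    ... | no miss with FP.pigeonhole (ℕP.n<1+n r′) (λ t → punchOut (s≢rankFin t))
      where
      s≢rankFin : ∀ t → s ≢ rankFin t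
      s≢rankFin t e = miss (t , trans (sym (toℕ-rankFin t)) (cong toℕ (sym e)))
    ...   | i , j , i<j , same = ⊥-elim (ℕP.<-irrefl (cong toℕ i≡j) i<j)
      where
      s≢rankFin : ∀ t → s ≢ rankFin t
      s≢rankFin t e = miss (t , trans (sym (toℕ-rankFin t)) (cong toℕ (sym e)))
      i≡j : i ≡ j
      i≡j = rank-injective i j (trans (sym (toℕ-rankFin i)) (trans (cong toℕ (FP.punchOut-injective (s≢rankFin i) (s≢rankFin j) same)) (toℕ-rankFin j)))

    unrank : Fin r → Fin r
    unrank s = proj₁ (rank-surjective s)

    rank-unrank : ∀ s → rank (unrank s) ≡ toℕ s
    rank-unrank s = proj₂ (rank-surjective s)

    unrank-rankFin : ∀ t → unrank (rankFin t) ≡ t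
    unrank-rankFin t = rank-injective _ _ (trans (rank-unrank (rankFin t)) (toℕ-rankFin t))

    ranked : RankedConfiguration r
    ranked = record
      { point = q ; point-injective = point-injective ; rank = rank ; rank-injective = rank-injective
      ; onBase = λ _ → false ; onBase-downward = λ _ _ _ () ; onBase-abscissa = λ _ _ () ; onBase-between = λ _ _ _ _ _ ()
      ; orient-nonneg = λ i j k i<j j<k → inj₁ (orient-pos i j k i<j j<k)
      ; orient-pos = λ i j k i<j j<k _ → orient-pos i j k i<j j<k }

module PartitionConstructions (F : OrderedField) where
  open ConvexPolygons F public

  rel-subst : ∀ {N} (π : Partition N) {a b c d} → a ≡ c → b ≡ d → T (rel π a b) → T (rel π c d)
  rel-subst π refl refl a~b = a~b

  pullback : ∀ {M N} → (Fin M → Fin N) → Partition N → Partition M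
  pullback φ σ = record
    { rel = λ a b → rel σ (φ a) (φ b)
    ; reflR = λ a → reflR σ (φ a)
    ; symR = λ a b → symR σ (φ a) (φ b)
    ; transR = λ a b c → transR σ (φ a) (φ b) (φ c) }

  ≤⇒≡⊎< : ∀ {N} (rank : Fin N → ℕ) → (∀ a b → rank a ≡ rank b → a ≡ b) → ∀ a b → rank a ≤ℕ rank b → a ≡ b ⊎ rank a <ℕ rank b
  ≤⇒≡⊎< rank rank-injective a b ra≤rb with ℕP.m≤n⇒m<n∨m≡n ra≤rb
  ... | inj₁ ra<rb = inj₂ ra<rb
  ... | inj₂ ra≡rb = inj₁ (rank-injective a b ra≡rb)

  -- A map that is weakly rank-monotone and keeps the base inside the base pulls back noncrossing partitions:
  -- a collapsed inequality only identifies two of the points involved, which makes the conclusion trivial.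
  pullback-rankNoncrossing : ∀ {M N} (rank′ : Fin M → ℕ) (onBase′ : Fin M → Bool) (rank : Fin N → ℕ) (onBase : Fin N → Bool) →
    (∀ a b → rank a ≡ rank b → a ≡ b) → (φ : Fin M → Fin N) →
    (∀ a b → rank′ a <ℕ rank′ b → rank (φ a) ≤ℕ rank (φ b)) → (∀ a → T (onBase′ a) → T (onBase (φ a))) →
    (σ : Partition N) → RankNoncrossing rank onBase σ → RankNoncrossing rank′ onBase′ (pullback φ σ)
  pullback-rankNoncrossing rank′ onBase′ rank onBase rank-injective φ mono base σ cnc =
    record { no-crossing = crossing-free ; base-interval = interval }
    where
    split = ≤⇒≡⊎< rank rank-injective
    crossing-free : ∀ i j k l → rank′ i <ℕ rank′ j → rank′ j <ℕ rank′ k → rank′ k <ℕ rank′ l →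
      T (rel σ (φ i) (φ k)) → T (rel σ (φ j) (φ l)) → T (rel σ (φ i) (φ j))
    crossing-free i j k l i<j j<k k<l i~k j~l with split (φ i) (φ j) (mono i j i<j) | split (φ j) (φ k) (mono j k j<k) | split (φ k) (φ l) (mono k l k<l)
    ... | inj₁ φi≡φj | _ | _ = subst (λ w → T (rel σ (φ i) w)) φi≡φj (reflR σ (φ i))
    ... | inj₂ _ | inj₁ φj≡φk | _ = subst (λ w → T (rel σ (φ i) w)) (sym φj≡φk) i~k
    ... | inj₂ _ | inj₂ _ | inj₁ φk≡φl =
      transR σ (φ i) (φ k) (φ j) i~k (symR σ (φ j) (φ k) (subst (λ w → T (rel σ (φ j) w)) (sym φk≡φl) j~l))
    ... | inj₂ φi<φj | inj₂ φj<φk | inj₂ φk<φl = no-crossing cnc (φ i) (φ j) (φ k) (φ l) φi<φj φj<φk φk<φl i~k j~l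
    interval : ∀ i j k → rank′ i <ℕ rank′ j → rank′ j <ℕ rank′ k → T (onBase′ k) → T (rel σ (φ i) (φ k)) → T (rel σ (φ i) (φ j))
    interval i j k i<j j<k k∈ i~k with split (φ i) (φ j) (mono i j i<j) | split (φ j) (φ k) (mono j k j<k)
    ... | inj₁ φi≡φj | _ = subst (λ w → T (rel σ (φ i) w)) φi≡φj (reflR σ (φ i))
    ... | inj₂ _ | inj₁ φj≡φk = subst (λ w → T (rel σ (φ i) w)) (sym φj≡φk) i~k
    ... | inj₂ φi<φj | inj₂ φj<φk = base-interval cnc (φ i) (φ j) (φ k) φi<φj φj<φk (base k k∈) i~k

  isolateRel : ∀ {N} → Fin N → Partition N → Fin N → Fin N → Bool
  isolateRel x π a b with a FP.≟ x | b FP.≟ x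
  ... | yes _ | yes _ = true
  ... | no _ | no _ = rel π a b
  ... | yes _ | no _ = false
  ... | no _ | yes _ = false

  data Isolated {N} (x : Fin N) (π : Partition N) (a b : Fin N) : Set where
    both : a ≡ x → b ≡ x → Isolated x π a b
    neither : a ≢ x → b ≢ x → T (rel π a b) → Isolated x π a b

  isolateRel⇒Isolated : ∀ {N} (x : Fin N) π a b → T (isolateRel x π a b) → Isolated x π a b
  isolateRel⇒Isolated x π a b a~b with a FP.≟ x | b FP.≟ x
  ... | yes a≡x | yes b≡x = both a≡x b≡x
  ... | no a≢x | no b≢x = neither a≢x b≢x a~b

  Isolated⇒isolateRel : ∀ {N} (x : Fin N) π a b → Isolated x π a b → T (isolateRel x π a b)
  Isolated⇒isolateRel x π a b iso with a FP.≟ x | b FP.≟ x | iso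
  ... | yes _ | yes _ | _ = tt
  ... | no _ | no _ | neither _ _ a~b = a~b
  ... | no a≢x | _ | both a≡x _ = ⊥-elim (a≢x a≡x)
  ... | yes a≡x | _ | neither a≢x _ _ = ⊥-elim (a≢x a≡x)
  ... | _ | no b≢x | both _ b≡x = ⊥-elim (b≢x b≡x)
  ... | _ | yes b≡x | neither _ b≢x _ = ⊥-elim (b≢x b≡x)

  isolate : ∀ {N} → Fin N → Partition N → Partition N
  isolate x π = record { rel = isolateRel x π ; reflR = reflexive ; symR = symmetric ; transR = transitive }
    where
    isolated-refl : ∀ a → Isolated x π a a
    isolated-refl a with a FP.≟ x
    ... | yes a≡x = both a≡x a≡x
    ... | no a≢x = neither a≢x a≢x (reflR π a)
    reflexive : ∀ a → T (isolateRel x π a a)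
    reflexive a = Isolated⇒isolateRel x π a a (isolated-refl a)
    symmetric : ∀ a b → T (isolateRel x π a b) → T (isolateRel x π b a)
    symmetric a b a~b with isolateRel⇒Isolated x π a b a~b
    ... | both a≡x b≡x = Isolated⇒isolateRel x π b a (both b≡x a≡x)
    ... | neither a≢x b≢x a~πb = Isolated⇒isolateRel x π b a (neither b≢x a≢x (symR π a b a~πb))
    transitive : ∀ a b c → T (isolateRel x π a b) → T (isolateRel x π b c) → T (isolateRel x π a c)
    transitive a b c a~b b~c with isolateRel⇒Isolated x π a b a~b | isolateRel⇒Isolated x π b c b~c
    ... | both a≡x _ | both _ c≡x = Isolated⇒isolateRel x π a c (both a≡x c≡x)
    ... | neither a≢x _ a~πb | neither _ c≢x b~πc = Isolated⇒isolateRel x π a c (neither a≢x c≢x (transR π a b c a~πb b~πc))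
    ... | both _ b≡x | neither b≢x _ _ = ⊥-elim (b≢x b≡x)
    ... | neither _ b≢x _ | both b≡x _ = ⊥-elim (b≢x b≡x)

  isolate-rankNoncrossing : ∀ {N} (rank : Fin N → ℕ) (onBase : Fin N → Bool) (x : Fin N) →
    (∀ k → T (onBase k) → rank k ≤ℕ rank x) →
    (π : Partition N) → RankNoncrossing rank onBase π → RankNoncrossing rank onBase (isolate x π)
  isolate-rankNoncrossing rank onBase x base≤x π cnc = record { no-crossing = crossing-free ; base-interval = interval }
    where
    distinct : ∀ {a b} → rank a <ℕ rank b → a ≡ x → b ≡ x → ⊥
    distinct a<b refl refl = ℕP.<-irrefl refl a<b
    crossing-free : ∀ i j k l → rank i <ℕ rank j → rank j <ℕ rank k → rank k <ℕ rank l →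
      T (isolateRel x π i k) → T (isolateRel x π j l) → T (isolateRel x π i j)
    crossing-free i j k l i<j j<k k<l i~k j~l with isolateRel⇒Isolated x π i k i~k | isolateRel⇒Isolated x π j l j~l
    ... | both i≡x k≡x | _ = ⊥-elim (distinct (ℕP.<-trans i<j j<k) i≡x k≡x)
    ... | neither _ _ _ | both j≡x l≡x = ⊥-elim (distinct (ℕP.<-trans j<k k<l) j≡x l≡x)
    ... | neither i≢x _ i~πk | neither j≢x _ j~πl =
      Isolated⇒isolateRel x π i j (neither i≢x j≢x (no-crossing cnc i j k l i<j j<k k<l i~πk j~πl))
    interval : ∀ i j k → rank i <ℕ rank j → rank j <ℕ rank k → T (onBase k) →
      T (isolateRel x π i k) → T (isolateRel x π i j)
    interval i j k i<j j<k k∈ i~k with isolateRel⇒Isolated x π i k i~k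
    ... | both i≡x k≡x = ⊥-elim (distinct (ℕP.<-trans i<j j<k) i≡x k≡x)
    ... | neither i≢x _ i~πk = Isolated⇒isolateRel x π i j (neither i≢x j≢x (base-interval cnc i j k i<j j<k k∈ i~πk))
      where
      j≢x : j ≢ x
      j≢x refl = ℕP.<-irrefl refl (ℕP.<-≤-trans j<k (base≤x k k∈))

module IndexMaps (F : OrderedField) where
  open PartitionConstructions F public

  module IndexMap {a b a′ b′ : ℕ} (C1 : SemiConf a b) (C2 : SemiConf a′ b′)
    (fx : Fin (suc (suc a)) → Fin (suc (suc a′))) (fy : Fin b → Fin b′) where
    module S1 = SemiConfRanking C1
    module S2 = SemiConfRanking C2

    indexMapSum : Fin (suc (suc a)) ⊎ Fin b → Fin (suc (suc a′) +ℕ b′)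
    indexMapSum (inj₁ i) = X {a′} {b′} (fx i)
    indexMapSum (inj₂ j) = Y {a′} {b′} (fy j)

    indexMap : Fin (suc (suc a) +ℕ b) → Fin (suc (suc a′) +ℕ b′)
    indexMap p = indexMapSum (splitAt (suc (suc a)) {b} p)

    indexMap-X : ∀ i → indexMap (X {a} {b} i) ≡ X {a′} {b′} (fx i)
    indexMap-X i = cong indexMapSum (FP.splitAt-↑ˡ (suc (suc a)) i b)
    indexMap-Y : ∀ j → indexMap (Y {a} {b} j) ≡ Y {a′} {b′} (fy j)
    indexMap-Y j = cong indexMapSum (FP.splitAt-↑ʳ (suc (suc a)) b j)

    indexMap-mono-≤ : (∀ i i′ → toℕ i <ℕ toℕ i′ → toℕ (fx i) ≤ℕ toℕ (fx i′)) → (∀ j j′ → toℕ j <ℕ toℕ j′ → toℕ (fy j) ≤ℕ toℕ (fy j′)) →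
      ∀ p p′ → S1.rank p <ℕ S1.rank p′ → S2.rank (indexMap p) ≤ℕ S2.rank (indexMap p′)
    indexMap-mono-≤ hx hy p p′ h with S1.view p | S1.view p′
    ... | S1.isX i refl | S1.isX i′ refl rewrite indexMap-X i | indexMap-X i′ = subst₂ _≤ℕ_ (sym (S2.rank-X (fx i))) (sym (S2.rank-X (fx i′))) (hx i i′ (S1.X≺X⇒< i i′ h))
    ... | S1.isX i refl | S1.isY j refl rewrite indexMap-X i | indexMap-Y j = ℕP.<⇒≤ (S2.X≺Y (fx i) (fy j))
    ... | S1.isY j refl | S1.isX i refl = ⊥-elim (S1.Y⊀X i j h)
    ... | S1.isY j refl | S1.isY j′ refl rewrite indexMap-Y j | indexMap-Y j′ with ℕP.<-cmp (toℕ (fy j′)) (toℕ (fy j))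
    ...   | tri< x _ _ = ℕP.<⇒≤ (S2.>⇒Y≺Y (fy j) (fy j′) x)
    ...   | tri≈ _ e _ = ℕP.≤-reflexive (cong S2.rank (cong (Y {a′} {b′}) (FP.toℕ-injective (sym e))))
    ...   | tri> _ _ x = ⊥-elim (ℕP.<-irrefl refl (ℕP.<-≤-trans x (hy j′ j (S1.Y≺Y⇒> j j′ h))))

    indexMap-mono-< : (∀ i i′ → toℕ i <ℕ toℕ i′ → toℕ (fx i) <ℕ toℕ (fx i′)) → (∀ j j′ → toℕ j <ℕ toℕ j′ → toℕ (fy j) <ℕ toℕ (fy j′)) →
      ∀ p p′ → S1.rank p <ℕ S1.rank p′ → S2.rank (indexMap p) <ℕ S2.rank (indexMap p′)
    indexMap-mono-< hx hy p p′ h with S1.view p | S1.view p′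
    ... | S1.isX i refl | S1.isX i′ refl rewrite indexMap-X i | indexMap-X i′ = S2.<⇒X≺X (fx i) (fx i′) (hx i i′ (S1.X≺X⇒< i i′ h))
    ... | S1.isX i refl | S1.isY j refl rewrite indexMap-X i | indexMap-Y j = S2.X≺Y (fx i) (fy j)
    ... | S1.isY j refl | S1.isX i refl = ⊥-elim (S1.Y⊀X i j h)
    ... | S1.isY j refl | S1.isY j′ refl rewrite indexMap-Y j | indexMap-Y j′ = S2.>⇒Y≺Y (fy j) (fy j′) (hy j′ j (S1.Y≺Y⇒> j j′ h))

    indexMap-base : ∀ p → T (S1.onBase p) → T (S2.onBase (indexMap p))
    indexMap-base p c with S1.view p
    ... | S1.isX i refl rewrite indexMap-X i = S2.X∈base (fx i)
    ... | S1.isY j refl = ⊥-elim (S1.Y∉base c)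

    indexMap-base⁻¹ : ∀ p → T (S2.onBase (indexMap p)) → T (S1.onBase p)
    indexMap-base⁻¹ p c with S1.view p
    ... | S1.isX i refl = S1.X∈base i
    ... | S1.isY j refl = ⊥-elim (S2.Y∉base (subst (λ w → T (S2.onBase w)) (indexMap-Y j) c))

  module LastPoints {m′ n : ℕ} (C : SemiConf (suc m′) n) where
    module S = SemiConfRanking C

    xL xP : Fin (suc (suc (suc m′)) +ℕ n)
    xL = xLast {suc m′} {n}
    xP = xPen {suc m′} {n}

    last : Fin (suc (suc (suc m′)))
    last = fromℕ (suc (suc m′))

    rank-xL : S.rank xL ≡ suc (suc m′)
    rank-xL = trans (S.rank-X last) (FP.toℕ-fromℕ (suc (suc m′)))

    toℕ-pen : toℕ (inject₁ (fromℕ (suc m′))) ≡ suc m′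
    toℕ-pen = trans (FP.toℕ-inject₁ (fromℕ (suc m′))) (FP.toℕ-fromℕ (suc m′))

    rank-xP : S.rank xP ≡ suc m′
    rank-xP = trans (S.rank-X _) toℕ-pen

    xP≺xL : xP S.≺ xL
    xP≺xL = subst₂ _<ℕ_ (sym rank-xP) (sym rank-xL) (ℕP.n<1+n (suc m′))

    xP≢xL : xP ≢ xL
    xP≢xL e = ℕP.<-irrefl (cong S.rank e) xP≺xL

    Y≢xL : ∀ k → Y {suc m′} {n} k ≢ xL
    Y≢xL k e = ℕP.<-irrefl (cong S.rank (sym e)) (S.X≺Y last k)

    base≼xL : ∀ p → T (S.onBase p) → S.rank p ≤ℕ S.rank xL
    base≼xL p p∈ with S.view p
    ... | S.isX i refl = subst₂ _≤ℕ_ (sym (S.rank-X i)) (sym rank-xL) (ℕP.≤-pred (FP.toℕ<n i))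
    ... | S.isY j refl = ⊥-elim (S.Y∉base p∈)

    -- xL lies on the base after every other xᵢ, so a block containing both reaches back to xP
    xL~X⇒xL~xP : ∀ π → RankNoncrossing S.rank S.onBase π → ∀ i → X {suc m′} {n} i ≢ xL → T (rel π xL (X i)) → T (rel π xL xP)
    xL~X⇒xL~xP π cnc i Xi≢xL xL~Xi with ℕP.<-cmp (toℕ i) (suc m′)
    ... | tri< i<m _ _ =
      transR π xL (X i) xP xL~Xi (base-interval cnc (X i) xP xL (subst₂ _<ℕ_ (sym (S.rank-X i)) (sym rank-xP) i<m) xP≺xL
                                   (S.X∈base last) (symR π xL (X i) xL~Xi))
    ... | tri≈ _ i≡m _ = rel-subst π refl (cong (X {suc m′} {n}) (FP.toℕ-injective (trans i≡m (sym toℕ-pen)))) xL~Xi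
    ... | tri> _ _ m<i =
      ⊥-elim (Xi≢xL (cong (X {suc m′} {n}) (FP.toℕ-injective (trans (ℕP.≤-antisym (ℕP.≤-pred (FP.toℕ<n i)) m<i) (sym (FP.toℕ-fromℕ (suc (suc m′))))))))

module Decomposition (F : OrderedField) where
  open IndexMaps F public

  module _ {m′ n : ℕ} (C : SemiConf (suc m′) n) where
    open LastPoints C

    decomposition : (π : Pre.Elt (NCS C)) →
        (InA C π ⊎ Σ (Fin n) (λ k → InB C k π))
      × (InA C π → (k : Fin n) → ¬ InB C k π)
      × ((k l : Fin n) → InB C k π → InB C l π → k ≡ l)
    decomposition (π , nc) = covering , A-excludes-B , B-unique
      where
      covering : InA C (π , nc) ⊎ Σ (Fin n) (λ k → InB C k (π , nc))
      covering with T-dichotomy (rel π xL xP)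
      ... | inj₁ xL~xP = inj₁ (inj₂ xL~xP)
      ... | inj₂ xL≁xP with minimum (λ k → T? (rel π xL (Y k))) toℕ
      ...   | some k xL~Yk k-least = inj₂ (k , xL~Yk , T-not⇒¬T xL≁xP , (λ j j<k xL~Yj → ℕP.<-irrefl refl (ℕP.<-≤-trans j<k (k-least j xL~Yj))))
      ...   | none xL≁Y = inj₁ (inj₁ singleton)
        where
        singleton : ∀ p → T (rel π xL p) → p ≡ xL
        singleton p xL~p with S.view p
        ... | S.isY j refl = ⊥-elim (xL≁Y j xL~p)
        ... | S.isX i refl with X {suc m′} {n} i FP.≟ xL
        ...   | yes Xi≡xL = Xi≡xL
        ...   | no Xi≢xL = ⊥-elim (T-not⇒¬T xL≁xP (xL~X⇒xL~xP π (noncrossing⇒rankNoncrossing (semiRanked C) π nc) i Xi≢xL xL~p))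
      A-excludes-B : InA C (π , nc) → (k : Fin n) → ¬ InB C k (π , nc)
      A-excludes-B (inj₁ singleton) k (xL~Yk , _ , _) = Y≢xL k (singleton _ xL~Yk)
      A-excludes-B (inj₂ xL~xP) k (_ , xL≁xP , _) = xL≁xP xL~xP
      B-unique : (k l : Fin n) → InB C k (π , nc) → InB C l (π , nc) → k ≡ l
      B-unique k l (xL~Yk , _ , k-first) (xL~Yl , _ , l-first) with FP.<-cmp k l
      ... | tri< k<l _ _ = ⊥-elim (l-first k k<l xL~Yk)
      ... | tri≈ _ k≡l _ = k≡l
      ... | tri> _ _ l<k = ⊥-elim (k-first l l<k xL~Yl)

module IsomorphismA (F : OrderedField) where
  open Decomposition F public

  module IsoA {m′ n : ℕ} (C : SemiConf (suc m′) n) (C′ : SemiConf m′ n) where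
    open LastPoints C
    module S′ = SemiConfRanking C′

    clip< : ∀ (i : Fin (suc (suc (suc m′)))) → toℕ i ⊓ suc m′ <ℕ suc (suc m′)
    clip< i = s≤s (ℕP.m⊓n≤n (toℕ i) (suc m′))

    clip : Fin (suc (suc (suc m′))) → Fin (suc (suc m′))
    clip i = fromℕ< (clip< i)

    toℕ-clip : ∀ i → toℕ (clip i) ≡ toℕ i ⊓ suc m′
    toℕ-clip i = FP.toℕ-fromℕ< (clip< i)

    clip-inject₁ : ∀ i → clip (inject₁ i) ≡ i
    clip-inject₁ i = FP.toℕ-injective (trans (toℕ-clip (inject₁ i))
      (trans (cong (_⊓ suc m′) (FP.toℕ-inject₁ i)) (ℕP.m≤n⇒m⊓n≡m (ℕP.≤-pred (FP.toℕ<n i)))))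

    inject₁-clip : ∀ i → i ≢ last → inject₁ (clip i) ≡ i
    inject₁-clip i i≢last = FP.toℕ-injective (trans (FP.toℕ-inject₁ (clip i)) (trans (toℕ-clip i) (ℕP.m≤n⇒m⊓n≡m i≤m+1)))
      where
      i≤m+1 : toℕ i ≤ℕ suc m′
      i≤m+1 with ℕP.m≤n⇒m<n∨m≡n (ℕP.≤-pred (FP.toℕ<n i))
      ... | inj₁ i<m+2 = ℕP.≤-pred i<m+2
      ... | inj₂ i≡m+2 = ⊥-elim (i≢last (FP.toℕ-injective (trans i≡m+2 (sym (FP.toℕ-fromℕ (suc (suc m′)))))))

    -- merge sends x_{m+1} to x_m and is the identity otherwise; embed is its section missing x_{m+1}
    module Merge = IndexMap C C′ clip (λ j → j)
    module Embed = IndexMap C′ C inject₁ (λ j → j)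

    merge : Fin (suc (suc (suc m′)) +ℕ n) → Fin (suc (suc m′) +ℕ n)
    merge = Merge.indexMap

    embed : Fin (suc (suc m′) +ℕ n) → Fin (suc (suc (suc m′)) +ℕ n)
    embed = Embed.indexMap

    merge-mono : ∀ p p′ → S.rank p <ℕ S.rank p′ → S′.rank (merge p) ≤ℕ S′.rank (merge p′)
    merge-mono = Merge.indexMap-mono-≤
      (λ i i′ i<i′ → subst₂ _≤ℕ_ (sym (toℕ-clip i)) (sym (toℕ-clip i′)) (ℕP.⊓-monoˡ-≤ (suc m′) (ℕP.<⇒≤ i<i′)))
      (λ j j′ j<j′ → ℕP.<⇒≤ j<j′)

    embed-mono : ∀ p p′ → S′.rank p <ℕ S′.rank p′ → S.rank (embed p) <ℕ S.rank (embed p′)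
    embed-mono = Embed.indexMap-mono-<
      (λ i i′ i<i′ → subst₂ _<ℕ_ (sym (FP.toℕ-inject₁ i)) (sym (FP.toℕ-inject₁ i′)) i<i′)
      (λ j j′ j<j′ → j<j′)

    merge-embed : ∀ p → merge (embed p) ≡ p
    merge-embed p with S′.view p
    ... | S′.isX i refl = trans (cong merge (Embed.indexMap-X i)) (trans (Merge.indexMap-X (inject₁ i)) (cong (X {m′} {n}) (clip-inject₁ i)))
    ... | S′.isY j refl = trans (cong merge (Embed.indexMap-Y j)) (Merge.indexMap-Y j)

    embed-merge : ∀ p → p ≢ xL → embed (merge p) ≡ p
    embed-merge p p≢xL with S.view p
    ... | S.isX i refl = trans (cong embed (Merge.indexMap-X i))
                           (trans (Embed.indexMap-X (clip i)) (cong (X {suc m′} {n}) (inject₁-clip i (λ e → p≢xL (cong (X {suc m′} {n}) e)))))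
    ... | S.isY j refl = trans (cong embed (Merge.indexMap-Y j)) (Embed.indexMap-Y j)

    merge-xL≡merge-xP : merge xL ≡ merge xP
    merge-xL≡merge-xP = trans (Merge.indexMap-X last) (trans (cong (X {m′} {n}) (FP.toℕ-injective clips)) (sym (Merge.indexMap-X _)))
      where
      clips : toℕ (clip last) ≡ toℕ (clip (inject₁ (fromℕ (suc m′))))
      clips = trans (toℕ-clip last) (trans (cong (_⊓ suc m′) (FP.toℕ-fromℕ (suc (suc m′))))
                (trans (ℕP.m≥n⇒m⊓n≡n (ℕP.n≤1+n (suc m′)))
                  (sym (trans (toℕ-clip _) (trans (cong (_⊓ suc m′) toℕ-pen) (ℕP.m≤n⇒m⊓n≡m ℕP.≤-refl))))))

    embed-merge-xL : embed (merge xL) ≡ xP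
    embed-merge-xL = trans (cong embed merge-xL≡merge-xP) (embed-merge xP xP≢xL)

    embed≢xL : ∀ p → embed p ≢ xL
    embed≢xL p e = xP≢xL (trans (sym embed-merge-xL) (trans (cong (λ w → embed (merge w)) (sym e)) (trans (cong embed (merge-embed p)) e)))

    merge-rankNoncrossing : ∀ σ → RankNoncrossing S′.rank S′.onBase σ → RankNoncrossing S.rank S.onBase (pullback merge σ)
    merge-rankNoncrossing = pullback-rankNoncrossing S.rank S.onBase S′.rank S′.onBase S′.rank-injective merge merge-mono Merge.indexMap-base

    embed-rankNoncrossing : ∀ π → RankNoncrossing S.rank S.onBase π → RankNoncrossing S′.rank S′.onBase (pullback embed π)
    embed-rankNoncrossing = pullback-rankNoncrossing S′.rank S′.onBase S.rank S.onBase S.rank-injective embed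
                              (λ p p′ p<p′ → ℕP.<⇒≤ (embed-mono p p′ p<p′)) Embed.indexMap-base

    separate : ∀ σ → Partition (suc (suc (suc m′)) +ℕ n)
    separate σ = isolate xL (pullback merge σ)

    separate-rankNoncrossing : ∀ σ → RankNoncrossing S′.rank S′.onBase σ → RankNoncrossing S.rank S.onBase (separate σ)
    separate-rankNoncrossing σ cnc = isolate-rankNoncrossing S.rank S.onBase xL base≼xL (pullback merge σ) (merge-rankNoncrossing σ cnc)

    restrict-NC : ∀ π → NonCrossing (pos C) π → NonCrossing (pos C′) (pullback embed π)
    restrict-NC π nc = rankNoncrossing⇒noncrossing S′.ranked _ (embed-rankNoncrossing π (noncrossing⇒rankNoncrossing S.ranked π nc))

    merge-NC : ∀ σ → NonCrossing (pos C′) σ → NonCrossing (pos C) (pullback merge σ)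
    merge-NC σ nc = rankNoncrossing⇒noncrossing S.ranked _ (merge-rankNoncrossing σ (noncrossing⇒rankNoncrossing S′.ranked σ nc))

    separate-NC : ∀ σ → NonCrossing (pos C′) σ → NonCrossing (pos C) (separate σ)
    separate-NC σ nc = rankNoncrossing⇒noncrossing S.ranked _ (separate-rankNoncrossing σ (noncrossing⇒rankNoncrossing S′.ranked σ nc))

    A : Pre
    A = Sub (NCS C) (InA C)

    restrict : Pre.Elt A → Pre.Elt (NCS C′ ⊗ Bool1)
    restrict ((π , nc) , _) = (pullback embed π , restrict-NC π nc) , rel π xL xP

    extend : Pre.Elt (NCS C′) → Bool → Pre.Elt A
    extend (σ , nc) true = (pullback merge σ , merge-NC σ nc) , inj₂ (rel-subst σ refl merge-xL≡merge-xP (reflR σ (merge xL)))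
    extend (σ , nc) false = (separate σ , separate-NC σ nc) , inj₁ singleton
      where
      singleton : ∀ p → T (rel (separate σ) xL p) → p ≡ xL
      singleton p xL~p with isolateRel⇒Isolated xL (pullback merge σ) xL p xL~p
      ... | both _ p≡xL = p≡xL
      ... | neither xL≢xL _ _ = ⊥-elim (xL≢xL refl)

    extend-mono : ∀ σ b σ′ b′ → Pre._⊑_ (NCS C′ ⊗ Bool1) (σ , b) (σ′ , b′) → Pre._⊑_ A (extend σ b) (extend σ′ b′)
    extend-mono (σ , _) true (τ , _) true (σ⊑τ , _) p q p~q = σ⊑τ (merge p) (merge q) p~q
    extend-mono (σ , _) true (τ , _) false (_ , true⇒false) = ⊥-elim (true⇒false tt)
    extend-mono (σ , _) false (τ , _) false (σ⊑τ , _) p q p~q with isolateRel⇒Isolated xL (pullback merge σ) p q p~q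
    ... | both p≡xL q≡xL = Isolated⇒isolateRel xL (pullback merge τ) p q (both p≡xL q≡xL)
    ... | neither p≢xL q≢xL p~σq = Isolated⇒isolateRel xL (pullback merge τ) p q (neither p≢xL q≢xL (σ⊑τ _ _ p~σq))
    extend-mono (σ , _) false (τ , _) true (σ⊑τ , _) p q p~q with isolateRel⇒Isolated xL (pullback merge σ) p q p~q
    ... | both p≡xL q≡xL = rel-subst τ refl (cong merge (trans p≡xL (sym q≡xL))) (reflR τ (merge p))
    ... | neither _ _ p~σq = σ⊑τ _ _ p~σq

    extend-restrict : ∀ π nc (inA : InA C (π , nc)) b → rel π xL xP ≡ b →
      Equiv A (extend (pullback embed π , restrict-NC π nc) b) ((π , nc) , inA)
    extend-restrict π nc inA true xL~xP =
      (λ p q p~q → transR π p _ q (transR π p _ _ (same p) p~q) (symR π q _ (same q))) ,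
      (λ p q p~q → transR π _ q _ (transR π _ p q (symR π p _ (same p)) p~q) (same q))
      where
      same : ∀ p → T (rel π p (embed (merge p)))
      same p with p FP.≟ xL
      ... | yes refl = rel-subst π refl (sym embed-merge-xL) (subst T (sym xL~xP) tt)
      ... | no p≢xL = rel-subst π refl (sym (embed-merge p p≢xL)) (reflR π p)
    extend-restrict π nc (inj₂ xL~xP) false xL≁xP = ⊥-elim (subst T xL≁xP xL~xP)
    extend-restrict π nc (inj₁ singleton) false _ = separate⊑π , π⊑separate
      where
      separate⊑π : ∀ p q → T (rel (separate (pullback embed π)) p q) → T (rel π p q)
      separate⊑π p q p~q with isolateRel⇒Isolated xL (pullback merge (pullback embed π)) p q p~q
      ... | both p≡xL q≡xL = rel-subst π (sym p≡xL) (sym q≡xL) (reflR π xL)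
      ... | neither p≢xL q≢xL p~πq = rel-subst π (embed-merge p p≢xL) (embed-merge q q≢xL) p~πq
      π⊑separate : ∀ p q → T (rel π p q) → T (rel (separate (pullback embed π)) p q)
      π⊑separate p q p~q = Isolated⇒isolateRel xL _ p q (isolated p q p~q)
        where
        isolated : ∀ p q → T (rel π p q) → Isolated xL (pullback merge (pullback embed π)) p q
        isolated p q p~q with p FP.≟ xL | q FP.≟ xL
        ... | yes p≡xL | yes q≡xL = both p≡xL q≡xL
        ... | yes refl | no q≢xL = ⊥-elim (q≢xL (singleton q p~q))
        ... | no p≢xL | yes refl = ⊥-elim (p≢xL (singleton p (symR π p xL p~q)))
        ... | no p≢xL | no q≢xL = neither p≢xL q≢xL (rel-subst π (sym (embed-merge p p≢xL)) (sym (embed-merge q q≢xL)) p~q)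

    restrict-extend : ∀ σ b → Equiv (NCS C′ ⊗ Bool1) (restrict (extend σ b)) (σ , b)
    restrict-extend (σ , nc) true =
      ((λ p q p~q → rel-subst σ (merge-embed p) (merge-embed q) p~q) , (λ _ → tt)) ,
      ((λ p q p~q → rel-subst σ (sym (merge-embed p)) (sym (merge-embed q)) p~q) , (λ _ → rel-subst σ refl merge-xL≡merge-xP (reflR σ (merge xL))))
    restrict-extend (σ , nc) false = (separate⊑σ , xL≁xP) , (σ⊑separate , λ ())
      where
      separate⊑σ : ∀ p q → T (rel (separate σ) (embed p) (embed q)) → T (rel σ p q)
      separate⊑σ p q p~q with isolateRel⇒Isolated xL (pullback merge σ) (embed p) (embed q) p~q
      ... | both embed-p≡xL _ = ⊥-elim (embed≢xL p embed-p≡xL)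
      ... | neither _ _ p~σq = rel-subst σ (merge-embed p) (merge-embed q) p~σq
      σ⊑separate : ∀ p q → T (rel σ p q) → T (rel (separate σ) (embed p) (embed q))
      σ⊑separate p q p~q = Isolated⇒isolateRel xL (pullback merge σ) (embed p) (embed q)
                             (neither (embed≢xL p) (embed≢xL q) (rel-subst σ (sym (merge-embed p)) (sym (merge-embed q)) p~q))
      xL≁xP : T (rel (separate σ) xL xP) → T false
      xL≁xP xL~xP with isolateRel⇒Isolated xL (pullback merge σ) xL xP xL~xP
      ... | both _ xP≡xL = xP≢xL xP≡xL
      ... | neither xL≢xL _ _ = xL≢xL refl

    A≅NC×Bool : A ≅ (NCS C′ ⊗ Bool1)
    A≅NC×Bool = record
      { to = restrict
      ; from = λ (σ , b) → extend σ b
      ; to-mono = λ { ((π , _) , _) ((μ , _) , _) π⊑μ → (λ p q p~q → π⊑μ (embed p) (embed q) p~q) , π⊑μ xL xP }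
      ; from-mono = λ { (σ , b) (σ′ , b′) σb⊑σ′b′ → extend-mono σ b σ′ b′ σb⊑σ′b′ }
      ; from-to = λ { ((π , nc) , inA) → extend-restrict π nc inA (rel π xL xP) refl }
      ; to-from = λ { (σ , b) → restrict-extend σ b } }

module IsomorphismB (F : OrderedField) where
  open IsomorphismA F public

  module IsoB {m′ n′ r′ : ℕ} (k : Fin (suc n′)) (C : SemiConf (suc m′) (suc n′)) (C′ : SemiConf m′ (toℕ k))
              (q : Fin (suc r′) → Pt) (convex : ConvexPosition q) (r≡n-k : suc r′ ≡ suc n′ ∸ toℕ k) where
    open LastPoints C
    module S′ = SemiConfRanking C′
    module Poly = ConvexPolygonRanking q convex
    κ : ℕ
    κ = toℕ k
    N : ℕ
    N = suc (suc (suc m′)) +ℕ suc n′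
    N′ : ℕ
    N′ = suc (suc m′) +ℕ κ
    r : ℕ
    r = suc r′
    A2 : ℕ
    A2 = suc (suc (suc m′))
    start : ℕ
    start = suc (suc m′)
    Yk : Fin N
    Yk = Y {suc m′} {suc n′} k

    k≤n′ : κ ≤ℕ n′
    k≤n′ = ℕP.≤-pred (FP.toℕ<n k)
    k≤n : κ ≤ℕ suc n′
    k≤n = ℕP.<⇒≤ (FP.toℕ<n k)

    r′≡n′∸k : r′ ≡ n′ ∸ κ
    r′≡n′∸k = ℕP.suc-injective (trans r≡n-k (ℕP.+-∸-assoc 1 k≤n′))

    -- The chord xL Yk splits S_{m,n}: left is the copy x₀ … x_m, y₀ … y_{k−1} of S_{m−1,k−1}, right lists the
    -- polygon xL, y_{n′}, …, y_{k+1} counterclockwise, and Yk belongs to the block of xL.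
    module Left = IndexMap C′ C inject₁ (λ j → inject≤ j k≤n)
    left : Fin N′ → Fin N
    left = Left.indexMap

    left-mono : ∀ p p′ → S′.rank p <ℕ S′.rank p′ → S.rank (left p) <ℕ S.rank (left p′)
    left-mono = Left.indexMap-mono-< (λ i i′ h → subst₂ _<ℕ_ (sym (FP.toℕ-inject₁ i)) (sym (FP.toℕ-inject₁ i′)) h)
                        (λ j j′ h → subst₂ _<ℕ_ (sym (FP.toℕ-inject≤ j k≤n)) (sym (FP.toℕ-inject≤ j′ k≤n)) h)

    rightY< : ∀ (s : Fin r′) → n′ ∸ toℕ s <ℕ suc n′
    rightY< s = s≤s (ℕP.m∸n≤m n′ (toℕ s))
    rightY : Fin r′ → Fin (suc n′)
    rightY s = fromℕ< (rightY< s)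

    s≤n′ : ∀ (s : Fin r′) → toℕ s ≤ℕ n′
    s≤n′ s = ℕP.≤-trans (ℕP.<⇒≤ (FP.toℕ<n s)) (subst (_≤ℕ n′) (sym r′≡n′∸k) (ℕP.m∸n≤m n′ κ))

    right : Fin r → Fin N
    right zero = xL
    right (suc s) = Y {suc m′} {suc n′} (rightY s)

    rank-right : ∀ s → S.rank (right s) ≡ start +ℕ toℕ s
    rank-right zero = trans (S.rank-X (fromℕ (suc (suc m′)))) (trans (FP.toℕ-fromℕ (suc (suc m′))) (sym (ℕP.+-identityʳ _)))
    rank-right (suc s) = trans (S.rank-Y (rightY s)) (trans (cong (λ v → A2 +ℕ (n′ ∸ v)) (FP.toℕ-fromℕ< (rightY< s)))
                   (trans (cong (A2 +ℕ_) (ℕP.m∸[m∸n]≡n (s≤n′ s))) (sym (ℕP.+-suc (suc (suc m′)) (toℕ s)))))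

    rank-Yk : S.rank Yk ≡ start +ℕ r
    rank-Yk = trans (S.rank-Y k) (trans (cong (A2 +ℕ_) (sym r′≡n′∸k)) (sym (ℕP.+-suc (suc (suc m′)) r′)))

    polygon : Fin r → Fin N
    polygon t = right (Poly.rankFin t)

    rank-polygon : ∀ t → S.rank (polygon t) ≡ start +ℕ Poly.rank t
    rank-polygon t = trans (rank-right (Poly.rankFin t)) (cong (start +ℕ_) (Poly.toℕ-rankFin t))

    -- In S_{m,n} the right part occupies the ranks start, …, start + r − 1 (xL first) and Yk has rank start + r;
    -- the left part lies outside this interval.
    data Outside (v : ℕ) : Set where
      below : v <ℕ start → Outside v
      above : start +ℕ r <ℕ v → Outside v

    left-outside : ∀ x → Outside (S.rank (left x))
    left-outside x with S′.view x
    ... | S′.isX i refl = below (subst (_<ℕ start) (sym (trans (cong S.rank (Left.indexMap-X i)) (trans (S.rank-X (inject₁ i)) (FP.toℕ-inject₁ i)))) (FP.toℕ<n i))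
    ... | S′.isY j refl = above (subst (start +ℕ r <ℕ_) (sym (trans (cong S.rank (Left.indexMap-Y j)) (S.rank-Y (inject≤ j k≤n)))) lt)
      where
      lt : start +ℕ r <ℕ A2 +ℕ (n′ ∸ toℕ (inject≤ j k≤n))
      lt = subst (_<ℕ A2 +ℕ (n′ ∸ toℕ (inject≤ j k≤n))) (sym (ℕP.+-suc (suc (suc m′)) r′))
             (ℕP.+-monoʳ-< A2 (subst₂ _<ℕ_ (sym r′≡n′∸k) refl (ℕP.∸-monoʳ-< (subst (_<ℕ κ) (sym (FP.toℕ-inject≤ j k≤n)) (FP.toℕ<n j)) k≤n′)))

    data Cover (a : Fin N) : Set where
      fromLeft : ∀ x → left x ≡ a → Cover a
      fromRight : ∀ s → right s ≡ a → Cover a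
      isYk : a ≡ Yk → Cover a

    cover : ∀ a → Cover a
    cover a with S.view a
    ... | S.isX i refl with ℕP.<-cmp (toℕ i) (suc (suc m′))
    ...   | tri< x _ _ = fromLeft (X {m′} {κ} (lower₁ i (λ e → ℕP.<-irrefl (sym e) x))) (trans (Left.indexMap-X _) (cong (X {suc m′} {suc n′}) (FP.inject₁-lower₁ i _)))
    ...   | tri≈ _ e _ = fromRight zero (cong (X {suc m′} {suc n′}) (FP.toℕ-injective (trans (FP.toℕ-fromℕ (suc (suc m′))) (sym e))))
    ...   | tri> _ _ x = ⊥-elim (ℕP.<-irrefl refl (ℕP.<-≤-trans x (ℕP.≤-pred (FP.toℕ<n i))))
    cover a | S.isY j refl with ℕP.<-cmp (toℕ j) κ
    ...   | tri< x _ _ = fromLeft (Y {m′} {κ} (fromℕ< x)) (trans (Left.indexMap-Y _) (cong (Y {suc m′} {suc n′}) (FP.toℕ-injective (trans (FP.toℕ-inject≤ (fromℕ< x) k≤n) (FP.toℕ-fromℕ< x)))))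
    ...   | tri≈ _ e _ = isYk (cong (Y {suc m′} {suc n′}) (FP.toℕ-injective e))
    ...   | tri> _ _ x = fromRight (suc (fromℕ< lt)) (cong (Y {suc m′} {suc n′}) (FP.toℕ-injective (trans (FP.toℕ-fromℕ< (rightY< (fromℕ< lt))) (trans (cong (n′ ∸_) (FP.toℕ-fromℕ< lt)) (ℕP.m∸[m∸n]≡n jle)))))
      where
      jle : toℕ j ≤ℕ n′
      jle = ℕP.≤-pred (FP.toℕ<n j)
      lt : n′ ∸ toℕ j <ℕ r′
      lt = subst (n′ ∸ toℕ j <ℕ_) (sym r′≡n′∸k) (ℕP.∸-monoʳ-< x jle)

    labelOf : ∀ {a} → Cover a → Fin N′ ⊎ Fin r
    labelOf (fromLeft x _) = inj₁ x
    labelOf (fromRight s _) = inj₂ s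
    labelOf (isYk _) = inj₂ zero

    label : Fin N → Fin N′ ⊎ Fin r
    label a = labelOf (cover a)

    data Labelled (a : Fin N) : Fin N′ ⊎ Fin r → Set where
      is-left : ∀ x → left x ≡ a → Labelled a (inj₁ x)
      is-right : ∀ s → right s ≡ a → Labelled a (inj₂ s)
      is-Yk : a ≡ Yk → Labelled a (inj₂ zero)

    label-spec : ∀ a → Labelled a (label a)
    label-spec a with cover a
    ... | fromLeft x e = is-left x e
    ... | fromRight s e = is-right s e
    ... | isYk e = is-Yk e

    right-not-outside : ∀ s → Outside (S.rank (right s)) → ⊥
    right-not-outside s (below h) = ℕP.<-irrefl refl (ℕP.<-≤-trans h (subst (start ≤ℕ_) (sym (rank-right s)) (ℕP.m≤m+n start (toℕ s))))
    right-not-outside s (above h) = ℕP.<-irrefl refl (ℕP.<-trans h (subst (_<ℕ start +ℕ r) (sym (rank-right s)) (ℕP.+-monoʳ-< start (FP.toℕ<n s))))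

    Yk-not-outside : Outside (S.rank Yk) → ⊥
    Yk-not-outside (below h) = ℕP.<-irrefl refl (ℕP.<-≤-trans h (subst (start ≤ℕ_) (sym rank-Yk) (ℕP.m≤m+n start r)))
    Yk-not-outside (above h) = ℕP.<-irrefl (sym rank-Yk) h

    right≢Yk : ∀ s → right s ≢ Yk
    right≢Yk s e = ℕP.<-irrefl (trans (sym (rank-right s)) (trans (cong S.rank e) rank-Yk)) (ℕP.+-monoʳ-< start (FP.toℕ<n s))

    left-injective : ∀ x y → left x ≡ left y → x ≡ y
    left-injective x y e with ℕP.<-cmp (S′.rank x) (S′.rank y)
    ... | tri< h _ _ = ⊥-elim (ℕP.<-irrefl (cong S.rank e) (left-mono x y h))
    ... | tri≈ _ h _ = S′.rank-injective x y h
    ... | tri> _ _ h = ⊥-elim (ℕP.<-irrefl (cong S.rank (sym e)) (left-mono y x h))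

    right-injective : ∀ s t → right s ≡ right t → s ≡ t
    right-injective s t e = FP.toℕ-injective (ℕP.+-cancelˡ-≡ start _ _ (trans (sym (rank-right s)) (trans (cong S.rank e) (rank-right t))))

    label-left : ∀ x → label (left x) ≡ inj₁ x
    label-left x with label (left x) | label-spec (left x)
    ... | _ | is-left x′ e = cong inj₁ (left-injective x′ x e)
    ... | _ | is-right s e = ⊥-elim (right-not-outside s (subst (λ w → Outside (S.rank w)) (sym e) (left-outside x)))
    ... | _ | is-Yk e = ⊥-elim (Yk-not-outside (subst (λ w → Outside (S.rank w)) e (left-outside x)))

    label-right : ∀ s → label (right s) ≡ inj₂ s
    label-right s with label (right s) | label-spec (right s)
    ... | _ | is-left x e = ⊥-elim (right-not-outside s (subst (λ w → Outside (S.rank w)) e (left-outside x)))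
    ... | _ | is-right s′ e = cong inj₂ (right-injective s′ s e)
    ... | _ | is-Yk e = ⊥-elim (right≢Yk s e)

    label-Yk : label Yk ≡ inj₂ zero
    label-Yk with label Yk | label-spec Yk
    ... | _ | is-left x e = ⊥-elim (Yk-not-outside (subst (λ w → Outside (S.rank w)) e (left-outside x)))
    ... | _ | is-right s e = ⊥-elim (right≢Yk s e)
    ... | _ | is-Yk e = refl

    labelRel : Partition N′ → Partition r → Fin N′ ⊎ Fin r → Fin N′ ⊎ Fin r → Bool
    labelRel σ τ (inj₁ x) (inj₁ y) = rel σ x y
    labelRel σ τ (inj₂ s) (inj₂ t) = rel τ (Poly.unrank s) (Poly.unrank t)
    labelRel σ τ (inj₁ _) (inj₂ _) = false
    labelRel σ τ (inj₂ _) (inj₁ _) = false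

    labelRel-refl : ∀ σ τ u → T (labelRel σ τ u u)
    labelRel-refl σ τ (inj₁ x) = reflR σ x
    labelRel-refl σ τ (inj₂ s) = reflR τ (Poly.unrank s)

    labelRel-sym : ∀ σ τ u v → T (labelRel σ τ u v) → T (labelRel σ τ v u)
    labelRel-sym σ τ (inj₁ x) (inj₁ y) t = symR σ x y t
    labelRel-sym σ τ (inj₂ s) (inj₂ s′) t = symR τ _ _ t

    labelRel-trans : ∀ σ τ u v w → T (labelRel σ τ u v) → T (labelRel σ τ v w) → T (labelRel σ τ u w)
    labelRel-trans σ τ (inj₁ x) (inj₁ y) (inj₁ z) t1 t2 = transR σ x y z t1 t2
    labelRel-trans σ τ (inj₂ x) (inj₂ y) (inj₂ z) t1 t2 = transR τ _ _ _ t1 t2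
    labelRel-trans σ τ (inj₁ x) (inj₂ y) _ () _
    labelRel-trans σ τ (inj₂ x) (inj₁ y) _ () _
    labelRel-trans σ τ (inj₁ x) (inj₁ y) (inj₂ z) _ ()
    labelRel-trans σ τ (inj₂ x) (inj₂ y) (inj₁ z) _ ()

    glue : Partition N′ → Partition r → Partition N
    glue σ τ = record
      { rel = λ a b → labelRel σ τ (label a) (label b)
      ; reflR = λ a → labelRel-refl σ τ (label a)
      ; symR = λ a b → labelRel-sym σ τ (label a) (label b)
      ; transR = λ a b c → labelRel-trans σ τ (label a) (label b) (label c) }

    label-of : ∀ {a u} → Labelled a u → label a ≡ u
    label-of (is-left x e) = trans (cong label (sym e)) (label-left x)
    label-of (is-right s e) = trans (cong label (sym e)) (label-right s)
    label-of (is-Yk e) = trans (cong label e) label-Yk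

    data Glued (σ : Partition N′) (τ : Partition r) (a b : Fin N) : Set where
      left-left : ∀ x y → Labelled a (inj₁ x) → Labelled b (inj₁ y) → T (rel σ x y) → Glued σ τ a b
      right-right : ∀ s t → Labelled a (inj₂ s) → Labelled b (inj₂ t) → T (rel τ (Poly.unrank s) (Poly.unrank t)) → Glued σ τ a b

    glue⇒Glued : ∀ σ τ a b → T (labelRel σ τ (label a) (label b)) → Glued σ τ a b
    glue⇒Glued σ τ a b t with label a | label-spec a | label b | label-spec b
    ... | inj₁ x | ca | inj₁ y | cb = left-left x y ca cb t
    ... | inj₂ s | ca | inj₂ s′ | cb = right-right s s′ ca cb t

    Glued⇒glue : ∀ σ τ a b → Glued σ τ a b → T (labelRel σ τ (label a) (label b))
    Glued⇒glue σ τ a b (left-left x y ca cb t) rewrite label-of ca | label-of cb = t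
    Glued⇒glue σ τ a b (right-right s s′ ca cb t) rewrite label-of ca | label-of cb = t

    rank-right′ : ∀ {a s} → Labelled a (inj₂ s) → a ≢ Yk → S.rank a ≡ start +ℕ toℕ s
    rank-right′ (is-right s e) ne = trans (cong S.rank (sym e)) (rank-right s)
    rank-right′ (is-Yk e) ne = ⊥-elim (ne e)

    right-interval : ∀ {a s} → Labelled a (inj₂ s) → (start ≤ℕ S.rank a) × (S.rank a ≤ℕ start +ℕ r)
    right-interval (is-right s e) = subst (λ w → start ≤ℕ S.rank w × S.rank w ≤ℕ start +ℕ r) e
       (subst (λ v → start ≤ℕ v × v ≤ℕ start +ℕ r) (sym (rank-right s)) (ℕP.m≤m+n start (toℕ s) , ℕP.<⇒≤ (ℕP.+-monoʳ-< start (FP.toℕ<n s))))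
    right-interval (is-Yk e) = subst (λ w → start ≤ℕ S.rank w × S.rank w ≤ℕ start +ℕ r) (sym e)
       (subst (λ v → start ≤ℕ v × v ≤ℕ start +ℕ r) (sym rank-Yk) (ℕP.m≤m+n start r , ℕP.≤-refl))

    left-outside′ : ∀ {a x} → Labelled a (inj₁ x) → Outside (S.rank a)
    left-outside′ (is-left x e) = subst (λ w → Outside (S.rank w)) e (left-outside x)

    left-not-between-right : ∀ {a b c s t x} → Labelled a (inj₂ s) → Labelled c (inj₂ t) → Labelled b (inj₁ x) → S.rank a <ℕ S.rank b → S.rank b <ℕ S.rank c → ⊥
    left-not-between-right ca cc cb h1 h2 with left-outside′ cb
    ... | below h = ℕP.<-irrefl refl (ℕP.<-≤-trans h (ℕP.≤-trans (proj₁ (right-interval ca)) (ℕP.<⇒≤ h1)))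
    ... | above h = ℕP.<-irrefl refl (ℕP.<-≤-trans h (ℕP.≤-trans (ℕP.<⇒≤ h2) (proj₂ (right-interval cc))))

    left-reflects-< : ∀ x y → S.rank (left x) <ℕ S.rank (left y) → S′.rank x <ℕ S′.rank y
    left-reflects-< x y h with ℕP.<-cmp (S′.rank x) (S′.rank y)
    ... | tri< z _ _ = z
    ... | tri≈ _ e _ = ⊥-elim (ℕP.<-irrefl (cong (λ w → S.rank (left w)) (S′.rank-injective x y e)) h)
    ... | tri> _ _ z = ⊥-elim (ℕP.<-asym h (left-mono y x z))

    rank-left′ : ∀ {a x} → Labelled a (inj₁ x) → S.rank a ≡ S.rank (left x)
    rank-left′ (is-left x e) = cong S.rank (sym e)

    base≤start : ∀ c → T (S.onBase c) → S.rank c ≤ℕ start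
    base≤start c c∈ = subst (S.rank c ≤ℕ_) rank-xL (base≼xL c c∈)

    left-base⁻¹ : ∀ {a x} → Labelled a (inj₁ x) → T (S.onBase a) → T (S′.onBase x)
    left-base⁻¹ (is-left x refl) a∈ = Left.indexMap-base⁻¹ x a∈

    below⇒≢Yk : ∀ {a s b t} → Labelled a (inj₂ s) → Labelled b (inj₂ t) → S.rank a <ℕ S.rank b → a ≢ Yk
    below⇒≢Yk {b = b} _ lb a<b refl = ℕP.<-irrefl refl (ℕP.<-≤-trans (subst (_<ℕ S.rank b) rank-Yk a<b) (proj₂ (right-interval lb)))

    left-< : ∀ {a b x y} → Labelled a (inj₁ x) → Labelled b (inj₁ y) → S.rank a <ℕ S.rank b → S′.rank x <ℕ S′.rank y
    left-< {x = x} {y} la lb a<b = left-reflects-< x y (subst₂ _<ℕ_ (rank-left′ la) (rank-left′ lb) a<b)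

    right-< : ∀ {a b s t} → Labelled a (inj₂ s) → Labelled b (inj₂ t) → a ≢ Yk → b ≢ Yk → S.rank a <ℕ S.rank b → toℕ s <ℕ toℕ t
    right-< la lb a≢Yk b≢Yk a<b = ℕP.+-cancelˡ-< start _ _ (subst₂ _<ℕ_ (rank-right′ la a≢Yk) (rank-right′ lb b≢Yk) a<b)

    glue-rankNoncrossing : ∀ σ τ → RankNoncrossing S′.rank S′.onBase σ → RankNoncrossing Poly.rank (λ _ → false) τ →
      RankNoncrossing S.rank S.onBase (glue σ τ)
    glue-rankNoncrossing σ τ cσ cτ = record { no-crossing = crossing-free ; base-interval = interval }
      where
      τ′ = pullback Poly.unrank τ
      cτ′ : RankNoncrossing toℕ (λ _ → false) τ′
      cτ′ = pullback-rankNoncrossing toℕ (λ _ → false) Poly.rank (λ _ → false) Poly.rank-injective Poly.unrank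
              (λ a b a<b → ℕP.<⇒≤ (subst₂ _<ℕ_ (sym (Poly.rank-unrank a)) (sym (Poly.rank-unrank b)) a<b)) (λ _ ()) τ cτ
      crossing-free : ∀ i j k l → S.rank i <ℕ S.rank j → S.rank j <ℕ S.rank k → S.rank k <ℕ S.rank l →
        T (labelRel σ τ (label i) (label k)) → T (labelRel σ τ (label j) (label l)) → T (labelRel σ τ (label i) (label j))
      crossing-free i j k l i<j j<k k<l i~k j~l with glue⇒Glued σ τ i k i~k | glue⇒Glued σ τ j l j~l
      ... | left-left xi xk li lk xi~xk | left-left xj xl lj ll xj~xl =
        Glued⇒glue σ τ i j (left-left xi xj li lj (no-crossing cσ xi xj xk xl (left-< li lj i<j) (left-< lj lk j<k) (left-< lk ll k<l) xi~xk xj~xl))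
      ... | left-left _ _ _ lk _ | right-right _ _ lj ll _ = ⊥-elim (left-not-between-right lj ll lk j<k k<l)
      ... | right-right _ _ li lk _ | left-left _ _ lj _ _ = ⊥-elim (left-not-between-right li lk lj i<j j<k)
      ... | right-right si sk li lk si~sk | right-right sj sl lj ll sj~sl = Glued⇒glue σ τ i j (right-right si sj li lj (polygon-case ll))
        where
        i≢Yk = below⇒≢Yk li ll (ℕP.<-trans i<j (ℕP.<-trans j<k k<l))
        j≢Yk = below⇒≢Yk lj ll (ℕP.<-trans j<k k<l)
        k≢Yk = below⇒≢Yk lk ll k<l
        si<sj = right-< li lj i≢Yk j≢Yk i<j
        sj<sk = right-< lj lk j≢Yk k≢Yk j<k
        -- Yk carries the label 0 of xL, which precedes all other labels: the crossing is then read from 0.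
        polygon-case : Labelled l (inj₂ sl) → T (rel τ′ si sj)
        polygon-case (is-right _ e) = no-crossing cτ′ si sj sk sl si<sj sj<sk (right-< lk ll k≢Yk (λ e′ → right≢Yk sl (trans e e′)) k<l) si~sk sj~sl
        polygon-case (is-Yk _) = from-zero si si<sj si~sk
          where
          from-zero : ∀ s → toℕ s <ℕ toℕ sj → T (rel τ′ s sk) → T (rel τ′ s sj)
          from-zero zero _ _ = symR τ′ sj zero sj~sl
          from-zero (suc s) s<sj s~sk = transR τ′ (suc s) zero sj
            (symR τ′ zero (suc s) (no-crossing cτ′ zero (suc s) sj sk (s≤s z≤n) s<sj sj<sk (symR τ′ sj zero sj~sl) s~sk)) (symR τ′ sj zero sj~sl)
      interval : ∀ i j k → S.rank i <ℕ S.rank j → S.rank j <ℕ S.rank k → T (S.onBase k) →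
        T (labelRel σ τ (label i) (label k)) → T (labelRel σ τ (label i) (label j))
      interval i j k i<j j<k k∈ i~k with glue⇒Glued σ τ i k i~k
      ... | right-right _ _ li _ _ = ⊥-elim (ℕP.<-irrefl refl (ℕP.<-≤-trans (ℕP.<-trans i<j j<k) (ℕP.≤-trans (base≤start k k∈) (proj₁ (right-interval li)))))
      ... | left-left xi xk li lk xi~xk with label j | label-spec j
      ...   | inj₂ _ | lj = ⊥-elim (ℕP.<-irrefl refl (ℕP.<-≤-trans j<k (ℕP.≤-trans (base≤start k k∈) (proj₁ (right-interval lj)))))
      ...   | inj₁ xj | lj = subst (λ u → T (labelRel σ τ u (inj₁ xj))) (sym (label-of li))
                             (base-interval cσ xi xj xk (left-< li lj i<j) (left-< lj lk j<k) (left-base⁻¹ lk k∈) xi~xk)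

    left-rankNoncrossing : ∀ π → RankNoncrossing S.rank S.onBase π → RankNoncrossing S′.rank S′.onBase (pullback left π)
    left-rankNoncrossing = pullback-rankNoncrossing S′.rank S′.onBase S.rank S.onBase S.rank-injective left
                             (λ a b a<b → ℕP.<⇒≤ (left-mono a b a<b)) Left.indexMap-base

    polygon-rankNoncrossing : ∀ π → RankNoncrossing S.rank S.onBase π → RankNoncrossing Poly.rank (λ _ → false) (pullback polygon π)
    polygon-rankNoncrossing = pullback-rankNoncrossing Poly.rank (λ _ → false) S.rank S.onBase S.rank-injective polygon
      (λ a b a<b → ℕP.<⇒≤ (subst₂ _<ℕ_ (sym (rank-polygon a)) (sym (rank-polygon b)) (ℕP.+-monoʳ-< start a<b))) (λ _ ())

    rankFin-unrank : ∀ s → Poly.rankFin (Poly.unrank s) ≡ s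
    rankFin-unrank s = FP.toℕ-injective (trans (Poly.toℕ-rankFin (Poly.unrank s)) (Poly.rank-unrank s))

    polygon-unrank : ∀ s → polygon (Poly.unrank s) ≡ right s
    polygon-unrank s = cong right (rankFin-unrank s)

    left-xm≡xP : left (X {m′} {κ} (fromℕ (suc m′))) ≡ xP
    left-xm≡xP = Left.indexMap-X (fromℕ (suc m′))

    left-not-glued-to-xL : ∀ σ τ x → ¬ T (labelRel σ τ (label xL) (label (left x)))
    left-not-glued-to-xL σ τ x xL~x rewrite label-right zero | label-left x = xL~x

    xL≺right-suc : ∀ s → xL S.≺ right (suc s)
    xL≺right-suc s = subst₂ _<ℕ_ (sym rank-xL) (sym (rank-right (suc s))) (ℕP.m<m+n start (s≤s z≤n))

    right≺Yk : ∀ s → right s S.≺ Yk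
    right≺Yk s = subst₂ _<ℕ_ (sym (rank-right s)) (sym rank-Yk) (ℕP.+-monoʳ-< start (FP.toℕ<n s))

    module _ (π : Partition N) (cnc : RankNoncrossing S.rank S.onBase π) (inB : InB C k (π , rankNoncrossing⇒noncrossing S.ranked π cnc)) where
      xL~Yk : T (rel π xL Yk)
      xL~Yk = proj₁ inB

      right-joined : ∀ {a s} → Labelled a (inj₂ s) → T (rel π a (right s))
      right-joined (is-right s refl) = reflR π (right s)
      right-joined (is-Yk refl) = symR π xL Yk xL~Yk

      -- the chord xL Yk separates the left part from the other right vertices
      left~right⇒left~xL : ∀ {a b x s} → Labelled a (inj₁ x) → Labelled b (inj₂ s) → T (rel π a b) → T (rel π a xL)
      left~right⇒left~xL {a} _ (is-Yk refl) a~Yk = transR π a Yk xL a~Yk (symR π xL Yk xL~Yk)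
      left~right⇒left~xL _ (is-right zero refl) a~xL = a~xL
      left~right⇒left~xL {a} la (is-right (suc s) refl) a~b with left-outside′ la
      ... | below a<start = no-crossing cnc a xL (right (suc s)) Yk (subst (S.rank a <ℕ_) (sym rank-xL) a<start) (xL≺right-suc s) (right≺Yk (suc s)) a~b xL~Yk
      ... | above end<a = transR π a _ xL a~b (symR π xL _ (no-crossing cnc xL (right (suc s)) Yk a (xL≺right-suc s) (right≺Yk (suc s))
                             (subst (_<ℕ S.rank a) (sym rank-Yk) end<a) xL~Yk (symR π a _ a~b)))

      left-right-unrelated : ∀ {a b x s} → Labelled a (inj₁ x) → Labelled b (inj₂ s) → ¬ T (rel π a b)
      left-right-unrelated la lb a~b = left≁xL la (left~right⇒left~xL la lb a~b)
        where
        left≁xL : ∀ {a x} → Labelled a (inj₁ x) → ¬ T (rel π a xL)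
        left≁xL (is-left x refl) x~xL with S′.view x
        ... | S′.isY j refl = proj₂ (proj₂ inB) (inject≤ j k≤n) (subst (_<ℕ κ) (sym (FP.toℕ-inject≤ j k≤n)) (FP.toℕ<n j))
                               (symR π _ xL (rel-subst π (Left.indexMap-Y j) refl x~xL))
        ... | S′.isX i refl = proj₁ (proj₂ inB) (xL~X⇒xL~xP π cnc (inject₁ i) Xi≢xL (symR π _ xL (rel-subst π (Left.indexMap-X i) refl x~xL)))
          where
          Xi≢xL : X {suc m′} {suc n′} (inject₁ i) ≢ xL
          Xi≢xL e = ℕP.<-irrefl (cong S.rank e) (ℕP.<-≤-trans (subst (_<ℕ start) (sym (trans (S.rank-X (inject₁ i)) (FP.toℕ-inject₁ i))) (FP.toℕ<n i)) (ℕP.≤-reflexive (sym rank-xL)))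

    B : Pre
    B = Sub (NCS C) (InB C k)

    split : Pre.Elt B → Pre.Elt (NCS C′ ⊗ NC q)
    split ((π , nc) , _) =
        (pullback left π , rankNoncrossing⇒noncrossing S′.ranked _ (left-rankNoncrossing π cnc))
      , (pullback polygon π , rankNoncrossing⇒noncrossing Poly.ranked _ (polygon-rankNoncrossing π cnc))
      where cnc = noncrossing⇒rankNoncrossing S.ranked π nc

    glue-InB : ∀ σ τ (nc : NonCrossing (pos C) (glue σ τ)) → InB C k (glue σ τ , nc)
    glue-InB σ τ nc =
        Glued⇒glue σ τ xL Yk (right-right zero zero (is-right zero refl) (is-Yk refl) (reflR τ (Poly.unrank zero)))
      , (λ xL~xP → left-not-glued-to-xL σ τ (X {m′} {κ} (fromℕ (suc m′))) (subst (λ w → T (labelRel σ τ (label xL) (label w))) (sym left-xm≡xP) xL~xP))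
      , (λ j j<k xL~Yj → left-not-glued-to-xL σ τ (Y {m′} {κ} (fromℕ< j<k)) (subst (λ w → T (labelRel σ τ (label xL) (label w))) (sym (left-Y j j<k)) xL~Yj))
      where
      left-Y : ∀ j (j<k : toℕ j <ℕ κ) → left (Y {m′} {κ} (fromℕ< j<k)) ≡ Y {suc m′} {suc n′} j
      left-Y j j<k = trans (Left.indexMap-Y _) (cong (Y {suc m′} {suc n′}) (FP.toℕ-injective (trans (FP.toℕ-inject≤ (fromℕ< j<k) k≤n) (FP.toℕ-fromℕ< j<k))))

    glue-pair : Pre.Elt (NCS C′ ⊗ NC q) → Pre.Elt B
    glue-pair ((σ , ncσ) , (τ , ncτ)) = (glue σ τ , nc) , glue-InB σ τ nc
      where
      nc = rankNoncrossing⇒noncrossing S.ranked (glue σ τ)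
             (glue-rankNoncrossing σ τ (noncrossing⇒rankNoncrossing S′.ranked σ ncσ) (noncrossing⇒rankNoncrossing Poly.ranked τ ncτ))

    glue-mono : ∀ σ τ σ′ τ′ → (∀ i j → T (rel σ i j) → T (rel σ′ i j)) → (∀ i j → T (rel τ i j) → T (rel τ′ i j)) →
      ∀ a b → T (labelRel σ τ (label a) (label b)) → T (labelRel σ′ τ′ (label a) (label b))
    glue-mono σ τ σ′ τ′ σ⊑σ′ τ⊑τ′ a b a~b with glue⇒Glued σ τ a b a~b
    ... | left-left x y la lb x~y = Glued⇒glue σ′ τ′ a b (left-left x y la lb (σ⊑σ′ x y x~y))
    ... | right-right s t la lb s~t = Glued⇒glue σ′ τ′ a b (right-right s t la lb (τ⊑τ′ _ _ s~t))

    glue-split : ∀ π nc inB → Equiv B (glue-pair (split ((π , nc) , inB))) ((π , nc) , inB)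
    glue-split π nc inB = glued⊑π , π⊑glued
      where
      cnc = noncrossing⇒rankNoncrossing S.ranked π nc
      σ = pullback left π
      τ = pullback polygon π
      glued⊑π : ∀ a b → T (labelRel σ τ (label a) (label b)) → T (rel π a b)
      glued⊑π a b a~b with glue⇒Glued σ τ a b a~b
      ... | left-left x y (is-left _ refl) (is-left _ refl) x~y = x~y
      ... | right-right s t la lb s~t =
        transR π a (right s) b (right-joined π cnc inB la)
          (transR π (right s) (right t) b (rel-subst π (polygon-unrank s) (polygon-unrank t) s~t) (symR π b (right t) (right-joined π cnc inB lb)))
      π⊑glued : ∀ a b → T (rel π a b) → T (labelRel σ τ (label a) (label b))
      π⊑glued a b a~b with label a | label-spec a | label b | label-spec b
      ... | inj₁ x | is-left _ refl | inj₁ y | is-left _ refl = a~b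
      ... | inj₂ s | la | inj₂ t | lb = rel-subst π (sym (polygon-unrank s)) (sym (polygon-unrank t))
              (transR π (right s) a (right t) (symR π a (right s) (right-joined π cnc inB la)) (transR π a b (right t) a~b (right-joined π cnc inB lb)))
      ... | inj₁ x | la | inj₂ t | lb = ⊥-elim (left-right-unrelated π cnc inB la lb a~b)
      ... | inj₂ s | la | inj₁ y | lb = ⊥-elim (left-right-unrelated π cnc inB lb la (symR π a b a~b))

    split-glue : ∀ σ ncσ τ ncτ → Equiv (NCS C′ ⊗ NC q) (split (glue-pair ((σ , ncσ) , (τ , ncτ)))) ((σ , ncσ) , (τ , ncτ))
    split-glue σ ncσ τ ncτ = (left⊑σ , polygon⊑τ) , (σ⊑left , τ⊑polygon)
      where
      left⊑σ : ∀ x y → T (labelRel σ τ (label (left x)) (label (left y))) → T (rel σ x y)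
      left⊑σ x y x~y rewrite label-left x | label-left y = x~y
      σ⊑left : ∀ x y → T (rel σ x y) → T (labelRel σ τ (label (left x)) (label (left y)))
      σ⊑left x y x~y rewrite label-left x | label-left y = x~y
      polygon⊑τ : ∀ x y → T (labelRel σ τ (label (polygon x)) (label (polygon y))) → T (rel τ x y)
      polygon⊑τ x y x~y rewrite label-right (Poly.rankFin x) | label-right (Poly.rankFin y) | Poly.unrank-rankFin x | Poly.unrank-rankFin y = x~y
      τ⊑polygon : ∀ x y → T (rel τ x y) → T (labelRel σ τ (label (polygon x)) (label (polygon y)))
      τ⊑polygon x y x~y rewrite label-right (Poly.rankFin x) | label-right (Poly.rankFin y) | Poly.unrank-rankFin x | Poly.unrank-rankFin y = x~y

    B≅NC×NC : B ≅ (NCS C′ ⊗ NC q)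
    B≅NC×NC = record
      { to = split
      ; from = glue-pair
      ; to-mono = λ { ((π , _) , _) ((μ , _) , _) π⊑μ → (λ x y x~y → π⊑μ (left x) (left y) x~y) , (λ x y x~y → π⊑μ (polygon x) (polygon y) x~y) }
      ; from-mono = λ { ((σ , _) , (τ , _)) ((σ′ , _) , (τ′ , _)) (σ⊑σ′ , τ⊑τ′) → glue-mono σ τ σ′ τ′ σ⊑σ′ τ⊑τ′ }
      ; from-to = λ { ((π , nc) , inB) → glue-split π nc inB }
      ; to-from = λ { ((σ , ncσ) , (τ , ncτ)) → split-glue σ ncσ τ ncτ } }

  B≅NC×NC : ∀ {m′ n′ r} (k : Fin (suc n′)) (C : SemiConf (suc m′) (suc n′)) (C′ : SemiConf m′ (toℕ k)) (q : Fin r → Pt) →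
    ConvexPosition q → r ≡ suc n′ ∸ toℕ k → Sub (NCS C) (InB C k) ≅ (NCS C′ ⊗ NC q)
  B≅NC×NC {r = zero} k C C′ q _ 0≡n-k = ⊥-elim (ℕP.0≢1+n (trans 0≡n-k (ℕP.+-∸-assoc 1 (ℕP.≤-pred (FP.toℕ<n k)))))
  B≅NC×NC {r = suc r′} k C C′ q convex r≡n-k = IsoB.B≅NC×NC k C C′ q convex r≡n-k

open import Data.Nat using (_≤_)

lemma4p1 : (F : OrderedField) → let open Geometry F in
  (m n : ℕ) → 1 ≤ m → 1 ≤ n → (C : SemiConf m n) →
    -- (1) A ≅ NC(S_{m-1,n}) × Bool(1)
    ((C′ : SemiConf (m ∸ 1) n) → Sub (NCS C) (InA C) ≅ (NCS C′ ⊗ Bool1))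
  × -- (2) B_k ≅ NC(S_{m-1,k-1}) × NC(n-k+1)   (k 0-based here)
    ((k : Fin n) → (C′ : SemiConf (m ∸ 1) (toℕ k)) →
      (q : Fin (n ∸ toℕ k) → Pt) → ConvexPosition q →
      Sub (NCS C) (InB C k) ≅ (NCS C′ ⊗ NC q))
  × -- NC(S_{m,n}) is the disjoint union of A, B_1, ..., B_n
    ((π : Pre.Elt (NCS C)) →
        (InA C π ⊎ Σ (Fin n) (λ k → InB C k π))
      × (InA C π → (k : Fin n) → ¬ InB C k π)
      × ((k l : Fin n) → InB C k π → InB C l π → k ≡ l))
lemma4p1 F (suc m′) (suc n′) _ _ C =
    (λ C′ → IsoA.A≅NC×Bool C C′)
  , (λ k C′ q convex → B≅NC×NC k C C′ q convex refl)
  , decomposition C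
  where open IsomorphismB F
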